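{- For every integer $n\geq 4$ and every $i\in[n]$, the following hold: \begin{align*} |\mathrm{VPF}_n|&= \sum_{i=1}^n|\mathrm{VPF}_{n,i}|,\\ |\mathrm{VPF}_{n,i}|&= |\mathrm{VPF}_{n,(i)}|+|\mathrm{VPF}_{n,[i]}|,\\ |\mathrm{VPF}_{n,(i)}|&= |\mathrm{VPF}_{n-1}|+(n-i)|\mathrm{VPF}_{n-2}|+\sum_{\ell=i}^{n-2}(\ell+1-i)|\mathrm{VPF}_{n-2, (\ell)}|,\\ |\mathrm{VPF}_{n,[i]}|&= \frac{(i-1)(i-2)}{2}|\mathrm{VPF}_{n-3}|+\sum_{\ell=1}^{i-1}|\mathrm{VPF}_{n-1,[\ell]}|+(i-1)\sum_{\ell=1}^{i-2}|\mathrm{VPF}_{n-2,\ell}|\\ &\qquad+\sum_{\ell=1}^{i-3}\frac{\ell(\ell+1)}{2}|\mathrm{VPF}_{n-3, (\ell)}|+\frac{(i-2)(i-1)}{2}\sum_{\ell=i-2}^{n-3}|\mathrm{VPF}_{n-3, (\ell)}|, \end{align*} (empty sums being $0$), with initial values $|\mathrm{VPF}_{1, (1)}|=|\mathrm{VPF}_{2, (2)}|=1$, $|\mathrm{VPF}_{2, (1)}|=2$, $|\mathrm{VPF}_{3, (1)}|=7$, $|\mathrm{VPF}_{3, (2)}|=5$, $|\mathrm{VPF}_{3, (3)}|=4$, and $|\mathrm{VPF}_{1, [1]}|=|\mathrm{VPF}_{2, [1]}|=|\mathrm{VPF}_{3, [1]}|=|\mathrm{VPF}_{3, [2]}|=0$,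 $|\mathrm{VPF}_{2, [2]}|=1$, $|\mathrm{VPF}_{3, [3]}|=4$.
   Context: For $n\in\mathbb{N}$ let $[n]=\{1,\dots,n\}$. A preference list $\alpha=(a_1,\dots,a_n)\in[n]^n$ describes $n$ cars entering, in order $i=1,\dots,n$, a one-way street with spots $1,\dots,n$; car $i$ prefers spot $a_i$. Under the (1-)vacillating parking rule, car $i$ parks in spot $a_i$ if unoccupied; otherwise in spot $a_i-1$ if it exists and is unoccupied; otherwise in spot $a_i+1$ if it exists and is unoccupied; otherwise it fails to park. If all cars park, $\alpha$ is a vacillating parking function of length $n$; $\mathrm{VPF}_n$ is the set of these. For $i\in[n]$: $\mathrm{VPF}_{n,i}$ is the set of $\alpha\in\mathrm{VPF}_n$ in which spot $n$ is occupied by car $i$; $\mathrm{VPF}_{n,(i)}$ is the set of $\alpha\in\mathrm{VPF}_n$ in which car $i$ prefers spot $n$ and parks in spot $n$; $\mathrm{VPF}_{n,[i]}$ is the set of $\alpha\in\mathrm{VPF}_n$ in which car $i$ prefers spot $n-1$ and parks in spot $n$. -}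

module Defs where

open import Data.Bool using (Bool; true; false; not; _∧_; if_then_else_)
open import Data.Nat using (ℕ; zero; suc; _+_; _∸_; _≡ᵇ_; _≤ᵇ_; _<ᵇ_)
open import Data.List using (List; []; _∷_; _++_; [_]; map; concatMap; length; filterᵇ; upTo)
open import Data.Nat.ListAction using (sum)
open import Data.Maybe using (Maybe; just; nothing)

-- Spots and cars are 1-based natural numbers.

-- range a b = [a, a+1, ..., b]  (empty if b < a)
range : ℕ → ℕ → List ℕ
range a b = map (a +_) (upTo (suc b ∸ a))

sumRange : ℕ → ℕ → (ℕ → ℕ) → ℕ
sumRange a b f = sum (map f (range a b))

prefs : ℕ → ℕ → List (List ℕ)
prefs n zero    = [] ∷ []
prefs n (suc k) = concatMap (λ a → map (a ∷_) (prefs n k)) (range 1 n)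

PrefLists : ℕ → List (List ℕ)
PrefLists n = prefs n n

isOcc : ℕ → List ℕ → Bool
isOcc s []       = false
isOcc s (t ∷ ts) = if s ≡ᵇ t then true else isOcc s ts

spot : ℕ → List ℕ → ℕ → Maybe ℕ
spot n occ a =
  if not (isOcc a occ) then just a
  else if (2 ≤ᵇ a) ∧ not (isOcc (a ∸ 1) occ) then just (a ∸ 1)
  else if (a <ᵇ n) ∧ not (isOcc (suc a) occ) then just (suc a)
  else nothing

-- park n acc as : acc = spots of the cars already parked (in car order);
-- result = list whose j-th entry is the spot of car j, or nothing if some car fails
park : ℕ → List ℕ → List ℕ → Maybe (List ℕ)
park n acc []       = just acc
park n acc (a ∷ as) with spot n acc a
... | nothing = nothing
... | just s  = park n (acc ++ [ s ]) as

outcome : ℕ → List ℕ → Maybe (List ℕ)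
outcome n α = park n [] α

-- 1-based lookup
at : List ℕ → ℕ → Maybe ℕ
at []       _             = nothing
at (x ∷ xs) zero          = nothing
at (x ∷ xs) (suc zero)    = just x
at (x ∷ xs) (suc (suc i)) = at xs (suc i)

isJustN : Maybe ℕ → ℕ → Bool
isJustN nothing  m = false
isJustN (just k) m = k ≡ᵇ m

isVPF : ℕ → List ℕ → Bool
isVPF n α with outcome n α
... | nothing = false
... | just _  = true

parksAt : ℕ → List ℕ → ℕ → ℕ → Bool
parksAt n α i s with outcome n α
... | nothing = false
... | just ps  = isJustN (at ps i) s

-- α ∈ VPF_{n,i}: spot n is occupied by car i
inVPFi : ℕ → ℕ → List ℕ → Bool
inVPFi n i α = parksAt n α i n

-- α ∈ VPF_{n,(i)}: car i prefers spot n and parks in spot n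
inVPFround : ℕ → ℕ → List ℕ → Bool
inVPFround n i α = isJustN (at α i) n ∧ parksAt n α i n

-- α ∈ VPF_{n,[i]}: car i prefers spot n-1 and parks in spot n
inVPFsquare : ℕ → ℕ → List ℕ → Bool
inVPFsquare n i α = isJustN (at α i) (n ∸ 1) ∧ parksAt n α i n

count : ℕ → (List ℕ → Bool) → ℕ
count n p = length (filterᵇ p (PrefLists n))

vpf : ℕ → ℕ
vpf n = count n (isVPF n)

vpfI : ℕ → ℕ → ℕ
vpfI n i = count n (inVPFi n i)

vpfR : ℕ → ℕ → ℕ
vpfR n i = count n (inVPFround n i)

vpfS : ℕ → ℕ → ℕ
vpfS n i = count n (inVPFsquare n i)

-- Every count in the theorem is a sum, over all preference lists, of the indicator that a
-- single parking run succeeds while each car satisfies a constraint on its pair (preferred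
-- spot, final spot).  Spot n can only be taken by a car preferring n or n - 1, which gives
-- the first two identities.  For the recurrences one deletes the car in the last spot.  Once
-- the last spot is filled, a car that prefers it and finds it taken behaves exactly like a
-- car that prefers the previous spot and finds that one free, so the rest of the run is a
-- run on one spot fewer; deleting the car itself renumbers the later cars.  Classifying the
-- shorter runs by the car that takes their own last spot gives
-- |VPF_{p+1,(J)}| = |VPF_p| + sum_{k >= J} |VPF_{p,(k)}| and a similar decomposition of
-- |VPF_{p+1,[i]}|.  Iterating these and exchanging the order of the resulting double sums
-- produces the coefficients (l + 1 - i) and the triangular numbers l (l + 1) / 2.

module Submission where

open import Defs
open import Data.Bool using (Bool; true; false; not; _∧_; _∨_; if_then_else_)
open import Data.Bool.Properties using (∧-assoc; ∧-comm; ∧-zeroʳ; ∧-identityʳ; ∨-zeroʳ; ∨-identityʳ)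
open import Data.Nat
open import Data.Nat.Properties
open import Algebra.Properties.CommutativeSemigroup +-commutativeSemigroup using () renaming (interchange to +-interchange)
open import Data.Nat.DivMod using (_/_; m*n/n≡m)
open import Data.Nat.ListAction using (sum)
open import Data.Nat.Solver using (module +-*-Solver)
open import Data.Nat.ListAction.Properties using (sum-++)
open import Data.List using (List; []; _∷_; _++_; [_]; map; concatMap; length; filterᵇ; applyUpTo)
open import Data.List.Properties using (map-++; length-++; map-cong; map-∘; map-applyUpTo)
open import Data.List.Relation.Unary.All using (All; []; _∷_)
open import Data.Maybe using (Maybe; just; nothing; is-just)
open import Data.Maybe.Properties using (just-injective)
open import Function using (_⟨_⟩_)
open import Data.Product using (_×_; _,_; proj₁; proj₂)
open import Data.Sum using (_⊎_; inj₁; inj₂)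
open import Data.Empty using (⊥; ⊥-elim)
open import Relation.Nullary using (yes; no; contradiction)
open import Relation.Binary.PropositionalEquality hiding ([_])
open ≡-Reasoning

≡ᵇ-refl : ∀ n → (n ≡ᵇ n) ≡ true
≡ᵇ-refl zero = refl
≡ᵇ-refl (suc n) = ≡ᵇ-refl n

≡ᵇ≡true⇒≡ : ∀ m n → (m ≡ᵇ n) ≡ true → m ≡ n
≡ᵇ≡true⇒≡ zero zero e = refl
≡ᵇ≡true⇒≡ (suc m) (suc n) e = cong suc (≡ᵇ≡true⇒≡ m n e)

≡ᵇ≡false⇒≢ : ∀ m n → (m ≡ᵇ n) ≡ false → m ≢ n
≡ᵇ≡false⇒≢ zero zero () refl
≡ᵇ≡false⇒≢ (suc m) (suc .m) e refl = ≡ᵇ≡false⇒≢ m m e refl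

≢⇒≡ᵇ≡false : ∀ m n → m ≢ n → (m ≡ᵇ n) ≡ false
≢⇒≡ᵇ≡false zero zero ne = ⊥-elim (ne refl)
≢⇒≡ᵇ≡false zero (suc n) ne = refl
≢⇒≡ᵇ≡false (suc m) zero ne = refl
≢⇒≡ᵇ≡false (suc m) (suc n) ne = ≢⇒≡ᵇ≡false m n (λ e → ne (cong suc e))

<ᵇ≡true⇒< : ∀ m n → (m <ᵇ n) ≡ true → m < n
<ᵇ≡true⇒< zero (suc n) e = s≤s z≤n
<ᵇ≡true⇒< (suc m) (suc n) e = s≤s (<ᵇ≡true⇒< m n e)

<ᵇ≡false⇒≥ : ∀ m n → (m <ᵇ n) ≡ false → n ≤ m
<ᵇ≡false⇒≥ m zero e = z≤n
<ᵇ≡false⇒≥ zero (suc n) ()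
<ᵇ≡false⇒≥ (suc m) (suc n) e = s≤s (<ᵇ≡false⇒≥ m n e)

<⇒<ᵇ≡true : ∀ m n → m < n → (m <ᵇ n) ≡ true
<⇒<ᵇ≡true zero (suc n) _ = refl
<⇒<ᵇ≡true (suc m) (suc n) (s≤s h) = <⇒<ᵇ≡true m n h

≥⇒<ᵇ≡false : ∀ m n → n ≤ m → (m <ᵇ n) ≡ false
≥⇒<ᵇ≡false m zero _ = refl
≥⇒<ᵇ≡false (suc m) (suc n) (s≤s h) = ≥⇒<ᵇ≡false m n h

≤⇒≤ᵇ≡true : ∀ j ℓ → j ≤ ℓ → (j ≤ᵇ ℓ) ≡ true
≤⇒≤ᵇ≡true zero ℓ _ = refl
≤⇒≤ᵇ≡true (suc j) ℓ h = <⇒<ᵇ≡true j ℓ h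

>⇒≤ᵇ≡false : ∀ j ℓ → ℓ < j → (j ≤ᵇ ℓ) ≡ false
>⇒≤ᵇ≡false (suc j) ℓ h = ≥⇒<ᵇ≡false j ℓ (≤-pred h)

<ᵇ-cases : ∀ j J → (((j <ᵇ J) ≡ true) × j < J) ⊎ (((j <ᵇ J) ≡ false) × J ≤ j)
<ᵇ-cases j J with j <ᵇ J in e
... | true = inj₁ (refl , <ᵇ≡true⇒< j J e)
... | false = inj₂ (refl , <ᵇ≡false⇒≥ j J e)

∧≡true⇒ˡ : ∀ x y → x ∧ y ≡ true → x ≡ true
∧≡true⇒ˡ true y e = refl

∧≡true⇒ʳ : ∀ x y → x ∧ y ≡ true → y ≡ true
∧≡true⇒ʳ true y e = e

∧-swapˡ : ∀ x y z → x ∧ (y ∧ z) ≡ y ∧ (x ∧ z)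
∧-swapˡ x y z = trans (sym (∧-assoc x y z)) (trans (cong (_∧ z) (∧-comm x y)) (∧-assoc y x z))

x∧¬b∧b≡false : ∀ x b → (x ∧ not b) ∧ b ≡ false
x∧¬b∧b≡false x true = trans (∧-identityʳ (x ∧ false)) (∧-zeroʳ x)
x∧¬b∧b≡false x false = ∧-zeroʳ (x ∧ true)

𝟙 : Bool → ℕ
𝟙 true = 1
𝟙 false = 0

𝟙-not≡0⇒true : ∀ b → 𝟙 (not b) ≡ 0 → b ≡ true
𝟙-not≡0⇒true true _ = refl

𝟙-∧-split : ∀ x p q1 q2 r → 𝟙 p ≡ 𝟙 q1 + 𝟙 q2 → 𝟙 ((x ∧ p) ∧ r) ≡ 𝟙 ((x ∧ q1) ∧ r) + 𝟙 ((x ∧ q2) ∧ r)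
𝟙-∧-split false p q1 q2 r h = refl
𝟙-∧-split true p q1 q2 false h = trans (cong 𝟙 (∧-zeroʳ p)) (sym (cong₂ _+_ (cong 𝟙 (∧-zeroʳ q1)) (cong 𝟙 (∧-zeroʳ q2))))
𝟙-∧-split true p q1 q2 true h = trans (cong 𝟙 (∧-identityʳ p)) (trans h (sym (cong₂ _+_ (cong 𝟙 (∧-identityʳ q1)) (cong 𝟙 (∧-identityʳ q2)))))

if-then-0-cong : ∀ (b : Bool) {x y : ℕ} → x ≡ y → (if b then x else 0) ≡ (if b then y else 0)
if-then-0-cong b refl = refl

if-then-0-+ : ∀ (b : Bool) x y → (if b then x + y else 0) ≡ (if b then x else 0) + (if b then y else 0)
if-then-0-+ true x y = refl
if-then-0-+ false x y = refl

-- Finite sums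

sumFrom : ℕ → ℕ → (ℕ → ℕ) → ℕ
sumFrom a zero f = 0
sumFrom a (suc k) f = f a + sumFrom (suc a) k f

applyUpTo-cong : ∀ {A : Set} (h h' : ℕ → A) k → (∀ x → h x ≡ h' x) → applyUpTo h k ≡ applyUpTo h' k
applyUpTo-cong h h' zero e = refl
applyUpTo-cong h h' (suc k) e = cong₂ _∷_ (e 0) (applyUpTo-cong (λ x → h (suc x)) (λ x → h' (suc x)) k (λ x → e (suc x)))

sum-applyUpTo≡sumFrom : ∀ a k f → sum (applyUpTo (λ x → f (a + x)) k) ≡ sumFrom a k f
sum-applyUpTo≡sumFrom a zero f = refl
sum-applyUpTo≡sumFrom a (suc k) f = cong₂ _+_ (cong f (+-identityʳ a))
  (trans (cong sum (applyUpTo-cong _ (λ x → f (suc a + x)) k (λ x → cong f (+-suc a x)))) (sum-applyUpTo≡sumFrom (suc a) k f))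

sumRange≡sumFrom : ∀ a b f → sumRange a b f ≡ sumFrom a (suc b ∸ a) f
sumRange≡sumFrom a b f = begin
  sum (map f (map (a +_) (applyUpTo (λ x → x) (suc b ∸ a))))
    ≡⟨ cong sum (cong (map f) (map-applyUpTo (λ x → x) (a +_) (suc b ∸ a))) ⟩
  sum (map f (applyUpTo (λ x → a + x) (suc b ∸ a)))
    ≡⟨ cong sum (map-applyUpTo (λ x → a + x) f (suc b ∸ a)) ⟩
  sum (applyUpTo (λ x → f (a + x)) (suc b ∸ a))
    ≡⟨ sum-applyUpTo≡sumFrom a (suc b ∸ a) f ⟩
  sumFrom a (suc b ∸ a) f ∎

sumFrom-cong : ∀ a k f g → (∀ j → a ≤ j → j < a + k → f j ≡ g j) → sumFrom a k f ≡ sumFrom a k g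
sumFrom-cong a zero f g e = refl
sumFrom-cong a (suc k) f g e = cong₂ _+_ (e a ≤-refl (subst (a <_) (sym (+-suc a k)) (s≤s (m≤m+n a k))))
  (sumFrom-cong (suc a) k f g (λ j a<j j<ak → e j (<⇒≤ a<j) (subst (j <_) (sym (+-suc a k)) j<ak)))

sumFrom-+ : ∀ a k f g → sumFrom a k (λ j → f j + g j) ≡ sumFrom a k f + sumFrom a k g
sumFrom-+ a zero f g = refl
sumFrom-+ a (suc k) f g = trans (cong (f a + g a +_) (sumFrom-+ (suc a) k f g)) (+-interchange (f a) (g a) _ _)

sumFrom-*ˡ : ∀ c a k f → sumFrom a k (λ j → c * f j) ≡ c * sumFrom a k f
sumFrom-*ˡ c a zero f = sym (*-zeroʳ c)
sumFrom-*ˡ c a (suc k) f = trans (cong (c * f a +_) (sumFrom-*ˡ c (suc a) k f)) (sym (*-distribˡ-+ c (f a) _))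

sumFrom-*ʳ : ∀ a k (f : ℕ → ℕ) c → sumFrom a k (λ j → f j * c) ≡ sumFrom a k f * c
sumFrom-*ʳ a k f c = trans (sumFrom-cong a k _ _ (λ j _ _ → *-comm (f j) c)) (trans (sumFrom-*ˡ c a k f) (*-comm c _))

sumFrom-0 : ∀ a k → sumFrom a k (λ _ → 0) ≡ 0
sumFrom-0 a zero = refl
sumFrom-0 a (suc k) = sumFrom-0 (suc a) k

sumFrom-const : ∀ a k c → sumFrom a k (λ _ → c) ≡ k * c
sumFrom-const a zero c = refl
sumFrom-const a (suc k) c = cong (c +_) (sumFrom-const (suc a) k c)

sumFrom-split : ∀ a k l f → sumFrom a (k + l) f ≡ sumFrom a k f + sumFrom (a + k) l f
sumFrom-split a zero l f = cong (λ z → sumFrom z l f) (sym (+-identityʳ a))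
sumFrom-split a (suc k) l f = trans (cong (f a +_) (trans (sumFrom-split (suc a) k l f) (cong (λ z → sumFrom (suc a) k f + sumFrom z l f) (sym (+-suc a k)))))
  (sym (+-assoc (f a) _ _))

sumFrom-suc : ∀ a k f → sumFrom a (suc k) f ≡ sumFrom a k f + f (a + k)
sumFrom-suc a k f = trans (cong (λ z → sumFrom a z f) (+-comm 1 k)) (trans (sumFrom-split a k 1 f) (cong (sumFrom a k f +_) (+-identityʳ _)))

sumFrom-swap : ∀ a k b l (F : ℕ → ℕ → ℕ) → sumFrom a k (λ i → sumFrom b l (λ j → F i j)) ≡ sumFrom b l (λ j → sumFrom a k (λ i → F i j))
sumFrom-swap a zero b l F = sym (sumFrom-0 b l)
sumFrom-swap a (suc k) b l F = begin
  sumFrom b l (λ j → F a j) + sumFrom (suc a) k (λ i → sumFrom b l (λ j → F i j))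
    ≡⟨ cong (sumFrom b l (λ j → F a j) +_) (sumFrom-swap (suc a) k b l F) ⟩
  sumFrom b l (λ j → F a j) + sumFrom b l (λ j → sumFrom (suc a) k (λ i → F i j))
    ≡⟨ sym (sumFrom-+ b l _ _) ⟩
  sumFrom b l (λ j → F a j + sumFrom (suc a) k (λ i → F i j)) ∎

sumFrom-truncate : ∀ a L L' (F : ℕ → ℕ) → L' ≤ L → (∀ ℓ → a + L' ≤ ℓ → ℓ < a + L → F ℓ ≡ 0) → sumFrom a L F ≡ sumFrom a L' F
sumFrom-truncate a L L' F h z = trans (cong (λ x → sumFrom a x F) (sym (m+[n∸m]≡n h))) (trans (sumFrom-split a L' (L ∸ L') F)
  (trans (cong (sumFrom a L' F +_) (trans (sumFrom-cong (a + L') (L ∸ L') F (λ _ → 0) (λ ℓ h1 h2 → z ℓ h1 (subst (ℓ <_) (trans (+-assoc a L' _) (cong (a +_) (m+[n∸m]≡n h))) h2))) (sumFrom-0 (a + L') (L ∸ L')))) (+-identityʳ _)))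

sumFrom-split-at : ∀ p J f → 1 ≤ J → J ≤ suc p → sumFrom 1 p f ≡ sumFrom 1 (J ∸ 1) f + sumFrom J (suc p ∸ J) f
sumFrom-split-at p (suc J') f _ J≤ = trans (cong (λ z → sumFrom 1 z f) (sym e)) (sumFrom-split 1 J' (suc p ∸ suc J') f)
  where
  e : J' + (suc p ∸ suc J') ≡ p
  e = m+[n∸m]≡n (≤-pred J≤)

sumFrom-window : ∀ i j u (f : ℕ → ℕ) → i ≤ j → j ≤ u → sumFrom j (u ∸ j) f ≡ sumFrom i (u ∸ i) (λ ℓ → if j ≤ᵇ ℓ then f ℓ else 0)
sumFrom-window i j u f i≤j j≤u = sym (begin
  sumFrom i (u ∸ i) g ≡⟨ cong (λ z → sumFrom i z g) eL ⟩
  sumFrom i ((j ∸ i) + (u ∸ j)) g ≡⟨ sumFrom-split i (j ∸ i) (u ∸ j) g ⟩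
  sumFrom i (j ∸ i) g + sumFrom (i + (j ∸ i)) (u ∸ j) g ≡⟨ cong₂ _+_ z1 (cong (λ z → sumFrom z (u ∸ j) g) (m+[n∸m]≡n i≤j)) ⟩
  0 + sumFrom j (u ∸ j) g ≡⟨ sumFrom-cong j (u ∸ j) g f (λ ℓ h1 _ → cong (λ b → if b then f ℓ else 0) (≤⇒≤ᵇ≡true j ℓ h1)) ⟩
  sumFrom j (u ∸ j) f ∎)
  where
  g : ℕ → ℕ
  g ℓ = if j ≤ᵇ ℓ then f ℓ else 0
  eL : u ∸ i ≡ (j ∸ i) + (u ∸ j)
  eL = trans (cong (_∸ i) (sym (trans (sym (+-assoc i (j ∸ i) (u ∸ j))) (trans (cong (_+ (u ∸ j)) (m+[n∸m]≡n i≤j)) (m+[n∸m]≡n j≤u))))) (m+n∸m≡n i _)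
  z1 : sumFrom i (j ∸ i) g ≡ 0
  z1 = trans (sumFrom-cong i (j ∸ i) g (λ _ → 0) (λ ℓ _ h2 → cong (λ b → if b then f ℓ else 0) (>⇒≤ᵇ≡false j ℓ (subst (ℓ <_) (m+[n∸m]≡n i≤j) h2)))) (sumFrom-0 i (j ∸ i))

sumFrom-≤ᵇ-truncate : ∀ a k ℓ (w : ℕ → ℕ) → a ≤ suc ℓ → suc ℓ ≤ a + k → sumFrom a k (λ j → if j ≤ᵇ ℓ then w j else 0) ≡ sumFrom a (suc ℓ ∸ a) w
sumFrom-≤ᵇ-truncate a k ℓ w h1 h2 = trans (sumFrom-truncate a k (suc ℓ ∸ a) _ L'≤ (λ j j1 j2 → cong (λ b → if b then w j else 0) (>⇒≤ᵇ≡false j ℓ (subst (_≤ j) (m+[n∸m]≡n h1) j1))))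
  (sumFrom-cong a (suc ℓ ∸ a) _ w (λ j _ j2 → cong (λ b → if b then w j else 0) (≤⇒≤ᵇ≡true j ℓ (≤-pred (subst (j <_) (m+[n∸m]≡n h1) j2)))))
  where
  L'≤ : suc ℓ ∸ a ≤ k
  L'≤ = subst (suc ℓ ∸ a ≤_) (m+n∸m≡n a k) (∸-monoˡ-≤ a h2)

sumFrom-≤ᵇ-all : ∀ a k ℓ (w : ℕ → ℕ) → a + k ≤ suc ℓ → sumFrom a k (λ j → if j ≤ᵇ ℓ then w j else 0) ≡ sumFrom a k w
sumFrom-≤ᵇ-all a k ℓ w h = sumFrom-cong a k _ w (λ j _ j2 → cong (λ b → if b then w j else 0) (≤⇒≤ᵇ≡true j ℓ (≤-pred (≤-trans j2 h))))

sumFrom-tail-swap : ∀ a k u (w f : ℕ → ℕ) → a + k ≤ suc u → sumFrom a k (λ j → w j * sumFrom j (u ∸ j) f) ≡ sumFrom a (u ∸ a) (λ ℓ → sumFrom a k (λ j → if j ≤ᵇ ℓ then w j else 0) * f ℓ)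
sumFrom-tail-swap a k u w f h = begin
  sumFrom a k (λ j → w j * sumFrom j (u ∸ j) f)
    ≡⟨ sumFrom-cong a k _ _ (λ j j1 j2 → cong (w j *_) (sumFrom-window a j u f j1 (≤-pred (≤-trans j2 h)))) ⟩
  sumFrom a k (λ j → w j * sumFrom a (u ∸ a) (λ ℓ → if j ≤ᵇ ℓ then f ℓ else 0))
    ≡⟨ sumFrom-cong a k _ _ (λ j _ _ → sym (sumFrom-*ˡ (w j) a (u ∸ a) _)) ⟩
  sumFrom a k (λ j → sumFrom a (u ∸ a) (λ ℓ → w j * (if j ≤ᵇ ℓ then f ℓ else 0)))
    ≡⟨ sumFrom-swap a k a (u ∸ a) (λ j ℓ → w j * (if j ≤ᵇ ℓ then f ℓ else 0)) ⟩
  sumFrom a (u ∸ a) (λ ℓ → sumFrom a k (λ j → w j * (if j ≤ᵇ ℓ then f ℓ else 0)))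
    ≡⟨ sumFrom-cong a (u ∸ a) _ _ (λ ℓ _ _ → trans (sumFrom-cong a k _ _ (λ j _ _ → pw j ℓ)) (sumFrom-*ʳ a k _ (f ℓ))) ⟩
  sumFrom a (u ∸ a) (λ ℓ → sumFrom a k (λ j → if j ≤ᵇ ℓ then w j else 0) * f ℓ) ∎
  where
  pw : ∀ j ℓ → w j * (if j ≤ᵇ ℓ then f ℓ else 0) ≡ (if j ≤ᵇ ℓ then w j else 0) * f ℓ
  pw j ℓ with j ≤ᵇ ℓ
  ... | true = refl
  ... | false = *-zeroʳ (w j)

sumFrom-≡ᵇ-outside : ∀ a k s → s < a → sumFrom a k (λ x → 𝟙 (x ≡ᵇ s)) ≡ 0
sumFrom-≡ᵇ-outside a zero s h = refl
sumFrom-≡ᵇ-outside a (suc k) s h = trans (cong (_+ sumFrom (suc a) k (λ x → 𝟙 (x ≡ᵇ s))) (cong 𝟙 (≢⇒≡ᵇ≡false a s (λ q → <-irrefl (sym q) h)))) (sumFrom-≡ᵇ-outside (suc a) k s (<-trans h (n<1+n a)))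

sumFrom-≡ᵇ-inside : ∀ a k s → a ≤ s → s < a + k → sumFrom a k (λ x → 𝟙 (x ≡ᵇ s)) ≡ 1
sumFrom-≡ᵇ-inside a zero s h1 h2 = ⊥-elim (<-irrefl refl (≤-trans h2 (subst (_≤ s) (sym (+-identityʳ a)) h1)))
sumFrom-≡ᵇ-inside a (suc k) s h1 h2 with a ≟ s
... | yes refl = trans (cong (λ z → 𝟙 z + sumFrom (suc a) k (λ x → 𝟙 (x ≡ᵇ a))) (≡ᵇ-refl a)) (cong suc (sumFrom-≡ᵇ-outside (suc a) k a (n<1+n a)))
... | no ne = trans (cong (_+ sumFrom (suc a) k (λ x → 𝟙 (x ≡ᵇ s))) (cong 𝟙 (≢⇒≡ᵇ≡false a s ne))) (sumFrom-≡ᵇ-inside (suc a) k s (≤∧≢⇒< h1 ne) (subst (s <_) (+-suc a k) h2))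

sumFrom-≡ᵇ-last : ∀ p X → 1 ≤ p → sumFrom 1 p (λ a → if a ≡ᵇ p then X else 0) ≡ X
sumFrom-≡ᵇ-last p X 1≤p = trans (sumFrom-cong 1 p _ _ (λ a _ _ → pw a)) (trans (sumFrom-*ˡ X 1 p _) (trans (cong (X *_) (sumFrom-≡ᵇ-inside 1 p p 1≤p (s≤s ≤-refl))) (*-identityʳ X)))
  where
  pw : ∀ a → (if a ≡ᵇ p then X else 0) ≡ X * 𝟙 (a ≡ᵇ p)
  pw a with a ≡ᵇ p
  ... | true = sym (*-identityʳ X)
  ... | false = sym (*-zeroʳ X)

sumFrom≡0⇒term≡0 : ∀ a k g x → sumFrom a k g ≡ 0 → a ≤ x → x < a + k → g x ≡ 0
sumFrom≡0⇒term≡0 a zero g x e h1 h2 = ⊥-elim (<-irrefl refl (≤-trans h2 (subst (_≤ x) (sym (+-identityʳ a)) h1)))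
sumFrom≡0⇒term≡0 a (suc k) g x e h1 h2 with a ≟ x
... | yes refl = m+n≡0⇒m≡0 (g a) e
... | no ne = sumFrom≡0⇒term≡0 (suc a) k g x (m+n≡0⇒n≡0 (g a) e) (≤∧≢⇒< h1 ne) (subst (x <_) (+-suc a k) h2)

triangular : ℕ → ℕ
triangular x = sumFrom 1 x (λ ℓ → ℓ)

triangular*2 : ∀ x → triangular x * 2 ≡ x * suc x
triangular*2 zero = refl
triangular*2 (suc x) = begin
  triangular (suc x) * 2 ≡⟨ cong (_* 2) (sumFrom-suc 1 x (λ ℓ → ℓ)) ⟩
  (triangular x + suc x) * 2 ≡⟨ *-distribʳ-+ 2 (triangular x) (suc x) ⟩
  triangular x * 2 + suc x * 2 ≡⟨ cong (_+ suc x * 2) (triangular*2 x) ⟩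
  x * suc x + suc x * 2 ≡⟨ solve 1 (λ x → x :* (con 1 :+ x) :+ (con 1 :+ x) :* con 2 := (con 1 :+ x) :* (con 2 :+ x)) refl x ⟩
  suc x * suc (suc x) ∎
  where open +-*-Solver

triangular≡/2 : ∀ x y → y ≡ x * suc x → y / 2 ≡ triangular x
triangular≡/2 x y e = trans (cong (_/ 2) (trans e (sym (triangular*2 x)))) (m*n/n≡m (triangular x) 2)

*-pred-comm : ∀ i' → i' * (i' ∸ 1) ≡ (i' ∸ 1) * suc (i' ∸ 1)
*-pred-comm zero = refl
*-pred-comm (suc c) = *-comm (suc c) c

sumFrom-pyramid : ∀ a u (f : ℕ → ℕ) → a ≤ suc u →
  sumFrom a (suc u ∸ a) (λ k → sumFrom k (u ∸ k) f) ≡ sumFrom a (u ∸ a) (λ ℓ → (suc ℓ ∸ a) * f ℓ)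
sumFrom-pyramid a u f a≤u+1 = begin
  sumFrom a (suc u ∸ a) (λ k → sumFrom k (u ∸ k) f)
    ≡⟨ sumFrom-cong a (suc u ∸ a) _ _ (λ k _ _ → sym (+-identityʳ _)) ⟩
  sumFrom a (suc u ∸ a) (λ k → 1 * sumFrom k (u ∸ k) f)
    ≡⟨ sumFrom-tail-swap a (suc u ∸ a) u (λ _ → 1) f (≤-reflexive (m+[n∸m]≡n a≤u+1)) ⟩
  sumFrom a (u ∸ a) (λ ℓ → sumFrom a (suc u ∸ a) (λ j → if j ≤ᵇ ℓ then 1 else 0) * f ℓ)
    ≡⟨ sumFrom-cong a (u ∸ a) _ _ (λ ℓ a≤ℓ ℓ< → cong (_* f ℓ) (multiplicity ℓ a≤ℓ ℓ<)) ⟩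
  sumFrom a (u ∸ a) (λ ℓ → (suc ℓ ∸ a) * f ℓ) ∎
  where
  multiplicity : ∀ ℓ → a ≤ ℓ → ℓ < a + (u ∸ a) → sumFrom a (suc u ∸ a) (λ j → if j ≤ᵇ ℓ then 1 else 0) ≡ suc ℓ ∸ a
  multiplicity ℓ a≤ℓ ℓ< = begin
    sumFrom a (suc u ∸ a) (λ j → if j ≤ᵇ ℓ then 1 else 0)
      ≡⟨ sumFrom-≤ᵇ-truncate a (suc u ∸ a) ℓ (λ _ → 1) (≤-trans a≤ℓ (n≤1+n ℓ)) (≤-trans ℓ< (+-monoʳ-≤ a (∸-monoˡ-≤ a (n≤1+n u)))) ⟩
    sumFrom a (suc ℓ ∸ a) (λ _ → 1)
      ≡⟨ trans (sumFrom-const a (suc ℓ ∸ a) 1) (*-identityʳ _) ⟩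
    suc ℓ ∸ a ∎

sumFrom-weighted-tails : ∀ u c (g : ℕ → ℕ) → c ≤ u →
  sumFrom 1 c (λ ℓ → ℓ * sumFrom ℓ (u ∸ ℓ) g)
  ≡ sumFrom 1 (c ∸ 1) (λ ℓ → triangular ℓ * g ℓ) + triangular c * sumFrom c (u ∸ c) g
sumFrom-weighted-tails u zero g _ = refl
sumFrom-weighted-tails (suc u) (suc c) g c+1≤u+1 = begin
  sumFrom 1 (suc c) (λ ℓ → ℓ * sumFrom ℓ (suc u ∸ ℓ) g)
    ≡⟨ sumFrom-tail-swap 1 (suc c) (suc u) (λ ℓ → ℓ) g (s≤s c+1≤u+1) ⟩
  sumFrom 1 u F
    ≡⟨ sumFrom-split-at u (suc c) F (s≤s z≤n) c+1≤u+1 ⟩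
  sumFrom 1 c F + sumFrom (suc c) (suc u ∸ suc c) F
    ≡⟨ cong₂ _+_ (sumFrom-cong 1 c F _ (λ ℓ 1≤ℓ ℓ<1+c → cong (_* g ℓ) (sumFrom-≤ᵇ-truncate 1 (suc c) ℓ (λ x → x) (≤-trans 1≤ℓ (n≤1+n ℓ)) (≤-trans ℓ<1+c (n≤1+n _)))))
                 (trans (sumFrom-cong (suc c) (suc u ∸ suc c) F _ (λ ℓ c<ℓ _ → cong (_* g ℓ) (sumFrom-≤ᵇ-all 1 (suc c) ℓ (λ x → x) (s≤s c<ℓ))))
                        (sumFrom-*ˡ (triangular (suc c)) (suc c) (suc u ∸ suc c) g)) ⟩
  sumFrom 1 c (λ ℓ → triangular ℓ * g ℓ) + triangular (suc c) * sumFrom (suc c) (suc u ∸ suc c) g ∎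
  where
  F : ℕ → ℕ
  F ℓ = sumFrom 1 (suc c) (λ j → if j ≤ᵇ ℓ then j else 0) * g ℓ

2≤⇒1≤pred : ∀ {p} → 2 ≤ p → 1 ≤ p ∸ 1
2≤⇒1≤pred {suc (suc p)} _ = s≤s z≤n
2≤⇒1≤pred {suc zero} (s≤s ())

<1+pred⇒< : ∀ ℓ c → 1 ≤ ℓ → ℓ < 1 + (c ∸ 1) → ℓ < c
<1+pred⇒< ℓ zero h1 h = ⊥-elim (<-irrefl refl (≤-trans h h1))
<1+pred⇒< ℓ (suc c) h1 h = h

sumPrefs : ℕ → ℕ → (List ℕ → ℕ) → ℕ
sumPrefs n r f = sum (map f (prefs n r))

length-filterᵇ≡sum-𝟙 : ∀ (p : List ℕ → Bool) xs → length (filterᵇ p xs) ≡ sum (map (λ w → 𝟙 (p w)) xs)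
length-filterᵇ≡sum-𝟙 p [] = refl
length-filterᵇ≡sum-𝟙 p (x ∷ xs) with p x
... | true = cong suc (length-filterᵇ≡sum-𝟙 p xs)
... | false = length-filterᵇ≡sum-𝟙 p xs

count≡sumPrefs : ∀ n p → count n p ≡ sumPrefs n n (λ w → 𝟙 (p w))
count≡sumPrefs n p = length-filterᵇ≡sum-𝟙 p (prefs n n)

sum-map-+ : ∀ {A : Set} (f g : A → ℕ) xs → sum (map (λ w → f w + g w) xs) ≡ sum (map f xs) + sum (map g xs)
sum-map-+ f g [] = refl
sum-map-+ f g (x ∷ xs) = trans (cong (f x + g x +_) (sum-map-+ f g xs)) (+-interchange (f x) (g x) _ _)

sum-map-sumFrom : ∀ {A : Set} a k (F : ℕ → A → ℕ) xs → sum (map (λ w → sumFrom a k (λ j → F j w)) xs) ≡ sumFrom a k (λ j → sum (map (F j) xs))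
sum-map-sumFrom a k F [] = sym (sumFrom-0 a k)
sum-map-sumFrom a k F (x ∷ xs) = trans (cong (sumFrom a k (λ j → F j x) +_) (sum-map-sumFrom a k F xs)) (sym (sumFrom-+ a k _ _))

sumPrefs-+ : ∀ n r f g → sumPrefs n r (λ w → f w + g w) ≡ sumPrefs n r f + sumPrefs n r g
sumPrefs-+ n r f g = sum-map-+ f g (prefs n r)

sumPrefs-sumFrom : ∀ n r a k (F : ℕ → List ℕ → ℕ) → sumPrefs n r (λ w → sumFrom a k (λ j → F j w)) ≡ sumFrom a k (λ j → sumPrefs n r (F j))
sumPrefs-sumFrom n r a k F = sum-map-sumFrom a k F (prefs n r)

sum-concatMap : ∀ {A B : Set} (f : B → ℕ) (g : A → List B) xs → sum (map f (concatMap g xs)) ≡ sum (map (λ x → sum (map f (g x))) xs)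
sum-concatMap f g [] = refl
sum-concatMap f g (x ∷ xs) = trans (cong sum (map-++ f (g x) (concatMap g xs)))
  (trans (sum-++ (map f (g x)) _) (cong (sum (map f (g x)) +_) (sum-concatMap f g xs)))

sumPrefs-suc : ∀ n r f → sumPrefs n (suc r) f ≡ sumFrom 1 n (λ a → sumPrefs n r (λ w → f (a ∷ w)))
sumPrefs-suc n r f = begin
  sum (map f (concatMap (λ a → map (a ∷_) (prefs n r)) (range 1 n)))
    ≡⟨ sum-concatMap f _ (range 1 n) ⟩
  sum (map (λ a → sum (map f (map (a ∷_) (prefs n r)))) (range 1 n))
    ≡⟨ cong sum (map-cong (λ a → cong sum (sym (map-∘ (prefs n r)))) (range 1 n)) ⟩
  sumRange 1 n (λ a → sumPrefs n r (λ w → f (a ∷ w)))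
    ≡⟨ sumRange≡sumFrom 1 n _ ⟩
  sumFrom 1 n (λ a → sumPrefs n r (λ w → f (a ∷ w))) ∎

InRange : ℕ → List ℕ → Set
InRange n w = All (λ a → 1 ≤ a × a ≤ n) w

sumPrefs-cong : ∀ n r f g → (∀ w → InRange n w → length w ≡ r → f w ≡ g w) → sumPrefs n r f ≡ sumPrefs n r g
sumPrefs-cong n zero f g e = cong (_+ 0) (e [] [] refl)
sumPrefs-cong n (suc r) f g e = trans (sumPrefs-suc n r f) (trans
  (sumFrom-cong 1 n _ _ (λ a 1≤a a<1+n → sumPrefs-cong n r _ _ (λ w iw lw → e (a ∷ w) ((1≤a , ≤-pred a<1+n) ∷ iw) (cong suc lw))))
  (sym (sumPrefs-suc n r g)))

sumPrefs-0 : ∀ n r → sumPrefs n r (λ _ → 0) ≡ 0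
sumPrefs-0 n r = go (prefs n r)
  where
  go : ∀ (xs : List (List ℕ)) → sum (map (λ _ → 0) xs) ≡ 0
  go [] = refl
  go (x ∷ xs) = go xs

-- The vacillating rule

isOcc-snoc : ∀ x occ s → isOcc x (occ ++ [ s ]) ≡ isOcc x occ ∨ (x ≡ᵇ s)
isOcc-snoc x [] s with x ≡ᵇ s
... | true = refl
... | false = refl
isOcc-snoc x (t ∷ ts) s with x ≡ᵇ t
... | true = refl
... | false = isOcc-snoc x ts s

isOcc-mono : ∀ x occ s → isOcc x occ ≡ true → isOcc x (occ ++ [ s ]) ≡ true
isOcc-mono x occ s e = trans (isOcc-snoc x occ s) (cong (_∨ (x ≡ᵇ s)) e)

isOcc-new : ∀ occ s → isOcc s (occ ++ [ s ]) ≡ true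
isOcc-new occ s = trans (isOcc-snoc s occ s) (trans (cong (isOcc s occ ∨_) (≡ᵇ-refl s)) (∨-zeroʳ _))

isOcc-other : ∀ x occ s → x ≢ s → isOcc x (occ ++ [ s ]) ≡ isOcc x occ
isOcc-other x occ s ne = trans (isOcc-snoc x occ s) (trans (cong (isOcc x occ ∨_) (≢⇒≡ᵇ≡false x s ne)) (∨-identityʳ _))

isOcc-anti : ∀ x occ s → isOcc x (occ ++ [ s ]) ≡ false → isOcc x occ ≡ false
isOcc-anti x occ s e with isOcc x occ in e'
... | false = refl
... | true = trans (sym (isOcc-mono x occ s e')) e

data SpotView (n : ℕ) (occ : List ℕ) (a : ℕ) : Maybe ℕ → Set where
  sv-here : isOcc a occ ≡ false → SpotView n occ a (just a)
  sv-left : isOcc a occ ≡ true → (2 ≤ᵇ a) ≡ true → isOcc (a ∸ 1) occ ≡ false → SpotView n occ a (just (a ∸ 1))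
  sv-right : isOcc a occ ≡ true → ((2 ≤ᵇ a) ∧ not (isOcc (a ∸ 1) occ)) ≡ false → (a <ᵇ n) ≡ true → isOcc (suc a) occ ≡ false → SpotView n occ a (just (suc a))
  sv-none : isOcc a occ ≡ true → ((2 ≤ᵇ a) ∧ not (isOcc (a ∸ 1) occ)) ≡ false → ((a <ᵇ n) ∧ not (isOcc (suc a) occ)) ≡ false → SpotView n occ a nothing

spot-view-right : ∀ n occ a → isOcc a occ ≡ true → ((2 ≤ᵇ a) ∧ not (isOcc (a ∸ 1) occ)) ≡ false →
  SpotView n occ a (if (a <ᵇ n) ∧ not (isOcc (suc a) occ) then just (suc a) else nothing)
spot-view-right n occ a e1 h2 with (a <ᵇ n) in e4 | isOcc (suc a) occ in e5
... | true | false = sv-right e1 h2 e4 e5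
... | true | true = sv-none e1 h2 (subst₂ (λ u v → (u ∧ not v) ≡ false) (sym e4) (sym e5) refl)
... | false | y = sv-none e1 h2 (subst (λ u → (u ∧ not (isOcc (suc a) occ)) ≡ false) (sym e4) refl)

spot-view : ∀ n occ a → SpotView n occ a (spot n occ a)
spot-view n occ a with isOcc a occ in e1
... | false = sv-here e1
... | true with (2 ≤ᵇ a) in e2 | isOcc (a ∸ 1) occ in e3
...   | true | false = sv-left e1 e2 e3
...   | false | x = spot-view-right n occ a e1 (subst (λ z → (z ∧ not (isOcc (a ∸ 1) occ)) ≡ false) (sym e2) refl)
...   | true | true = spot-view-right n occ a e1 (subst₂ (λ u v → (u ∧ not v) ≡ false) (sym e2) (sym e3) refl)

sv-free : ∀ {n occ a s} → SpotView n occ a (just s) → isOcc s occ ≡ false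
sv-free (sv-here e) = e
sv-free (sv-left _ _ e) = e
sv-free (sv-right _ _ _ e) = e

spot-free : ∀ n occ a s → spot n occ a ≡ just s → isOcc s occ ≡ false
spot-free n occ a s e = sv-free (subst (SpotView n occ a) e (spot-view n occ a))

Adjacent : ℕ → ℕ → Set
Adjacent a s = (s ≡ a) ⊎ (suc s ≡ a) ⊎ (s ≡ suc a)

sv-range : ∀ {n occ a s} → SpotView n occ a (just s) → 1 ≤ a → a ≤ n → (1 ≤ s × s ≤ n) × Adjacent a s
sv-range (sv-here e) h1 h2 = (h1 , h2) , inj₁ refl
sv-range {a = suc (suc a)} (sv-left _ _ _) h1 h2 = (s≤s z≤n , ≤-trans (n≤1+n _) h2) , inj₂ (inj₁ refl)
sv-range {a = zero} (sv-left _ () _) h1 h2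
sv-range {a = suc zero} (sv-left _ () _) h1 h2
sv-range {n} {a = a} (sv-right _ _ e _) h1 h2 = (s≤s z≤n , <ᵇ≡true⇒< a n e) , inj₂ (inj₂ refl)

spot-range : ∀ n occ a s → spot n occ a ≡ just s → 1 ≤ a → a ≤ n → (1 ≤ s × s ≤ n) × Adjacent a s
spot-range n occ a s e = sv-range (subst (SpotView n occ a) e (spot-view n occ a))

cong₃ : ∀ {A B C D : Set} (f : A → B → C → D) {x y u v s t} → x ≡ y → u ≡ v → s ≡ t → f x u s ≡ f y v t
cong₃ f refl refl refl = refl

spotOf : Bool → Bool → Bool → ℕ → Maybe ℕ
spotOf b1 b2 b3 a = if not b1 then just a else if b2 then just (a ∸ 1) else if b3 then just (suc a) else nothing

spot-here : ∀ n occ a → isOcc a occ ≡ false → spot n occ a ≡ just a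
spot-here n occ a e = cong (λ z → spotOf z ((2 ≤ᵇ a) ∧ not (isOcc (a ∸ 1) occ)) ((a <ᵇ n) ∧ not (isOcc (suc a) occ)) a) e

AgreeExcept : ℕ → List ℕ → List ℕ → Set
AgreeExcept m occ occ' = ∀ x → x ≢ m → isOcc x occ ≡ isOcc x occ'

AgreeExcept-snoc : ∀ m occ occ' s → AgreeExcept m occ occ' → AgreeExcept m (occ ++ [ s ]) (occ' ++ [ s ])
AgreeExcept-snoc m occ occ' s r x ne = trans (isOcc-snoc x occ s) (trans (cong (_∨ (x ≡ᵇ s)) (r x ne)) (sym (isOcc-snoc x occ' s)))

pred≢suc : ∀ a p → a ≤ p → a ∸ 1 ≢ suc p
pred≢suc a p a≤p e = <-irrefl refl (≤-<-trans (subst (_≤ a) e (m∸n≤m a 1)) (s≤s a≤p))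

spot-drop-last-occupied : ∀ p occ occ' a → 1 ≤ a → a ≤ p → AgreeExcept (suc p) occ occ' → isOcc (suc p) occ ≡ true → spot (suc p) occ a ≡ spot p occ' a
spot-drop-last-occupied p occ occ' a 1≤a a≤p r e = cong₃ (λ b1 b2 b3 → spotOf b1 b2 b3 a) (r a (λ q → <-irrefl q (s≤s a≤p)))
  (cong (λ z → (2 ≤ᵇ a) ∧ not z) (r (a ∸ 1) (pred≢suc a p a≤p))) b3
  where
  b3 : ((a <ᵇ suc p) ∧ not (isOcc (suc a) occ)) ≡ ((a <ᵇ p) ∧ not (isOcc (suc a) occ'))
  b3 with a ≟ p
  ... | yes refl = trans (cong (λ z → (a <ᵇ suc a) ∧ not z) e) (trans (∧-zeroʳ _) (sym (cong (_∧ not (isOcc (suc a) occ')) (≥⇒<ᵇ≡false a a ≤-refl))))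
  ... | no ne = cong₂ (λ u v → u ∧ not v) (trans (<⇒<ᵇ≡true a (suc p) (s≤s a≤p)) (sym (<⇒<ᵇ≡true a p (≤∧≢⇒< a≤p ne)))) (r (suc a) (λ q → ne (suc-injective q)))

spot-drop-last-free : ∀ p occ a → 1 ≤ a → a ≤ p → isOcc (suc p) occ ≡ false →
  (spot (suc p) occ a ≡ spot p occ a) ⊎ ((spot (suc p) occ a ≡ just (suc p)) × (spot p occ a ≡ nothing))
spot-drop-last-free p occ a 1≤a a≤p e with a ≟ p
... | no ne = inj₁ (cong (λ b3 → spotOf (isOcc a occ) ((2 ≤ᵇ a) ∧ not (isOcc (a ∸ 1) occ)) (b3 ∧ not (isOcc (suc a) occ)) a)
        (trans (<⇒<ᵇ≡true a (suc p) (s≤s a≤p)) (sym (<⇒<ᵇ≡true a p (≤∧≢⇒< a≤p ne)))))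
... | yes refl = cases (isOcc a occ) ((2 ≤ᵇ a) ∧ not (isOcc (a ∸ 1) occ)) (q1 refl) (q2 refl)
  where
  q1 : ∀ {z} → z ≡ a → ((a <ᵇ suc a) ∧ not (isOcc (suc a) occ)) ≡ true
  q1 _ = trans (cong ((a <ᵇ suc a) ∧_) (cong not e)) (trans (∧-identityʳ _) (<⇒<ᵇ≡true a (suc a) ≤-refl))
  q2 : ∀ {z} → z ≡ a → ((a <ᵇ a) ∧ not (isOcc (suc a) occ)) ≡ false
  q2 _ = cong (_∧ not (isOcc (suc a) occ)) (≥⇒<ᵇ≡false a a ≤-refl)
  cases : ∀ b1 b2 → ((a <ᵇ suc a) ∧ not (isOcc (suc a) occ)) ≡ true → ((a <ᵇ a) ∧ not (isOcc (suc a) occ)) ≡ false →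
    (spotOf b1 b2 ((a <ᵇ suc a) ∧ not (isOcc (suc a) occ)) a ≡ spotOf b1 b2 ((a <ᵇ a) ∧ not (isOcc (suc a) occ)) a) ⊎
    ((spotOf b1 b2 ((a <ᵇ suc a) ∧ not (isOcc (suc a) occ)) a ≡ just (suc a)) × (spotOf b1 b2 ((a <ᵇ a) ∧ not (isOcc (suc a) occ)) a ≡ nothing))
  cases false b2 h1 h2 = inj₁ refl
  cases true true h1 h2 = inj₁ refl
  cases true false h1 h2 = inj₂ (cong (λ z → if z then just (suc a) else nothing) h1 , cong (λ z → if z then just (suc a) else nothing) h2)

spot-last-occupied : ∀ p occ → 1 ≤ p → isOcc (suc p) occ ≡ true → spot (suc p) occ (suc p) ≡ (if isOcc p occ then nothing else just p)
spot-last-occupied (suc p) occ _ e = trans (cong₂ (λ u v → spotOf u (true ∧ not (isOcc (suc p) occ)) (v ∧ not (isOcc (suc (suc (suc p))) occ)) (suc (suc p))) e (≥⇒<ᵇ≡false p p ≤-refl)) (fin (isOcc (suc p) occ))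
  where
  fin : ∀ b → spotOf true (true ∧ not b) (false ∧ not (isOcc (suc (suc (suc p))) occ)) (suc (suc p)) ≡ (if b then nothing else just (suc p))
  fin true = refl
  fin false = refl

spot-last-free : ∀ p occ → isOcc (suc p) occ ≡ false → spot (suc p) occ (suc p) ≡ just (suc p)
spot-last-free p occ e = cong (λ z → spotOf z ((2 ≤ᵇ suc p) ∧ not (isOcc (suc p ∸ 1) occ)) ((suc p <ᵇ suc p) ∧ not (isOcc (suc (suc p)) occ)) (suc p)) e

-- Parking runs under constraints

-- run n occ w o i f: the cars of w, numbered from i, park on spots 1..n in which occ is
-- already taken; it holds iff every car parks, car j preferring a and ending in spot s
-- satisfies o j a s, and the final list of taken spots satisfies f.
Constraint : Set
Constraint = ℕ → ℕ → ℕ → Bool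

mutual
  run : ℕ → List ℕ → List ℕ → Constraint → ℕ → (List ℕ → Bool) → Bool
  run n occ [] o i f = f occ
  run n occ (a ∷ w) o i f = runOn n occ a w o i f (spot n occ a)

  runOn : ℕ → List ℕ → ℕ → List ℕ → Constraint → ℕ → (List ℕ → Bool) → Maybe ℕ → Bool
  runOn n occ a w o i f nothing = false
  runOn n occ a w o i f (just s) = o i a s ∧ run n (occ ++ [ s ]) w o (suc i) f

unconstrained : Constraint
unconstrained _ _ _ = true

anyOutcome : List ℕ → Bool
anyOutcome _ = true

constrainAt : ℕ → (ℕ → ℕ → Bool) → Constraint → Constraint
constrainAt I P o j a s = o j a s ∧ (if j ≡ᵇ I then P a s else true)

constrainAt-other : ∀ I P o j a s → j ≢ I → constrainAt I P o j a s ≡ o j a s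
constrainAt-other I P o j a s ne = trans (cong (λ z → o j a s ∧ (if z then P a s else true)) (≢⇒≡ᵇ≡false j I ne)) (∧-identityʳ _)

constrainAt-same : ∀ I P o a s → constrainAt I P o I a s ≡ o I a s ∧ P a s
constrainAt-same I P o a s = cong (λ z → o I a s ∧ (if z then P a s else true)) (≡ᵇ-refl I)

constrainAt-∧ : ∀ I (P Q : ℕ → ℕ → Bool) j a s → constrainAt I P (constrainAt I Q unconstrained) j a s ≡ constrainAt I (λ a s → P a s ∧ Q a s) unconstrained j a s
constrainAt-∧ I P Q j a s with j ≡ᵇ I
... | true = ∧-comm (Q a s) (P a s)
... | false = refl

run-cong-from : ∀ n occ w o o' i f → (∀ j a s → i ≤ j → o j a s ≡ o' j a s) → run n occ w o i f ≡ run n occ w o' i f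
run-cong-from n occ [] o o' i f e = refl
run-cong-from n occ (a ∷ w) o o' i f e with spot n occ a
... | nothing = refl
... | just s = cong₂ _∧_ (e i a s ≤-refl) (run-cong-from n (occ ++ [ s ]) w o o' (suc i) f (λ j a s i<j → e j a s (<⇒≤ i<j)))

run-cong-final : ∀ n occ w o i f g → (∀ occ' → f occ' ≡ g occ') → run n occ w o i f ≡ run n occ w o i g
run-cong-final n occ [] o i f g e = e occ
run-cong-final n occ (a ∷ w) o i f g e with spot n occ a
... | nothing = refl
... | just s = cong (o i a s ∧_) (run-cong-final n (occ ++ [ s ]) w o i' f g e)
  where i' = suc i

run-constrainAt-past : ∀ n occ w o I X f → run n occ w (constrainAt I X o) (suc I) f ≡ run n occ w o (suc I) f
run-constrainAt-past n occ w o I X f = run-cong-from n occ w _ _ (suc I) f (λ j a s I<j → constrainAt-other I X o j a s (λ q → <-irrefl (sym q) I<j))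

run-shift : ∀ n occ w o i f → run n occ w o (suc i) f ≡ run n occ w (λ k → o (suc k)) i f
run-shift n occ [] o i f = refl
run-shift n occ (a ∷ w) o i f with spot n occ a
... | nothing = refl
... | just s = cong (o (suc i) a s ∧_) (run-shift n (occ ++ [ s ]) w o (suc i) f)

parksAtOutcome : Maybe (List ℕ) → ℕ → ℕ → Bool
parksAtOutcome nothing I t = false
parksAtOutcome (just ps) I t = isJustN (at ps I) t

parksAt≡parksAtOutcome : ∀ n α I t → parksAt n α I t ≡ parksAtOutcome (outcome n α) I t
parksAt≡parksAtOutcome n α I t with outcome n α
... | nothing = refl
... | just _ = refl

isVPF≡is-just : ∀ n α → isVPF n α ≡ is-just (outcome n α)
isVPF≡is-just n α with outcome n α
... | nothing = refl
... | just _ = refl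

parksAtOutcome-park≡run : ∀ n acc w I t i → parksAtOutcome (park n acc w) I t ≡ run n acc w unconstrained i (λ ps → isJustN (at ps I) t)
parksAtOutcome-park≡run n acc [] I t i = refl
parksAtOutcome-park≡run n acc (a ∷ w) I t i with spot n acc a
... | nothing = refl
... | just s = parksAtOutcome-park≡run n (acc ++ [ s ]) w I t (suc i)

is-just-park≡run : ∀ n acc w i → is-just (park n acc w) ≡ run n acc w unconstrained i anyOutcome
is-just-park≡run n acc [] i = refl
is-just-park≡run n acc (a ∷ w) i with spot n acc a
... | nothing = refl
... | just s = is-just-park≡run n (acc ++ [ s ]) w (suc i)

at-++ : ∀ xs ys I → 1 ≤ I → I ≤ length xs → at (xs ++ ys) I ≡ at xs I
at-++ (x ∷ xs) ys (suc zero) h1 h2 = refl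
at-++ (x ∷ xs) ys (suc (suc I)) h1 (s≤s h2) = at-++ xs ys (suc I) (s≤s z≤n) h2

at-last : ∀ xs s → at (xs ++ [ s ]) (suc (length xs)) ≡ just s
at-last [] s = refl
at-last (x ∷ []) s = refl
at-last (x ∷ y ∷ xs) s = at-last (y ∷ xs) s

length-snoc : ∀ (xs : List ℕ) s → length (xs ++ [ s ]) ≡ suc (length xs)
length-snoc xs s = trans (length-++ xs) (+-comm (length xs) 1)

run-final-prefix : ∀ n acc w o j (g : Maybe ℕ → Bool) f I → 1 ≤ I → I ≤ length acc →
  run n acc w o j (λ ps → g (at ps I) ∧ f ps) ≡ g (at acc I) ∧ run n acc w o j f
run-final-prefix n acc [] o j g f I h1 h2 = refl
run-final-prefix n acc (a ∷ w) o j g f I h1 h2 with spot n acc a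
... | nothing = sym (∧-zeroʳ (g (at acc I)))
... | just s = begin
    o j a s ∧ run n (acc ++ [ s ]) w o (suc j) (λ ps → g (at ps I) ∧ f ps)
      ≡⟨ cong (o j a s ∧_) (run-final-prefix n (acc ++ [ s ]) w o (suc j) g f I h1 (≤-trans h2 (subst (length acc ≤_) (sym (length-snoc acc s)) (n≤1+n _)))) ⟩
    o j a s ∧ (g (at (acc ++ [ s ]) I) ∧ run n (acc ++ [ s ]) w o (suc j) f)
      ≡⟨ cong (λ z → o j a s ∧ (g z ∧ run n (acc ++ [ s ]) w o (suc j) f)) (at-++ acc [ s ] I h1 h2) ⟩
    o j a s ∧ (g (at acc I) ∧ run n (acc ++ [ s ]) w o (suc j) f)
      ≡⟨ sym (∧-assoc (o j a s) _ _) ⟩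
    (o j a s ∧ g (at acc I)) ∧ run n (acc ++ [ s ]) w o (suc j) f
      ≡⟨ cong (_∧ run n (acc ++ [ s ]) w o (suc j) f) (∧-comm (o j a s) _) ⟩
    (g (at acc I) ∧ o j a s) ∧ run n (acc ++ [ s ]) w o (suc j) f
      ≡⟨ ∧-assoc (g (at acc I)) _ _ ⟩
    g (at acc I) ∧ (o j a s ∧ run n (acc ++ [ s ]) w o (suc j) f) ∎

run-final-at≡constrainAt : ∀ n acc w o f t k → k < length w →
  run n acc w o (suc (length acc)) (λ ps → isJustN (at ps (suc (length acc) + k)) t ∧ f ps)
  ≡ run n acc w (constrainAt (suc (length acc) + k) (λ a s → s ≡ᵇ t) o) (suc (length acc)) f
run-final-at≡constrainAt n acc (a ∷ w) o f t k k< with spot n acc a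
... | nothing = refl
run-final-at≡constrainAt n acc (a ∷ w) o f t zero k< | just s = begin
    o i a s ∧ run n (acc ++ [ s ]) w o (suc i) (λ ps → isJustN (at ps (i + 0)) t ∧ f ps)
      ≡⟨ cong (λ z → o i a s ∧ run n (acc ++ [ s ]) w o (suc i) (λ ps → isJustN (at ps z) t ∧ f ps)) (+-identityʳ i) ⟩
    o i a s ∧ run n (acc ++ [ s ]) w o (suc i) (λ ps → isJustN (at ps i) t ∧ f ps)
      ≡⟨ cong (o i a s ∧_) (run-final-prefix n (acc ++ [ s ]) w o (suc i) (λ x → isJustN x t) f i (s≤s z≤n) (≤-reflexive (sym (length-snoc acc s)))) ⟩
    o i a s ∧ (isJustN (at (acc ++ [ s ]) i) t ∧ run n (acc ++ [ s ]) w o (suc i) f)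
      ≡⟨ cong (λ z → o i a s ∧ (isJustN z t ∧ run n (acc ++ [ s ]) w o (suc i) f)) (at-last acc s) ⟩
    o i a s ∧ ((s ≡ᵇ t) ∧ run n (acc ++ [ s ]) w o (suc i) f)
      ≡⟨ sym (∧-assoc (o i a s) _ _) ⟩
    (o i a s ∧ (s ≡ᵇ t)) ∧ run n (acc ++ [ s ]) w o (suc i) f
      ≡⟨ cong₂ (λ u v → (o i a s ∧ u) ∧ v) (cong (λ z → if z then s ≡ᵇ t else true) (sym (trans (cong (i ≡ᵇ_) (+-identityʳ i)) (≡ᵇ-refl i))))
           (run-cong-from n (acc ++ [ s ]) w o o' (suc i) f (λ j a' s' i<j → sym (trans (cong (λ z → o j a' s' ∧ (if z then s' ≡ᵇ t else true)) (≢⇒≡ᵇ≡false j (i + 0) (λ e → <-irrefl (trans (sym (+-identityʳ i)) (sym e)) i<j))) (∧-identityʳ _)))) ⟩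
    (o i a s ∧ (if i ≡ᵇ (i + 0) then s ≡ᵇ t else true)) ∧ run n (acc ++ [ s ]) w o' (suc i) f ∎
  where
  i = suc (length acc)
  o' = constrainAt (i + 0) (λ a s → s ≡ᵇ t) o
run-final-at≡constrainAt n acc (a ∷ w) o f t (suc k) (s≤s k<) | just s = cong₂ _∧_ e1 e2
  where
  i = suc (length acc)
  I = i + suc k
  e1 : o i a s ≡ o i a s ∧ (if i ≡ᵇ I then s ≡ᵇ t else true)
  e1 = sym (trans (cong (λ z → o i a s ∧ (if z then s ≡ᵇ t else true)) (≢⇒≡ᵇ≡false i I (λ e → 1+n≢0 {k} (+-cancelˡ-≡ i (suc k) 0 (trans (sym e) (sym (+-identityʳ i))))))) (∧-identityʳ _))
  eq : suc (length (acc ++ [ s ])) + k ≡ I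
  eq = trans (cong (λ z → suc z + k) (length-snoc acc s)) (sym (+-suc i k))
  e2 : run n (acc ++ [ s ]) w o (suc i) (λ ps → isJustN (at ps I) t ∧ f ps) ≡ run n (acc ++ [ s ]) w (constrainAt I (λ a s → s ≡ᵇ t) o) (suc i) f
  e2 = subst (λ z → run n (acc ++ [ s ]) w o z (λ ps → isJustN (at ps I) t ∧ f ps) ≡ run n (acc ++ [ s ]) w (constrainAt I (λ a s → s ≡ᵇ t) o) z f)
        (cong suc (length-snoc acc s))
        (subst (λ I' → run n (acc ++ [ s ]) w o (suc (length (acc ++ [ s ]))) (λ ps → isJustN (at ps I') t ∧ f ps) ≡ run n (acc ++ [ s ]) w (constrainAt I' (λ a s → s ≡ᵇ t) o) (suc (length (acc ++ [ s ]))) f)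
          eq (run-final-at≡constrainAt n (acc ++ [ s ]) w o f t k k<))

preference∧run≡constrainAt : ∀ n acc w o i f p k → k < length w →
  isJustN (at w (suc k)) p ∧ run n acc w o i f ≡ run n acc w (constrainAt (i + k) (λ a s → a ≡ᵇ p) o) i f
preference∧run≡constrainAt n acc (a ∷ w) o i f p zero k< with spot n acc a
... | nothing = ∧-zeroʳ (a ≡ᵇ p)
... | just s = begin
    (a ≡ᵇ p) ∧ (o i a s ∧ run n (acc ++ [ s ]) w o (suc i) f)
      ≡⟨ ∧-swapˡ (a ≡ᵇ p) (o i a s) (run n (acc ++ [ s ]) w o (suc i) f) ⟩
    o i a s ∧ ((a ≡ᵇ p) ∧ run n (acc ++ [ s ]) w o (suc i) f)
      ≡⟨ sym (∧-assoc (o i a s) _ _) ⟩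
    (o i a s ∧ (a ≡ᵇ p)) ∧ run n (acc ++ [ s ]) w o (suc i) f
      ≡⟨ cong₂ _∧_ (sym (trans (cong (λ I → constrainAt I (λ a s → a ≡ᵇ p) o i a s) (+-identityʳ i)) (constrainAt-same i (λ a s → a ≡ᵇ p) o a s)))
          (run-cong-from n (acc ++ [ s ]) w o (constrainAt (i + 0) (λ a s → a ≡ᵇ p) o) (suc i) f (λ j a' s' i<j → sym (constrainAt-other (i + 0) (λ a s → a ≡ᵇ p) o j a' s' (λ e → <-irrefl (trans (sym (+-identityʳ i)) (sym e)) i<j)))) ⟩
    constrainAt (i + 0) (λ a s → a ≡ᵇ p) o i a s ∧ run n (acc ++ [ s ]) w (constrainAt (i + 0) (λ a s → a ≡ᵇ p) o) (suc i) f ∎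
preference∧run≡constrainAt n acc (a ∷ w) o i f p (suc k) (s≤s k<) with spot n acc a
... | nothing = ∧-zeroʳ _
... | just s = begin
    x ∧ (o i a s ∧ run n (acc ++ [ s ]) w o (suc i) f)
      ≡⟨ ∧-swapˡ x (o i a s) (run n (acc ++ [ s ]) w o (suc i) f) ⟩
    o i a s ∧ (x ∧ run n (acc ++ [ s ]) w o (suc i) f)
      ≡⟨ cong₂ _∧_ (sym (constrainAt-other (i + suc k) (λ a s → a ≡ᵇ p) o i a s ne))
          (trans (preference∧run≡constrainAt n (acc ++ [ s ]) w o (suc i) f p k k<) (cong (λ I → run n (acc ++ [ s ]) w (constrainAt I (λ a s → a ≡ᵇ p) o) (suc i) f) (sym (+-suc i k)))) ⟩
    constrainAt (i + suc k) (λ a s → a ≡ᵇ p) o i a s ∧ run n (acc ++ [ s ]) w (constrainAt (i + suc k) (λ a s → a ≡ᵇ p) o) (suc i) f ∎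
  where
  x = isJustN (at w (suc k)) p
  ne : i ≢ i + suc k
  ne e = 1+n≢0 {k} (+-cancelˡ-≡ i (suc k) 0 (trans (sym e) (sym (+-identityʳ i))))

parksIn : ℕ → ℕ → ℕ → Bool
parksIn t a s = s ≡ᵇ t

prefersParksIn : ℕ → ℕ → ℕ → Bool
prefersParksIn t a s = (a ≡ᵇ t) ∧ (s ≡ᵇ t)

prefersLeftParksIn : ℕ → ℕ → ℕ → Bool
prefersLeftParksIn t a s = (a ≡ᵇ t ∸ 1) ∧ (s ≡ᵇ t)

carParksIn : ℕ → ℕ → Constraint
carParksIn I t = constrainAt I (parksIn t) unconstrained

carPrefersParksIn : ℕ → ℕ → Constraint
carPrefersParksIn I t = constrainAt I (prefersParksIn t) unconstrained

carPrefersLeftParksIn : ℕ → ℕ → Constraint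
carPrefersLeftParksIn I t = constrainAt I (prefersLeftParksIn t) unconstrained

vpf≡sumPrefs-run : ∀ n → vpf n ≡ sumPrefs n n (λ w → 𝟙 (run n [] w unconstrained 1 anyOutcome))
vpf≡sumPrefs-run n = trans (count≡sumPrefs n (isVPF n)) (sumPrefs-cong n n _ _ (λ w _ _ → cong 𝟙 (trans (isVPF≡is-just n w) (is-just-park≡run n [] w 1))))

parksAt≡run : ∀ n w k → k < length w → parksAt n w (suc k) n ≡ run n [] w (carParksIn (suc k) n) 1 anyOutcome
parksAt≡run n w k k< = begin
  parksAt n w (suc k) n ≡⟨ parksAt≡parksAtOutcome n w (suc k) n ⟩
  parksAtOutcome (park n [] w) (suc k) n ≡⟨ parksAtOutcome-park≡run n [] w (suc k) n 1 ⟩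
  run n [] w unconstrained 1 (λ ps → isJustN (at ps (suc k)) n) ≡⟨ run-cong-final n [] w unconstrained 1 _ _ (λ ps → sym (∧-identityʳ _)) ⟩
  run n [] w unconstrained 1 (λ ps → isJustN (at ps (suc k)) n ∧ anyOutcome ps) ≡⟨ run-final-at≡constrainAt n [] w unconstrained anyOutcome n k k< ⟩
  run n [] w (carParksIn (suc k) n) 1 anyOutcome ∎

vpfI≡sumPrefs-run : ∀ n i → 1 ≤ i → i ≤ n → vpfI n i ≡ sumPrefs n n (λ w → 𝟙 (run n [] w (carParksIn i n) 1 anyOutcome))
vpfI≡sumPrefs-run n (suc k) _ i≤n = trans (count≡sumPrefs n (inVPFi n (suc k))) (sumPrefs-cong n n _ _ (λ w _ lw → cong 𝟙 (parksAt≡run n w k (subst (k <_) (sym lw) i≤n))))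

preference∧parksAt≡run : ∀ n w k p → k < length w → isJustN (at w (suc k)) p ∧ parksAt n w (suc k) n
   ≡ run n [] w (constrainAt (suc k) (λ a s → (a ≡ᵇ p) ∧ (s ≡ᵇ n)) unconstrained) 1 anyOutcome
preference∧parksAt≡run n w k p k< = begin
  isJustN (at w (suc k)) p ∧ parksAt n w (suc k) n ≡⟨ cong (isJustN (at w (suc k)) p ∧_) (parksAt≡run n w k k<) ⟩
  isJustN (at w (suc k)) p ∧ run n [] w (carParksIn (suc k) n) 1 anyOutcome ≡⟨ preference∧run≡constrainAt n [] w (carParksIn (suc k) n) 1 anyOutcome p k k< ⟩
  run n [] w (constrainAt (suc k) (λ a s → a ≡ᵇ p) (carParksIn (suc k) n)) 1 anyOutcome ≡⟨ run-cong-from n [] w (constrainAt (suc k) (λ a s → a ≡ᵇ p) (carParksIn (suc k) n)) (constrainAt (suc k) (λ a s → (a ≡ᵇ p) ∧ (s ≡ᵇ n)) unconstrained) 1 anyOutcome (λ j a s _ → constrainAt-∧ (suc k) (λ a s → a ≡ᵇ p) (λ a s → s ≡ᵇ n) j a s) ⟩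
  run n [] w (constrainAt (suc k) (λ a s → (a ≡ᵇ p) ∧ (s ≡ᵇ n)) unconstrained) 1 anyOutcome ∎

vpfR≡sumPrefs-run : ∀ n i → 1 ≤ i → i ≤ n → vpfR n i ≡ sumPrefs n n (λ w → 𝟙 (run n [] w (carPrefersParksIn i n) 1 anyOutcome))
vpfR≡sumPrefs-run n (suc k) _ i≤n = trans (count≡sumPrefs n (inVPFround n (suc k))) (sumPrefs-cong n n _ _ (λ w _ lw → cong 𝟙 (preference∧parksAt≡run n w k n (subst (k <_) (sym lw) i≤n))))

vpfS≡sumPrefs-run : ∀ n i → 1 ≤ i → i ≤ n → vpfS n i ≡ sumPrefs n n (λ w → 𝟙 (run n [] w (carPrefersLeftParksIn i n) 1 anyOutcome))
vpfS≡sumPrefs-run n (suc k) _ i≤n = trans (count≡sumPrefs n (inVPFsquare n (suc k))) (sumPrefs-cong n n _ _ (λ w _ lw → cong 𝟙 (preference∧parksAt≡run n w k (n ∸ 1) (subst (k <_) (sym lw) i≤n))))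

run-blocked : ∀ n occ w o i f I → i ≤ I → I < i + length w → (∀ a s → o I a s ≡ true → isOcc s occ ≡ true) → run n occ w o i f ≡ false
run-blocked n occ [] o i f I i≤I I< h = ⊥-elim (<-irrefl refl (≤-<-trans i≤I (subst (I <_) (+-identityʳ i) I<)))
run-blocked n occ (a ∷ w) o i f I i≤I I< h with spot n occ a in eq
... | nothing = refl
... | just s with i ≟ I
...   | yes refl with o i a s in eo
...     | true = ⊥-elim (case (trans (sym (h a s eo)) (spot-free n occ a s eq)))
  where
  case : true ≡ false → ⊥
  case ()
...     | false = refl
run-blocked n occ (a ∷ w) o i f I i≤I I< h | just s | no ne =
  trans (cong (o i a s ∧_) (run-blocked n (occ ++ [ s ]) w o (suc i) f I (≤∧≢⇒< i≤I ne) (subst (I <_) (+-suc i (length w)) I<) (λ a' s' e → isOcc-mono s' occ s (h a' s' e)))) (∧-zeroʳ _)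

run-cong-free : ∀ n occ w o o' i f → (∀ j a s → i ≤ j → isOcc s occ ≡ false → o j a s ≡ o' j a s) → run n occ w o i f ≡ run n occ w o' i f
run-cong-free n occ [] o o' i f h = refl
run-cong-free n occ (a ∷ w) o o' i f h with spot n occ a in eq
... | nothing = refl
... | just s = cong₂ _∧_ (h i a s ≤-refl (spot-free n occ a s eq))
   (run-cong-free n (occ ++ [ s ]) w o o' (suc i) f (λ j a' s' i<j fr → h j a' s' (<⇒≤ i<j) (isOcc-anti s' occ s fr)))

run-final-occupied : ∀ n occ w o i f t → isOcc t occ ≡ true → run n occ w o i (λ x → f x ∧ isOcc t x) ≡ run n occ w o i f
run-final-occupied n occ [] o i f t e = trans (cong (f occ ∧_) e) (∧-identityʳ _)
run-final-occupied n occ (a ∷ w) o i f t e with spot n occ a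
... | nothing = refl
... | just s = cong (o i a s ∧_) (run-final-occupied n (occ ++ [ s ]) w o (suc i) f t (isOcc-mono t occ s e))

sum-constrainAt-occupied : ∀ n occ w o i f t → isOcc t occ ≡ true →
  sumFrom i (length w) (λ j → 𝟙 (run n occ w (constrainAt j (parksIn t) o) i f)) ≡ 0
sum-constrainAt-occupied n occ w o i f t e = trans (sumFrom-cong i (length w) _ _ (λ j i≤j j< → cong 𝟙 (run-blocked n occ w (constrainAt j (parksIn t) o) i f j i≤j j< (λ a s h → subst (λ z → isOcc z occ ≡ true) (sym (kk j a s h)) e))))
   (sumFrom-0 i (length w))
  where
  kk : ∀ j a s → constrainAt j (parksIn t) o j a s ≡ true → s ≡ t
  kk j a s h = ≡ᵇ≡true⇒≡ s t (∧≡true⇒ʳ (o j a s) _ (trans (sym (constrainAt-same j (parksIn t) o a s)) h))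

-- Spot t is taken by at most one car, and by exactly one if it is taken at the end.
sum-constrainAt-parksIn : ∀ n occ w o i f t → isOcc t occ ≡ false →
  sumFrom i (length w) (λ j → 𝟙 (run n occ w (constrainAt j (parksIn t) o) i f)) ≡ 𝟙 (run n occ w o i (λ x → f x ∧ isOcc t x))
sum-constrainAt-parksIn n occ [] o i f t e = sym (cong 𝟙 (trans (cong (f occ ∧_) e) (∧-zeroʳ (f occ))))
sum-constrainAt-parksIn n occ (a ∷ w) o i f t e with spot n occ a in eq
... | nothing = sumFrom-0 (suc i) (length w)
... | just s = begin
    𝟙 (constrainAt i (parksIn t) o i a s ∧ run n occ' w (constrainAt i (parksIn t) o) (suc i) f) + sumFrom (suc i) (length w) (λ j → 𝟙 (constrainAt j (parksIn t) o i a s ∧ run n occ' w (constrainAt j (parksIn t) o) (suc i) f))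
      ≡⟨ cong₂ _+_ (cong₂ (λ u v → 𝟙 (u ∧ v)) (constrainAt-same i (parksIn t) o a s) (run-cong-from n occ' w _ o (suc i) f (λ j a' s' i<j → constrainAt-other i (parksIn t) o j a' s' (λ q → <-irrefl (sym q) i<j))))
           (sumFrom-cong (suc i) (length w) _ _ (λ j i<j _ → cong (λ u → 𝟙 (u ∧ run n occ' w (constrainAt j (parksIn t) o) (suc i) f)) (constrainAt-other j (parksIn t) o i a s (λ q → <-irrefl q i<j)))) ⟩
    𝟙 ((o i a s ∧ (s ≡ᵇ t)) ∧ run n occ' w o (suc i) f) + sumFrom (suc i) (length w) (λ j → 𝟙 (o i a s ∧ run n occ' w (constrainAt j (parksIn t) o) (suc i) f))
      ≡⟨ main (o i a s) (s ≡ᵇ t) refl refl ⟩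
    𝟙 (o i a s ∧ run n occ' w o (suc i) (λ x → f x ∧ isOcc t x)) ∎
  where
  occ' = occ ++ [ s ]
  main : ∀ b c → b ≡ o i a s → c ≡ (s ≡ᵇ t) → 𝟙 ((b ∧ c) ∧ run n occ' w o (suc i) f) + sumFrom (suc i) (length w) (λ j → 𝟙 (b ∧ run n occ' w (constrainAt j (parksIn t) o) (suc i) f))
       ≡ 𝟙 (b ∧ run n occ' w o (suc i) (λ x → f x ∧ isOcc t x))
  main false c _ _ = sumFrom-0 (suc i) (length w)
  main true true _ ec = begin
    𝟙 (run n occ' w o (suc i) f) + sumFrom (suc i) (length w) (λ j → 𝟙 (run n occ' w (constrainAt j (parksIn t) o) (suc i) f))
      ≡⟨ cong (𝟙 (run n occ' w o (suc i) f) +_) (sum-constrainAt-occupied n occ' w o (suc i) f t occt) ⟩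
    𝟙 (run n occ' w o (suc i) f) + 0 ≡⟨ +-identityʳ _ ⟩
    𝟙 (run n occ' w o (suc i) f) ≡⟨ cong 𝟙 (sym (run-final-occupied n occ' w o (suc i) f t occt)) ⟩
    𝟙 (run n occ' w o (suc i) (λ x → f x ∧ isOcc t x)) ∎
    where
    occt : isOcc t occ' ≡ true
    occt = subst (λ z → isOcc z occ' ≡ true) (≡ᵇ≡true⇒≡ s t (sym ec)) (isOcc-new occ s)
  main true false _ ec = sum-constrainAt-parksIn n occ' w o (suc i) f t (trans (isOcc-other t occ s (λ q → ≡ᵇ≡false⇒≢ s t (sym ec) (sym q))) e)

freeCount : ℕ → List ℕ → ℕ
freeCount n occ = sumFrom 1 n (λ x → 𝟙 (not (isOcc x occ)))

freeCount-snoc : ∀ n occ s → 1 ≤ s → s ≤ n → isOcc s occ ≡ false → freeCount n occ ≡ freeCount n (occ ++ [ s ]) + 1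
freeCount-snoc n occ s h1 h2 e = begin
  sumFrom 1 n (λ x → 𝟙 (not (isOcc x occ)))
    ≡⟨ sumFrom-cong 1 n _ _ (λ x _ _ → pw x) ⟩
  sumFrom 1 n (λ x → 𝟙 (not (isOcc x (occ ++ [ s ]))) + 𝟙 (x ≡ᵇ s))
    ≡⟨ sumFrom-+ 1 n _ _ ⟩
  freeCount n (occ ++ [ s ]) + sumFrom 1 n (λ x → 𝟙 (x ≡ᵇ s))
    ≡⟨ cong (freeCount n (occ ++ [ s ]) +_) (sumFrom-≡ᵇ-inside 1 n s h1 (s≤s h2)) ⟩
  freeCount n (occ ++ [ s ]) + 1 ∎
  where
  pw : ∀ x → 𝟙 (not (isOcc x occ)) ≡ 𝟙 (not (isOcc x (occ ++ [ s ]))) + 𝟙 (x ≡ᵇ s)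
  pw x with x ≟ s
  ... | yes refl = trans (cong (λ z → 𝟙 (not z)) e) (sym (cong₂ (λ u v → 𝟙 (not u) + 𝟙 v) (isOcc-new occ s) (≡ᵇ-refl s)))
  ... | no ne = sym (trans (cong₂ (λ u v → 𝟙 (not u) + 𝟙 v) (isOcc-other x occ s ne) (≢⇒≡ᵇ≡false x s ne)) (+-identityʳ _))

freeCount-[] : ∀ n → freeCount n [] ≡ n
freeCount-[] n = trans (sumFrom-const 1 n 1) (*-identityʳ n)

run-final-filled : ∀ n occ w o i f t → InRange n w → freeCount n occ ≡ length w → 1 ≤ t → t ≤ n →
  run n occ w o i (λ x → f x ∧ isOcc t x) ≡ run n occ w o i f
run-final-filled n occ [] o i f t iw e h1 h2 = trans (cong (f occ ∧_) (𝟙-not≡0⇒true _ (sumFrom≡0⇒term≡0 1 n _ t e h1 (s≤s h2)))) (∧-identityʳ _)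
run-final-filled n occ (a ∷ w) o i f t ((a1 , a2) ∷ iw) e h1 h2 with spot n occ a in eq
... | nothing = refl
... | just s = cong (o i a s ∧_) (run-final-filled n (occ ++ [ s ]) w o (suc i) f t iw
    (+-cancelʳ-≡ 1 _ _ (trans (sym (freeCount-snoc n occ s s1 s2 (spot-free n occ a s eq))) (trans e (+-comm 1 (length w))))) h1 h2)
  where
  s1 = proj₁ (proj₁ (spot-range n occ a s eq a1 a2))
  s2 = proj₂ (proj₁ (spot-range n occ a s eq a1 a2))

-- Only car I can end in spot t, so the constraints at spot t are consulted for car I alone.
run-cong-unique : ∀ n occ w o o' i f I t → i ≤ I → I < i + length w → (∀ a s → o I a s ≡ o' I a s) → (∀ a s → o I a s ≡ true → s ≡ t) →
  (∀ j a s → s ≢ t → o j a s ≡ o' j a s) → run n occ w o i f ≡ run n occ w o' i f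
run-cong-unique n occ [] o o' i f I t i≤I I< hI ht hother = ⊥-elim (<-irrefl refl (≤-<-trans i≤I (subst (I <_) (+-identityʳ i) I<)))
run-cong-unique n occ (a ∷ w) o o' i f I t i≤I I< hI ht hother with spot n occ a in eq
... | nothing = refl
... | just s with i ≟ I
...   | yes refl = trans (cong (_∧ run n (occ ++ [ s ]) w o (suc i) f) (hI a s)) (after (o' i a s) refl)
  where
  after : ∀ b → b ≡ o' i a s → b ∧ run n (occ ++ [ s ]) w o (suc i) f ≡ b ∧ run n (occ ++ [ s ]) w o' (suc i) f
  after false _ = refl
  after true e = run-cong-free n (occ ++ [ s ]) w o o' (suc i) f (λ j a' s' _ fr → hother j a' s' (λ q → contradiction (trans (sym fr) (subst (λ z → isOcc z (occ ++ [ s ]) ≡ true) (sym (trans q (sym (ht a s (trans (hI a s) (sym e)))))) (isOcc-new occ s))) (λ ())))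
...   | no ne with s ≟ t
...     | yes refl = trans (cong (o i a s ∧_) (run-blocked n (occ ++ [ s ]) w o (suc i) f I i<I I<' (λ a' s' h → subst (λ z → isOcc z (occ ++ [ s ]) ≡ true) (sym (ht a' s' h)) (isOcc-new occ s))))
               (trans (∧-zeroʳ _) (sym (trans (cong (o' i a s ∧_) (run-blocked n (occ ++ [ s ]) w o' (suc i) f I i<I I<' (λ a' s' h → subst (λ z → isOcc z (occ ++ [ s ]) ≡ true) (sym (ht a' s' (trans (hI a' s') h))) (isOcc-new occ s)))) (∧-zeroʳ _))))
  where
  i<I = ≤∧≢⇒< i≤I ne
  I<' = subst (I <_) (+-suc i (length w)) I<
...     | no nst = cong₂ _∧_ (hother i a s nst) (run-cong-unique n (occ ++ [ s ]) w o o' (suc i) f I t (≤∧≢⇒< i≤I ne) (subst (I <_) (+-suc i (length w)) I<) hI ht hother)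

run-never-occupies : ∀ n occ w o i (g : List ℕ → Bool) t → (∀ j a s → i ≤ j → o j a s ≡ true → s ≢ t) → isOcc t occ ≡ false → run n occ w o i (λ x → g x ∧ isOcc t x) ≡ false
run-never-occupies n occ [] o i g t h e = trans (cong (g occ ∧_) e) (∧-zeroʳ (g occ))
run-never-occupies n occ (a ∷ w) o i g t h e with spot n occ a
... | nothing = refl
... | just s with o i a s in eo
...   | false = refl
...   | true = run-never-occupies n (occ ++ [ s ]) w o (suc i) g t (λ j a' s' i<j → h j a' s' (<⇒≤ i<j)) (trans (isOcc-other t occ s (λ q → h i a s ≤-refl eo (sym q))) e)

-- Car I prefers t and ends in t + 1, so t is taken by then and no later car ends in t.
run-cong-left-filled : ∀ n occ w o o' i f I t → i ≤ I → (∀ j a s → j ≤ I → o j a s ≡ o' j a s) →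
  (∀ a s → o I a s ≡ true → (a ≡ t) × (s ≡ suc t)) → (∀ j a s → s ≢ t → o j a s ≡ o' j a s) →
  run n occ w o i f ≡ run n occ w o' i f
run-cong-left-filled n occ [] o o' i f I t i≤I hle hI ho = refl
run-cong-left-filled n occ (a ∷ w) o o' i f I t i≤I hle hI ho with spot n occ a in eq
... | nothing = refl
... | just s with i ≟ I
...   | yes refl = trans (cong (_∧ run n (occ ++ [ s ]) w o (suc i) f) (hle i a s ≤-refl)) (after (o' i a s) refl)
  where
  after : ∀ b → b ≡ o' i a s → b ∧ run n (occ ++ [ s ]) w o (suc i) f ≡ b ∧ run n (occ ++ [ s ]) w o' (suc i) f
  after false _ = refl
  after true e = run-cong-free n (occ ++ [ s ]) w o o' (suc i) f (λ j a' s' _ fr → ho j a' s' (λ q → contradiction (trans (sym fr) (subst (λ z → isOcc z (occ ++ [ s ]) ≡ true) (sym q) (isOcc-mono t occ s tocc))) (λ ())))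
    where
    hh = hI a s (trans (hle i a s ≤-refl) (sym e))
    tocc : isOcc t occ ≡ true
    tocc = sv (subst (SpotView n occ a) eq (spot-view n occ a)) (proj₁ hh) (proj₂ hh)
      where
      sv : ∀ {x} → SpotView n occ a (just x) → a ≡ t → x ≡ suc t → isOcc t occ ≡ true
      sv (sv-here _) refl e2 = ⊥-elim (<-irrefl e2 (n<1+n a))
      sv (sv-left _ _ _) refl e2 = ⊥-elim (<-irrefl e2 (≤-<-trans (m∸n≤m a 1) (n<1+n a)))
      sv (sv-right e1 _ _ _) refl e2 = e1
...   | no ne = cong₂ _∧_ (hle i a s i≤I) (run-cong-left-filled n (occ ++ [ s ]) w o o' (suc i) f I t (≤∧≢⇒< i≤I ne) hle hI ho)

run-split-constraint : ∀ n occ w o i f I (P Q1 Q2 : ℕ → ℕ → Bool) → InRange n w → i ≤ I → I < i + length w →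
  (∀ a s → 1 ≤ a → a ≤ n → 1 ≤ s → s ≤ n → Adjacent a s → 𝟙 (P a s) ≡ 𝟙 (Q1 a s) + 𝟙 (Q2 a s)) →
  𝟙 (run n occ w (constrainAt I P o) i f) ≡ 𝟙 (run n occ w (constrainAt I Q1 o) i f) + 𝟙 (run n occ w (constrainAt I Q2 o) i f)
run-split-constraint n occ [] o i f I P Q1 Q2 iw i≤I I< h = ⊥-elim (<-irrefl refl (≤-<-trans i≤I (subst (I <_) (+-identityʳ i) I<)))
run-split-constraint n occ (a ∷ w) o i f I P Q1 Q2 ((a1 , a2) ∷ iw) i≤I I< h with spot n occ a in eq
... | nothing = refl
... | just s with i ≟ I
...   | yes refl = begin
      𝟙 (constrainAt i P o i a s ∧ run n occ' w (constrainAt i P o) (suc i) f)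
        ≡⟨ cong₂ (λ u v → 𝟙 (u ∧ v)) (constrainAt-same i P o a s) (run-constrainAt-past n occ' w o i P f) ⟩
      𝟙 ((o i a s ∧ P a s) ∧ run n occ' w o (suc i) f)
        ≡⟨ 𝟙-∧-split (o i a s) (P a s) (Q1 a s) (Q2 a s) _ (h a s a1 a2 s1 s2 adj) ⟩
      𝟙 ((o i a s ∧ Q1 a s) ∧ run n occ' w o (suc i) f) + 𝟙 ((o i a s ∧ Q2 a s) ∧ run n occ' w o (suc i) f)
        ≡⟨ sym (cong₂ _+_ (cong₂ (λ u v → 𝟙 (u ∧ v)) (constrainAt-same i Q1 o a s) (run-constrainAt-past n occ' w o i Q1 f)) (cong₂ (λ u v → 𝟙 (u ∧ v)) (constrainAt-same i Q2 o a s) (run-constrainAt-past n occ' w o i Q2 f))) ⟩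
      𝟙 (constrainAt i Q1 o i a s ∧ run n occ' w (constrainAt i Q1 o) (suc i) f) + 𝟙 (constrainAt i Q2 o i a s ∧ run n occ' w (constrainAt i Q2 o) (suc i) f) ∎
  where
  occ' = occ ++ [ s ]
  sr = spot-range n occ a s eq a1 a2
  s1 = proj₁ (proj₁ sr)
  s2 = proj₂ (proj₁ sr)
  adj = proj₂ sr
...   | no ne = begin
      𝟙 (constrainAt I P o i a s ∧ run n occ' w (constrainAt I P o) (suc i) f)
        ≡⟨ cong (λ u → 𝟙 (u ∧ run n occ' w (constrainAt I P o) (suc i) f)) (constrainAt-other I P o i a s ne) ⟩
      𝟙 (o i a s ∧ run n occ' w (constrainAt I P o) (suc i) f)
        ≡⟨ step (o i a s) ⟩
      𝟙 (o i a s ∧ run n occ' w (constrainAt I Q1 o) (suc i) f) + 𝟙 (o i a s ∧ run n occ' w (constrainAt I Q2 o) (suc i) f)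
        ≡⟨ sym (cong₂ _+_ (cong (λ u → 𝟙 (u ∧ run n occ' w (constrainAt I Q1 o) (suc i) f)) (constrainAt-other I Q1 o i a s ne)) (cong (λ u → 𝟙 (u ∧ run n occ' w (constrainAt I Q2 o) (suc i) f)) (constrainAt-other I Q2 o i a s ne))) ⟩
      𝟙 (constrainAt I Q1 o i a s ∧ run n occ' w (constrainAt I Q1 o) (suc i) f) + 𝟙 (constrainAt I Q2 o i a s ∧ run n occ' w (constrainAt I Q2 o) (suc i) f) ∎
  where
  occ' = occ ++ [ s ]
  step : ∀ b → 𝟙 (b ∧ run n occ' w (constrainAt I P o) (suc i) f) ≡ 𝟙 (b ∧ run n occ' w (constrainAt I Q1 o) (suc i) f) + 𝟙 (b ∧ run n occ' w (constrainAt I Q2 o) (suc i) f)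
  step false = refl
  step true = run-split-constraint n occ' w o (suc i) f I P Q1 Q2 iw (≤∧≢⇒< i≤I ne) (subst (I <_) (+-suc i (length w)) I<) h

parksIn-last-split : ∀ n a s → 1 ≤ n → a ≤ n → Adjacent a s → 𝟙 (s ≡ᵇ n) ≡ 𝟙 ((a ≡ᵇ n) ∧ (s ≡ᵇ n)) + 𝟙 ((a ≡ᵇ n ∸ 1) ∧ (s ≡ᵇ n))
parksIn-last-split n a s 1≤n a≤n adj with s ≟ n
... | no ne = trans (cong 𝟙 (≢⇒≡ᵇ≡false s n ne)) (sym (cong₂ _+_ (cong 𝟙 (trans (cong ((a ≡ᵇ n) ∧_) (≢⇒≡ᵇ≡false s n ne)) (∧-zeroʳ _))) (cong 𝟙 (trans (cong ((a ≡ᵇ n ∸ 1) ∧_) (≢⇒≡ᵇ≡false s n ne)) (∧-zeroʳ _)))))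
parksIn-last-split (suc n) a .(suc n) 1≤n a≤n (inj₁ refl) | yes refl = trans (cong 𝟙 (≡ᵇ-refl n)) (sym (cong₂ _+_ (cong 𝟙 (trans (cong (_∧ (n ≡ᵇ n)) (≡ᵇ-refl n)) (≡ᵇ-refl n))) (cong 𝟙 (trans (cong (_∧ (n ≡ᵇ n)) (≢⇒≡ᵇ≡false (suc n) n (λ q → <-irrefl (sym q) (n<1+n n)))) refl))))
parksIn-last-split (suc n) a .(suc n) 1≤n a≤n (inj₂ (inj₁ refl)) | yes refl = ⊥-elim (<-irrefl refl a≤n)
parksIn-last-split (suc n) n .(suc n) 1≤n a≤n (inj₂ (inj₂ refl)) | yes refl = trans (cong 𝟙 (≡ᵇ-refl n)) (sym (cong₂ _+_ (cong 𝟙 (trans (cong (_∧ (n ≡ᵇ n)) (≢⇒≡ᵇ≡false n (suc n) (λ q → <-irrefl q (n<1+n n)))) refl)) (cong 𝟙 (trans (cong (_∧ (n ≡ᵇ n)) (≡ᵇ-refl n)) (≡ᵇ-refl n)))))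

countOn : ℕ → List ℕ → ℕ → Constraint → ℕ → (List ℕ → Bool) → ℕ → Maybe ℕ → ℕ
countOn n occ a o i f r x = sumPrefs n r (λ w → 𝟙 (runOn n occ a w o i f x))

countOn-just : ∀ n occ a o i f r s → countOn n occ a o i f r (just s) ≡ (if o i a s then sumPrefs n r (λ w → 𝟙 (run n (occ ++ [ s ]) w o (suc i) f)) else 0)
countOn-just n occ a o i f r s with o i a s
... | true = refl
... | false = sumPrefs-0 n r

countOn-nothing : ∀ n occ a o i f r → countOn n occ a o i f r nothing ≡ 0
countOn-nothing n occ a o i f r = sumPrefs-0 n r

sumPrefs-by-car-at : ∀ n t o → 1 ≤ t → t ≤ n → sumPrefs n n (λ w → 𝟙 (run n [] w o 1 anyOutcome)) ≡ sumFrom 1 n (λ k → sumPrefs n n (λ w → 𝟙 (run n [] w (constrainAt k (parksIn t) o) 1 anyOutcome)))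
sumPrefs-by-car-at n t o h1 h2 = trans (sumPrefs-cong n n _ _ pw) (sumPrefs-sumFrom n n 1 n _)
  where
  pw : ∀ w → InRange n w → length w ≡ n → 𝟙 (run n [] w o 1 anyOutcome) ≡ sumFrom 1 n (λ k → 𝟙 (run n [] w (constrainAt k (parksIn t) o) 1 anyOutcome))
  pw w iw lw = trans (cong 𝟙 (sym (run-final-filled n [] w o 1 anyOutcome t iw (trans (freeCount-[] n) (sym lw)) h1 h2)))
     (trans (sym (sum-constrainAt-parksIn n [] w o 1 anyOutcome t refl)) (cong (λ z → sumFrom 1 z (λ k → 𝟙 (run n [] w (constrainAt k (parksIn t) o) 1 anyOutcome))) lw))

sumPrefs-final-by-car-at : ∀ n t o → sumPrefs n n (λ w → 𝟙 (run n [] w o 1 (isOcc t))) ≡ sumFrom 1 n (λ k → sumPrefs n n (λ w → 𝟙 (run n [] w (constrainAt k (parksIn t) o) 1 anyOutcome)))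
sumPrefs-final-by-car-at n t o = trans (sumPrefs-cong n n _ _ pw) (sumPrefs-sumFrom n n 1 n _)
  where
  pw : ∀ w → InRange n w → length w ≡ n → 𝟙 (run n [] w o 1 (isOcc t)) ≡ sumFrom 1 n (λ k → 𝟙 (run n [] w (constrainAt k (parksIn t) o) 1 anyOutcome))
  pw w iw lw = trans (sym (sum-constrainAt-parksIn n [] w o 1 anyOutcome t refl)) (cong (λ z → sumFrom 1 z (λ k → 𝟙 (run n [] w (constrainAt k (parksIn t) o) 1 anyOutcome))) lw)

sumPrefs-impossible : ∀ n k o f → 1 ≤ k → k ≤ n → (∀ a s → o k a s ≡ false) → sumPrefs n n (λ w → 𝟙 (run n [] w o 1 f)) ≡ 0
sumPrefs-impossible n k o f h1 h2 h = trans (sumPrefs-cong n n _ (λ _ → 0) (λ w _ lw → cong 𝟙 (run-blocked n [] w o 1 f k h1 (s≤s (subst (k ≤_) (sym lw) h2)) (λ a s e → contradiction (trans (sym (h a s)) e) (λ ()))))) (sumPrefs-0 n n)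

sumPrefs-cong-unique : ∀ n o o' f k t → 1 ≤ k → k ≤ n → (∀ a s → o k a s ≡ o' k a s) → (∀ a s → o k a s ≡ true → s ≡ t) →
  (∀ j a s → s ≢ t → o j a s ≡ o' j a s) → sumPrefs n n (λ w → 𝟙 (run n [] w o 1 f)) ≡ sumPrefs n n (λ w → 𝟙 (run n [] w o' 1 f))
sumPrefs-cong-unique n o o' f k t h1 h2 hk ht ho = sumPrefs-cong n n _ _ (λ w _ lw → cong 𝟙 (run-cong-unique n [] w o o' 1 f k t h1 (s≤s (subst (k ≤_) (sym lw) h2)) hk ht ho))

-- Who takes the last spot

vpf≡sum-vpfI : ∀ n → 1 ≤ n → vpf n ≡ sumRange 1 n (λ j → vpfI n j)
vpf≡sum-vpfI n 1≤n = begin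
  vpf n ≡⟨ vpf≡sumPrefs-run n ⟩
  sumPrefs n n (λ w → 𝟙 (run n [] w unconstrained 1 anyOutcome))
    ≡⟨ sumPrefs-cong n n _ _ pw ⟩
  sumPrefs n n (λ w → sumFrom 1 n (λ j → 𝟙 (run n [] w (carParksIn j n) 1 anyOutcome)))
    ≡⟨ sumPrefs-sumFrom n n 1 n (λ j w → 𝟙 (run n [] w (carParksIn j n) 1 anyOutcome)) ⟩
  sumFrom 1 n (λ j → sumPrefs n n (λ w → 𝟙 (run n [] w (carParksIn j n) 1 anyOutcome)))
    ≡⟨ sumFrom-cong 1 n _ _ (λ j h1 h2 → sym (vpfI≡sumPrefs-run n j h1 (≤-pred h2))) ⟩
  sumFrom 1 n (λ j → vpfI n j)
    ≡⟨ sym (sumRange≡sumFrom 1 n (λ j → vpfI n j)) ⟩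
  sumRange 1 n (λ j → vpfI n j) ∎
  where
  pw : ∀ w → InRange n w → length w ≡ n → 𝟙 (run n [] w unconstrained 1 anyOutcome) ≡ sumFrom 1 n (λ j → 𝟙 (run n [] w (carParksIn j n) 1 anyOutcome))
  pw w iw lw = begin
    𝟙 (run n [] w unconstrained 1 anyOutcome) ≡⟨ cong 𝟙 (sym (run-final-filled n [] w unconstrained 1 anyOutcome n iw (trans (freeCount-[] n) (sym lw)) 1≤n ≤-refl)) ⟩
    𝟙 (run n [] w unconstrained 1 (λ x → anyOutcome x ∧ isOcc n x)) ≡⟨ sym (sum-constrainAt-parksIn n [] w unconstrained 1 anyOutcome n refl) ⟩
    sumFrom 1 (length w) (λ j → 𝟙 (run n [] w (carParksIn j n) 1 anyOutcome)) ≡⟨ cong (λ z → sumFrom 1 z (λ j → 𝟙 (run n [] w (carParksIn j n) 1 anyOutcome))) lw ⟩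
    sumFrom 1 n (λ j → 𝟙 (run n [] w (carParksIn j n) 1 anyOutcome)) ∎

vpfI≡vpfR+vpfS : ∀ n i → 1 ≤ i → i ≤ n → vpfI n i ≡ vpfR n i + vpfS n i
vpfI≡vpfR+vpfS n i 1≤i i≤n = begin
  vpfI n i ≡⟨ vpfI≡sumPrefs-run n i 1≤i i≤n ⟩
  sumPrefs n n (λ w → 𝟙 (run n [] w (carParksIn i n) 1 anyOutcome))
    ≡⟨ sumPrefs-cong n n _ _ (λ w iw lw → run-split-constraint n [] w unconstrained 1 anyOutcome i _ _ _ iw 1≤i (s≤s (subst (i ≤_) (sym lw) i≤n)) (λ a s _ a≤n _ _ adj → parksIn-last-split n a s (≤-trans 1≤i i≤n) a≤n adj)) ⟩
  sumPrefs n n (λ w → 𝟙 (run n [] w (carPrefersParksIn i n) 1 anyOutcome) + 𝟙 (run n [] w (carPrefersLeftParksIn i n) 1 anyOutcome))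
    ≡⟨ sumPrefs-+ n n _ _ ⟩
  sumPrefs n n (λ w → 𝟙 (run n [] w (carPrefersParksIn i n) 1 anyOutcome)) + sumPrefs n n (λ w → 𝟙 (run n [] w (carPrefersLeftParksIn i n) 1 anyOutcome))
    ≡⟨ sym (cong₂ _+_ (vpfR≡sumPrefs-run n i 1≤i i≤n) (vpfS≡sumPrefs-run n i 1≤i i≤n)) ⟩
  vpfR n i + vpfS n i ∎

-- Deleting the last spot

-- When spot m = p + 1 is taken, a run on m spots is a run on p spots, except that a car
-- preferring m falls back to p: countSmallFilled counts, via viaLast, the runs on p spots in
-- which the car ending in spot p stands for such a car.
module DropLastSpot (p : ℕ) (hp : 1 ≤ p) where
  m : ℕ
  m = suc p

  viaLast : Constraint → Constraint
  viaLast o j a s = if s ≡ᵇ p then (a ≡ᵇ p) ∧ o j m p else o j a s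

  countBig : List ℕ → Constraint → ℕ → ℕ → ℕ
  countBig occ o i r = sumPrefs m r (λ w → 𝟙 (run m occ w o i anyOutcome))

  countSmall : List ℕ → Constraint → ℕ → ℕ → ℕ
  countSmall occ o i r = sumPrefs p r (λ w → 𝟙 (run p occ w o i anyOutcome))

  countSmallFilled : List ℕ → Constraint → ℕ → ℕ → ℕ
  countSmallFilled occ o i r = sumPrefs p r (λ w → 𝟙 (run p occ w (viaLast o) i (isOcc p)))

  countSmallFilled≡countSmall : ∀ occ' o i r → isOcc p occ' ≡ true → countSmallFilled occ' o i r ≡ countSmall occ' o i r
  countSmallFilled≡countSmall occ' o i r e = sumPrefs-cong p r _ _ (λ w _ _ → cong 𝟙 (trans
     (run-cong-free p occ' w (viaLast o) o i (isOcc p) (λ j a s _ fr → st j a s (λ q → subst (λ z → isOcc z occ' ≡ false → ⊥) (sym q) (λ h → contradiction (trans (sym e) h) (λ ())) fr)))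
     (run-final-occupied p occ' w o i anyOutcome p e)))
    where
    st : ∀ j a s → s ≢ p → viaLast o j a s ≡ o j a s
    st j a s ne = cong (λ z → if z then (a ≡ᵇ p) ∧ o j m p else o j a s) (≢⇒≡ᵇ≡false s p ne)

  AgreeExcept-last : ∀ occ → AgreeExcept m (occ ++ [ m ]) occ
  AgreeExcept-last occ x ne = isOcc-other x occ m ne

  countBig-blocked : ∀ J o → (∀ a s → o J a s ≡ true → s ≡ m) →
    ∀ occ i r → isOcc m occ ≡ true → i ≤ J → J < i + r → countBig occ o i r ≡ 0
  countBig-blocked J o hJ occ i r em i≤J J< = trans (sumPrefs-cong m r _ _ (λ w _ lw → cong 𝟙 (run-blocked m occ w o i anyOutcome J i≤J (subst (λ z → J < i + z) (sym lw) J<)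
      (λ a s h → subst (λ z → isOcc z occ ≡ true) (sym (hJ a s h)) em)))) (sumPrefs-0 m r)

  LastOccupied : ℕ → Set
  LastOccupied r = ∀ occ occ' o i → AgreeExcept m occ occ' → isOcc m occ ≡ true →
    countBig occ o i r ≡ countSmall occ' o i r + (if isOcc p occ then 0 else countSmallFilled occ' o i r)

  LastOccupied-filled : ∀ r → LastOccupied r → ∀ occ occ' o i → AgreeExcept m occ occ' → isOcc m occ ≡ true →
    isOcc p occ ≡ true → countBig occ o i r ≡ countSmall occ' o i r
  LastOccupied-filled r ih occ occ' o i rel em ep =
    trans (ih occ occ' o i rel em) (trans (cong (λ z → countSmall occ' o i r + (if z then 0 else countSmallFilled occ' o i r)) ep) (+-identityʳ _))

  countBig-last-filled-step : ∀ r → LastOccupied r → ∀ occ occ' o i → AgreeExcept m occ occ' → isOcc m occ ≡ true →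
    isOcc p occ ≡ true → countBig occ o i (suc r) ≡ countSmall occ' o i (suc r)
  countBig-last-filled-step r ih occ occ' o i rel em ep = begin
      countBig occ o i (suc r)
        ≡⟨ sumPrefs-suc m r _ ⟩
      sumFrom 1 m (λ a → countOn m occ a o i anyOutcome r (spot m occ a))
        ≡⟨ sumFrom-suc 1 p _ ⟩
      sumFrom 1 p (λ a → countOn m occ a o i anyOutcome r (spot m occ a)) + countOn m occ m o i anyOutcome r (spot m occ m)
        ≡⟨ cong₂ _+_ (sumFrom-cong 1 p _ _ (λ a h1 h2 → pw a h1 (≤-pred h2))) (trans (cong (countOn m occ m o i anyOutcome r) (trans (spot-last-occupied p occ hp em) (cong (λ z → if z then nothing else just p) ep))) (countOn-nothing m occ m o i anyOutcome r)) ⟩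
      sumFrom 1 p (λ a → countOn p occ' a o i anyOutcome r (spot p occ' a)) + 0
        ≡⟨ +-identityʳ _ ⟩
      sumFrom 1 p (λ a → countOn p occ' a o i anyOutcome r (spot p occ' a))
        ≡⟨ sym (sumPrefs-suc p r _) ⟩
      countSmall occ' o i (suc r) ∎
    where
    pw : ∀ a → 1 ≤ a → a ≤ p → countOn m occ a o i anyOutcome r (spot m occ a) ≡ countOn p occ' a o i anyOutcome r (spot p occ' a)
    pw a h1 h2 = trans (cong (countOn m occ a o i anyOutcome r) (spot-drop-last-occupied p occ occ' a h1 h2 rel em)) (go (spot p occ' a) refl)
      where
      go : ∀ x → spot p occ' a ≡ x → countOn m occ a o i anyOutcome r x ≡ countOn p occ' a o i anyOutcome r x
      go nothing _ = trans (countOn-nothing m occ a o i anyOutcome r) (sym (countOn-nothing p occ' a o i anyOutcome r))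
      go (just s) _ = trans (countOn-just m occ a o i anyOutcome r s) (trans (if-then-0-cong (o i a s)
        (LastOccupied-filled r (ih) (occ ++ [ s ]) (occ' ++ [ s ]) o (suc i) (AgreeExcept-snoc m occ occ' s rel) (isOcc-mono m occ s em) (isOcc-mono p occ s ep)))
        (sym (countOn-just p occ' a o i anyOutcome r s)))

  countBig-last-free-step : ∀ r → LastOccupied r → ∀ occ occ' o i → AgreeExcept m occ occ' → isOcc m occ ≡ true →
    isOcc p occ ≡ false → countBig occ o i (suc r) ≡ countSmall occ' o i (suc r) + countSmallFilled occ' o i (suc r)
  countBig-last-free-step r ih occ occ' o i rel em ep = begin
      countBig occ o i (suc r)
        ≡⟨ sumPrefs-suc m r _ ⟩
      sumFrom 1 m (λ a → countOn m occ a o i anyOutcome r (spot m occ a))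
        ≡⟨ sumFrom-suc 1 p _ ⟩
      sumFrom 1 p (λ a → countOn m occ a o i anyOutcome r (spot m occ a)) + Lmm
        ≡⟨ cong (sumFrom 1 p (λ a → countOn m occ a o i anyOutcome r (spot m occ a)) +_) (sym (sumFrom-≡ᵇ-last p Lmm hp)) ⟩
      sumFrom 1 p (λ a → countOn m occ a o i anyOutcome r (spot m occ a)) + sumFrom 1 p (λ a → if a ≡ᵇ p then Lmm else 0)
        ≡⟨ sym (sumFrom-+ 1 p _ _) ⟩
      sumFrom 1 p (λ a → countOn m occ a o i anyOutcome r (spot m occ a) + (if a ≡ᵇ p then Lmm else 0))
        ≡⟨ sumFrom-cong 1 p _ _ (λ a h1 h2 → pw a h1 (≤-pred h2)) ⟩
      sumFrom 1 p (λ a → countOn p occ' a o i anyOutcome r (spot p occ' a) + countOn p occ' a (viaLast o) i (isOcc p) r (spot p occ' a))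
        ≡⟨ sumFrom-+ 1 p _ _ ⟩
      sumFrom 1 p (λ a → countOn p occ' a o i anyOutcome r (spot p occ' a)) + sumFrom 1 p (λ a → countOn p occ' a (viaLast o) i (isOcc p) r (spot p occ' a))
        ≡⟨ sym (cong₂ _+_ (sumPrefs-suc p r _) (sumPrefs-suc p r _)) ⟩
      countSmall occ' o i (suc r) + countSmallFilled occ' o i (suc r) ∎
    where
    Lmm : ℕ
    Lmm = countOn m occ m o i anyOutcome r (spot m occ m)
    ep' : isOcc p occ' ≡ false
    ep' = trans (sym (rel p (λ q → <-irrefl q ≤-refl))) ep
    Lmm≡ : Lmm ≡ (if o i m p then countSmall (occ' ++ [ p ]) o (suc i) r else 0)
    Lmm≡ = trans (cong (countOn m occ m o i anyOutcome r) (trans (spot-last-occupied p occ hp em) (cong (λ z → if z then nothing else just p) ep)))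
           (trans (countOn-just m occ m o i anyOutcome r p) (if-then-0-cong (o i m p)
             (LastOccupied-filled r (ih) (occ ++ [ p ]) (occ' ++ [ p ]) o (suc i) (AgreeExcept-snoc m occ occ' p rel) (isOcc-mono m occ p em) (isOcc-new occ p))))
    pw : ∀ a → 1 ≤ a → a ≤ p → countOn m occ a o i anyOutcome r (spot m occ a) + (if a ≡ᵇ p then Lmm else 0)
        ≡ countOn p occ' a o i anyOutcome r (spot p occ' a) + countOn p occ' a (viaLast o) i (isOcc p) r (spot p occ' a)
    pw a h1 h2 = trans (cong (λ z → countOn m occ a o i anyOutcome r z + (if a ≡ᵇ p then Lmm else 0)) (spot-drop-last-occupied p occ occ' a h1 h2 rel em)) (go (spot p occ' a) refl)
      where
      go : ∀ x → spot p occ' a ≡ x → countOn m occ a o i anyOutcome r x + (if a ≡ᵇ p then Lmm else 0) ≡ countOn p occ' a o i anyOutcome r x + countOn p occ' a (viaLast o) i (isOcc p) r x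
      go nothing sx with a ≟ p
      ... | yes refl = contradiction (trans (sym (spot-here p occ' a ep')) sx) (λ ())
      ... | no ne = trans (cong₂ _+_ (countOn-nothing m occ a o i anyOutcome r) (cong (λ z → if z then Lmm else 0) (≢⇒≡ᵇ≡false a p ne)))
                    (sym (cong₂ _+_ (countOn-nothing p occ' a o i anyOutcome r) (countOn-nothing p occ' a (viaLast o) i (isOcc p) r)))
      go (just s) sx with s ≟ p
      ... | yes refl with a ≟ s
      ...   | yes refl = begin
          countOn m occ a o i anyOutcome r (just a) + (if a ≡ᵇ a then Lmm else 0)
            ≡⟨ cong₂ _+_ (countOn-just m occ a o i anyOutcome r a) (cong (λ z → if z then Lmm else 0) (≡ᵇ-refl a)) ⟩
          (if o i a a then sumPrefs m r (λ w → 𝟙 (run m (occ ++ [ a ]) w o (suc i) anyOutcome)) else 0) + Lmm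
            ≡⟨ cong₂ _+_ (if-then-0-cong (o i a a) (LastOccupied-filled r (ih) (occ ++ [ a ]) (occ' ++ [ a ]) o (suc i) (AgreeExcept-snoc m occ occ' a rel) (isOcc-mono m occ a em) (isOcc-new occ a))) Lmm≡ ⟩
          (if o i a a then countSmall (occ' ++ [ a ]) o (suc i) r else 0) + (if o i m a then countSmall (occ' ++ [ a ]) o (suc i) r else 0)
            ≡⟨ cong₂ _+_ (sym (countOn-just p occ' a o i anyOutcome r a)) (sym (trans (countOn-just p occ' a (viaLast o) i (isOcc p) r a)
                 (trans (cong (λ z → if z then countSmallFilled (occ' ++ [ a ]) o (suc i) r else 0) (trans (cong (λ z → if z then (a ≡ᵇ a) ∧ o i m a else o i a a) (≡ᵇ-refl a)) (cong (_∧ o i m a) (≡ᵇ-refl a))))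
                   (if-then-0-cong (o i m a) (countSmallFilled≡countSmall (occ' ++ [ a ]) o (suc i) r (isOcc-new occ' a)))))) ⟩
          countOn p occ' a o i anyOutcome r (just a) + countOn p occ' a (viaLast o) i (isOcc p) r (just a) ∎
      ...   | no ne = begin
          countOn m occ a o i anyOutcome r (just s) + (if a ≡ᵇ s then Lmm else 0)
            ≡⟨ cong₂ _+_ (countOn-just m occ a o i anyOutcome r s) (cong (λ z → if z then Lmm else 0) (≢⇒≡ᵇ≡false a s ne)) ⟩
          (if o i a s then sumPrefs m r (λ w → 𝟙 (run m (occ ++ [ s ]) w o (suc i) anyOutcome)) else 0) + 0
            ≡⟨ cong (_+ 0) (if-then-0-cong (o i a s) (LastOccupied-filled r (ih) (occ ++ [ s ]) (occ' ++ [ s ]) o (suc i) (AgreeExcept-snoc m occ occ' s rel) (isOcc-mono m occ s em) (isOcc-new occ s))) ⟩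
          (if o i a s then countSmall (occ' ++ [ s ]) o (suc i) r else 0) + 0
            ≡⟨ cong₂ _+_ (sym (countOn-just p occ' a o i anyOutcome r s)) (sym (trans (countOn-just p occ' a (viaLast o) i (isOcc p) r s)
                 (cong (λ z → if z then countSmallFilled (occ' ++ [ s ]) o (suc i) r else 0) (trans (cong (λ z → if z then (a ≡ᵇ s) ∧ o i m s else o i a s) (≡ᵇ-refl s)) (cong (_∧ o i m s) (≢⇒≡ᵇ≡false a s ne)))))) ⟩
          countOn p occ' a o i anyOutcome r (just s) + countOn p occ' a (viaLast o) i (isOcc p) r (just s) ∎
      go (just s) sx | no nsp = begin
          countOn m occ a o i anyOutcome r (just s) + (if a ≡ᵇ p then Lmm else 0)
            ≡⟨ cong₂ _+_ (countOn-just m occ a o i anyOutcome r s) (cong (λ z → if z then Lmm else 0) (≢⇒≡ᵇ≡false a p anp)) ⟩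
          (if o i a s then sumPrefs m r (λ w → 𝟙 (run m (occ ++ [ s ]) w o (suc i) anyOutcome)) else 0) + 0
            ≡⟨ +-identityʳ _ ⟩
          (if o i a s then sumPrefs m r (λ w → 𝟙 (run m (occ ++ [ s ]) w o (suc i) anyOutcome)) else 0)
            ≡⟨ if-then-0-cong (o i a s) (trans (ih (occ ++ [ s ]) (occ' ++ [ s ]) o (suc i) (AgreeExcept-snoc m occ occ' s rel) (isOcc-mono m occ s em))
                  (cong (λ z → countSmall (occ' ++ [ s ]) o (suc i) r + (if z then 0 else countSmallFilled (occ' ++ [ s ]) o (suc i) r)) (trans (isOcc-other p occ s (λ q → nsp (sym q))) ep))) ⟩
          (if o i a s then countSmall (occ' ++ [ s ]) o (suc i) r + countSmallFilled (occ' ++ [ s ]) o (suc i) r else 0)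
            ≡⟨ if-then-0-+ (o i a s) _ _ ⟩
          (if o i a s then countSmall (occ' ++ [ s ]) o (suc i) r else 0) + (if o i a s then countSmallFilled (occ' ++ [ s ]) o (suc i) r else 0)
            ≡⟨ cong₂ _+_ (sym (countOn-just p occ' a o i anyOutcome r s)) (sym (trans (countOn-just p occ' a (viaLast o) i (isOcc p) r s)
                 (cong (λ z → if z then countSmallFilled (occ' ++ [ s ]) o (suc i) r else 0) (cong (λ z → if z then (a ≡ᵇ p) ∧ o i m p else o i a s) (≢⇒≡ᵇ≡false s p nsp))))) ⟩
          countOn p occ' a o i anyOutcome r (just s) + countOn p occ' a (viaLast o) i (isOcc p) r (just s) ∎
        where
        anp : a ≢ p
        anp refl = nsp (just-injective (trans (sym sx) (spot-here p occ' a ep')))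

  countBig-last-occupied : ∀ r → LastOccupied r
  countBig-last-occupied zero occ occ' o i rel em with isOcc p occ in ep
  ... | true = refl
  ... | false = sym (cong (λ z → 1 + (𝟙 z + 0)) (trans (sym (rel p (λ q → <-irrefl q ≤-refl))) ep))
  countBig-last-occupied (suc r) occ occ' o i rel em with isOcc p occ in ep
  ... | true = trans (countBig-last-filled-step r (countBig-last-occupied r) occ occ' o i rel em ep) (sym (+-identityʳ _))
  ... | false = countBig-last-free-step r (countBig-last-occupied r) occ occ' o i rel em ep

  skipCar : ℕ → Constraint → Constraint
  skipCar J o j a s = if j <ᵇ J then o j a s else o (suc j) a s

  skipCarFilled : ℕ → Constraint → Constraint
  skipCarFilled J o j a s = if j <ᵇ J then o j a s ∧ not (s ≡ᵇ p) else viaLast o (suc j) a s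

  countSmallSkip : ℕ → Constraint → List ℕ → ℕ → ℕ → ℕ
  countSmallSkip J o occ i r = sumPrefs p r (λ w → 𝟙 (run p occ w (skipCarFilled J o) i (isOcc p)))

-- Deleting car J, which prefers and takes the last spot m, renumbers the later cars (skipCar).
module RemoveLastSpotCar (p : ℕ) (hp : 1 ≤ p) (J : ℕ) (o : Constraint) (hJm : o J (suc p) (suc p) ≡ true)
   (hJ : ∀ a s → o J a s ≡ true → (a ≡ suc p) × (s ≡ suc p)) where
  open DropLastSpot p hp

  countSmall-skip : ∀ occ r → countSmall occ o (suc J) r ≡ countSmall occ (skipCar J o) J r
  countSmall-skip occ r = sumPrefs-cong p r _ _ (λ w _ _ → cong 𝟙 (trans (run-shift p occ w o J anyOutcome)
     (run-cong-from p occ w _ _ J anyOutcome (λ k a s J≤k → sym (cong (λ z → if z then o k a s else o (suc k) a s) (≥⇒<ᵇ≡false k J J≤k))))))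

  countSmallFilled-skip : ∀ occ r → countSmallFilled occ o (suc J) r ≡ countSmallSkip J o occ J r
  countSmallFilled-skip occ r = sumPrefs-cong p r _ _ (λ w _ _ → cong 𝟙 (trans (run-shift p occ w (viaLast o) J (isOcc p))
     (run-cong-from p occ w _ _ J (isOcc p) (λ k a s J≤k → sym (cong (λ z → if z then o k a s ∧ not (s ≡ᵇ p) else viaLast o (suc k) a s) (≥⇒<ᵇ≡false k J J≤k))))))

  countBig-remove-first : ∀ r occ i → isOcc m occ ≡ false → i ≡ J →
    countBig occ o i (suc r) ≡ countSmall occ (skipCar J o) i r + (if isOcc p occ then 0 else countSmallSkip J o occ i r)
  countBig-remove-first r occ i em refl = begin
      countBig occ o i (suc r)
        ≡⟨ sumPrefs-suc m r _ ⟩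
      sumFrom 1 m (λ a → countOn m occ a o i anyOutcome r (spot m occ a))
        ≡⟨ sumFrom-suc 1 p _ ⟩
      sumFrom 1 p (λ a → countOn m occ a o i anyOutcome r (spot m occ a)) + countOn m occ m o i anyOutcome r (spot m occ m)
        ≡⟨ cong₂ _+_ (trans (sumFrom-cong 1 p _ _ (λ a h1 h2 → zero-a a (≤-pred h2) (spot m occ a))) (sumFrom-0 1 p)) (cong (countOn m occ m o i anyOutcome r) (spot-last-free p occ em)) ⟩
      0 + countOn m occ m o i anyOutcome r (just m)
        ≡⟨ trans (countOn-just m occ m o i anyOutcome r m) (cong (λ z → if z then countBig (occ ++ [ m ]) o (suc i) r else 0) hJm) ⟩
      countBig (occ ++ [ m ]) o (suc i) r
        ≡⟨ countBig-last-occupied r (occ ++ [ m ]) occ o (suc i) (AgreeExcept-last occ) (isOcc-new occ m) ⟩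
      countSmall occ o (suc i) r + (if isOcc p (occ ++ [ m ]) then 0 else countSmallFilled occ o (suc i) r)
        ≡⟨ cong₂ (λ u v → u + (if v then 0 else countSmallFilled occ o (suc i) r)) (countSmall-skip occ r) (isOcc-other p occ m (λ q → <-irrefl q ≤-refl)) ⟩
      countSmall occ (skipCar J o) i r + (if isOcc p occ then 0 else countSmallFilled occ o (suc i) r)
        ≡⟨ cong (λ z → countSmall occ (skipCar J o) i r + (if isOcc p occ then 0 else z)) (countSmallFilled-skip occ r) ⟩
      countSmall occ (skipCar J o) i r + (if isOcc p occ then 0 else countSmallSkip J o occ i r) ∎
    where
    zero-a : ∀ a → a ≤ p → ∀ x → countOn m occ a o i anyOutcome r x ≡ 0
    zero-a a a≤p nothing = countOn-nothing m occ a o i anyOutcome r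
    zero-a a a≤p (just s) = trans (countOn-just m occ a o i anyOutcome r s) (cong (λ z → if z then countBig (occ ++ [ s ]) o (suc i) r else 0) (ofalse (o i a s) refl))
      where
      ofalse : ∀ b → b ≡ o i a s → o i a s ≡ false
      ofalse false e = sym e
      ofalse true e = ⊥-elim (<-irrefl (proj₁ (hJ a s (sym e))) (s≤s a≤p))

  countBig-remove : ∀ r occ i → isOcc m occ ≡ false → i ≤ J → J ≤ i + r →
    countBig occ o i (suc r) ≡ countSmall occ (skipCar J o) i r + (if isOcc p occ then 0 else countSmallSkip J o occ i r)
  countBig-remove r occ i em i≤J J≤ with i ≟ J
  ... | yes i≡J = countBig-remove-first r occ i em i≡J
  countBig-remove zero occ i em i≤J J≤ | no ne = ⊥-elim (ne (≤-antisym i≤J (subst (J ≤_) (+-identityʳ i) J≤)))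
  countBig-remove (suc r) occ i em i≤J J≤ | no ne = begin
      countBig occ o i (suc (suc r))
        ≡⟨ sumPrefs-suc m (suc r) _ ⟩
      sumFrom 1 m (λ a → countOn m occ a o i anyOutcome (suc r) (spot m occ a))
        ≡⟨ sumFrom-suc 1 p _ ⟩
      sumFrom 1 p (λ a → countOn m occ a o i anyOutcome (suc r) (spot m occ a)) + countOn m occ m o i anyOutcome (suc r) (spot m occ m)
        ≡⟨ cong (sumFrom 1 p (λ a → countOn m occ a o i anyOutcome (suc r) (spot m occ a)) +_) (trans (cong (countOn m occ m o i anyOutcome (suc r)) (spot-last-free p occ em)) deadM') ⟩
      sumFrom 1 p (λ a → countOn m occ a o i anyOutcome (suc r) (spot m occ a)) + 0
        ≡⟨ +-identityʳ _ ⟩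
      sumFrom 1 p (λ a → countOn m occ a o i anyOutcome (suc r) (spot m occ a))
        ≡⟨ main (isOcc p occ) refl ⟩
      sumFrom 1 p (λ a → countOn p occ a (skipCar J o) i anyOutcome r (spot p occ a)) + (if isOcc p occ then 0 else sumFrom 1 p (λ a → countOn p occ a (skipCarFilled J o) i (isOcc p) r (spot p occ a)))
        ≡⟨ sym (cong₂ (λ u v → u + (if isOcc p occ then 0 else v)) (sumPrefs-suc p r _) (sumPrefs-suc p r _)) ⟩
      countSmall occ (skipCar J o) i (suc r) + (if isOcc p occ then 0 else countSmallSkip J o occ i (suc r)) ∎
    where
    i<J = ≤∧≢⇒< i≤J ne
    J≤' : J ≤ suc i + r
    J≤' = subst (J ≤_) (+-suc i r) J≤
    deadA : ∀ a → countOn m occ a o i anyOutcome (suc r) (just m) ≡ 0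
    deadA a = trans (countOn-just m occ a o i anyOutcome (suc r) m) (ifz (o i a m))
      where
      ifz : ∀ b → (if b then countBig (occ ++ [ m ]) o (suc i) (suc r) else 0) ≡ 0
      ifz false = refl
      ifz true = countBig-blocked J o (λ a s h → proj₂ (hJ a s h)) (occ ++ [ m ]) (suc i) (suc r) (isOcc-new occ m) i<J (subst (J <_) (sym (+-suc (suc i) r)) (s≤s J≤'))
    deadM' : countOn m occ m o i anyOutcome (suc r) (just m) ≡ 0
    deadM' = deadA m
    odi : ∀ a s → skipCar J o i a s ≡ o i a s
    odi a s = cong (λ z → if z then o i a s else o (suc i) a s) (<⇒<ᵇ≡true i J i<J)
    odCi : ∀ a s → skipCarFilled J o i a s ≡ o i a s ∧ not (s ≡ᵇ p)
    odCi a s = cong (λ z → if z then o i a s ∧ not (s ≡ᵇ p) else viaLast o (suc i) a s) (<⇒<ᵇ≡true i J i<J)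
    IH : ∀ s → isOcc m (occ ++ [ s ]) ≡ false → countBig (occ ++ [ s ]) o (suc i) (suc r) ≡ countSmall (occ ++ [ s ]) (skipCar J o) (suc i) r + (if isOcc p (occ ++ [ s ]) then 0 else countSmallSkip J o (occ ++ [ s ]) (suc i) r)
    IH s e = countBig-remove r (occ ++ [ s ]) (suc i) e i<J J≤'
    main : ∀ b → b ≡ isOcc p occ → sumFrom 1 p (λ a → countOn m occ a o i anyOutcome (suc r) (spot m occ a)) ≡
       sumFrom 1 p (λ a → countOn p occ a (skipCar J o) i anyOutcome r (spot p occ a)) + (if b then 0 else sumFrom 1 p (λ a → countOn p occ a (skipCarFilled J o) i (isOcc p) r (spot p occ a)))
    main b eb = begin
        sumFrom 1 p X ≡⟨ sumFrom-cong 1 p _ _ (λ a h1 h2 → pwX a h1 (≤-pred h2)) ⟩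
        sumFrom 1 p (λ a → Y a + (if b then 0 else Z a)) ≡⟨ sumFrom-+ 1 p _ _ ⟩
        sumFrom 1 p Y + sumFrom 1 p (λ a → if b then 0 else Z a) ≡⟨ cong (sumFrom 1 p Y +_) (ifSm b) ⟩
        sumFrom 1 p Y + (if b then 0 else sumFrom 1 p Z) ∎
      where
      X Y Z : ℕ → ℕ
      X = λ a → countOn m occ a o i anyOutcome (suc r) (spot m occ a)
      Y = λ a → countOn p occ a (skipCar J o) i anyOutcome r (spot p occ a)
      Z = λ a → countOn p occ a (skipCarFilled J o) i (isOcc p) r (spot p occ a)
      ifSm : ∀ c → sumFrom 1 p (λ a → if c then 0 else Z a) ≡ (if c then 0 else sumFrom 1 p Z)
      ifSm true = sumFrom-0 1 p
      ifSm false = refl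
      pwX : ∀ a → 1 ≤ a → a ≤ p → X a ≡ Y a + (if b then 0 else Z a)
      pwX a h1 h2 with spot-drop-last-free p occ a h1 h2 em
      ... | inj₂ (sm , sp) = trans (cong (countOn m occ a o i anyOutcome (suc r)) sm) (trans (deadA a)
            (sym (cong₂ (λ u v → countOn p occ a (skipCar J o) i anyOutcome r u + (if b then 0 else countOn p occ a (skipCarFilled J o) i (isOcc p) r v)) sp sp ⟨ trans ⟩ cong (_+ (if b then 0 else countOn p occ a (skipCarFilled J o) i (isOcc p) r nothing)) (countOn-nothing p occ a (skipCar J o) i anyOutcome r) ⟨ trans ⟩ ifz b)))
        where
        ifz : ∀ c → 0 + (if c then 0 else countOn p occ a (skipCarFilled J o) i (isOcc p) r nothing) ≡ 0
        ifz true = refl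
        ifz false = countOn-nothing p occ a (skipCarFilled J o) i (isOcc p) r
      ... | inj₁ eqs = trans (cong (countOn m occ a o i anyOutcome (suc r)) eqs) (go (spot p occ a) refl)
        where
        go : ∀ x → spot p occ a ≡ x → countOn m occ a o i anyOutcome (suc r) x ≡ countOn p occ a (skipCar J o) i anyOutcome r x + (if b then 0 else countOn p occ a (skipCarFilled J o) i (isOcc p) r x)
        go nothing _ = trans (countOn-nothing m occ a o i anyOutcome (suc r)) (sym (trans (cong (_+ (if b then 0 else countOn p occ a (skipCarFilled J o) i (isOcc p) r nothing)) (countOn-nothing p occ a (skipCar J o) i anyOutcome r)) (ifz b)))
          where
          ifz : ∀ c → 0 + (if c then 0 else countOn p occ a (skipCarFilled J o) i (isOcc p) r nothing) ≡ 0
          ifz true = refl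
          ifz false = countOn-nothing p occ a (skipCarFilled J o) i (isOcc p) r
        go (just s) sx = begin
            countOn m occ a o i anyOutcome (suc r) (just s)
              ≡⟨ countOn-just m occ a o i anyOutcome (suc r) s ⟩
            (if o i a s then countBig (occ ++ [ s ]) o (suc i) (suc r) else 0)
              ≡⟨ if-then-0-cong (o i a s) (IH s (trans (isOcc-other m occ s (λ q → <-irrefl (sym q) (s≤s s≤p))) em)) ⟩
            (if o i a s then countSmall (occ ++ [ s ]) (skipCar J o) (suc i) r + (if isOcc p (occ ++ [ s ]) then 0 else countSmallSkip J o (occ ++ [ s ]) (suc i) r) else 0)
              ≡⟨ fin b eb ⟩
            (if o i a s then countSmall (occ ++ [ s ]) (skipCar J o) (suc i) r else 0) + (if b then 0 else (if o i a s ∧ not (s ≡ᵇ p) then countSmallSkip J o (occ ++ [ s ]) (suc i) r else 0))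
              ≡⟨ sym (cong₂ (λ u v → (if u then countSmall (occ ++ [ s ]) (skipCar J o) (suc i) r else 0) + (if b then 0 else (if v then countSmallSkip J o (occ ++ [ s ]) (suc i) r else 0))) (odi a s) (odCi a s)) ⟩
            (if skipCar J o i a s then countSmall (occ ++ [ s ]) (skipCar J o) (suc i) r else 0) + (if b then 0 else (if skipCarFilled J o i a s then countSmallSkip J o (occ ++ [ s ]) (suc i) r else 0))
              ≡⟨ sym (cong₂ (λ u v → u + (if b then 0 else v)) (countOn-just p occ a (skipCar J o) i anyOutcome r s) (countOn-just p occ a (skipCarFilled J o) i (isOcc p) r s)) ⟩
            countOn p occ a (skipCar J o) i anyOutcome r (just s) + (if b then 0 else countOn p occ a (skipCarFilled J o) i (isOcc p) r (just s)) ∎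
          where
          s≤p = proj₂ (proj₁ (spot-range p occ a s sx h1 h2))
          Bs = countSmall (occ ++ [ s ]) (skipCar J o) (suc i) r
          Cs = countSmallSkip J o (occ ++ [ s ]) (suc i) r
          fin : ∀ c → c ≡ isOcc p occ → (if o i a s then Bs + (if isOcc p (occ ++ [ s ]) then 0 else Cs) else 0) ≡ (if o i a s then Bs else 0) + (if c then 0 else (if o i a s ∧ not (s ≡ᵇ p) then Cs else 0))
          fin true ec = trans (if-then-0-cong (o i a s) (trans (cong (λ z → Bs + (if z then 0 else Cs)) (isOcc-mono p occ s (sym ec))) (+-identityʳ Bs))) (sym (+-identityʳ _))
          fin false ec with s ≟ p
          ... | yes refl = trans (if-then-0-cong (o i a s) (trans (cong (λ z → Bs + (if z then 0 else Cs)) (isOcc-new occ s)) (+-identityʳ Bs)))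
                  (sym (trans (cong (λ z → (if o i a s then Bs else 0) + (if o i a s ∧ not z then Cs else 0)) (≡ᵇ-refl s)) (trans (cong (λ z → (if o i a s then Bs else 0) + (if z then Cs else 0)) (∧-zeroʳ (o i a s))) (+-identityʳ _))))
          ... | no nsp = trans (if-then-0-cong (o i a s) (cong (λ z → Bs + (if z then 0 else Cs)) (trans (isOcc-other p occ s (λ q → nsp (sym q))) (sym ec))))
                  (trans (if-then-0-+ (o i a s) Bs Cs) (cong (λ z → (if o i a s then Bs else 0) + (if z then Cs else 0)) (sym (trans (cong (λ z → o i a s ∧ not z) (≢⇒≡ᵇ≡false s p nsp)) (∧-identityʳ (o i a s))))))

-- Car J prefers p and ends in m = p + 1, which happens exactly when p and p - 1 are already
-- taken; deleting it leaves a run on p spots in which p and p - 1 are filled by earlier cars.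
module RemoveSquareCar (p : ℕ) (hp : 2 ≤ p) (J : ℕ) (o : Constraint) (hJm : o J p (suc p) ≡ true)
   (hJ : ∀ a s → o J a s ≡ true → (a ≡ p) × (s ≡ suc p)) where
  hp1 : 1 ≤ p
  hp1 = ≤-trans (s≤s z≤n) hp
  open DropLastSpot p hp1

  lastTwoFilled : List ℕ → Bool
  lastTwoFilled x = isOcc p x ∧ isOcc (p ∸ 1) x

  skipSquareCar : Constraint
  skipSquareCar j a s = if j <ᵇ J then o j a s else (o (suc j) a s ∧ not (s ≡ᵇ p) ∧ not (s ≡ᵇ p ∸ 1))

  countSmallSquare : List ℕ → ℕ → ℕ → ℕ
  countSmallSquare occ i r = sumPrefs p r (λ w → 𝟙 (run p occ w skipSquareCar i lastTwoFilled))

  p≢m : p ≢ m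
  p≢m q = <-irrefl q ≤-refl

  ofalse : ∀ a s → (a ≢ p ⊎ s ≢ m) → o J a s ≡ false
  ofalse a s h with o J a s in e
  ... | false = refl
  ... | true with h
  ...   | inj₁ ne = ⊥-elim (ne (proj₁ (hJ a s e)))
  ...   | inj₂ ne = ⊥-elim (ne (proj₂ (hJ a s e)))

  countBig-removeSquare-first : ∀ r occ i → isOcc m occ ≡ false → i ≡ J → countBig occ o i (suc r) ≡ countSmallSquare occ i r
  countBig-removeSquare-first r occ i em refl = begin
      countBig occ o i (suc r)
        ≡⟨ sumPrefs-suc m r _ ⟩
      sumFrom 1 m (λ a → countOn m occ a o i anyOutcome r (spot m occ a))
        ≡⟨ sumFrom-suc 1 p _ ⟩
      sumFrom 1 p (λ a → countOn m occ a o i anyOutcome r (spot m occ a)) + countOn m occ m o i anyOutcome r (spot m occ m)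
        ≡⟨ cong₂ _+_ (sumFrom-cong 1 p _ _ (λ a _ _ → pick a)) (zero-a m (inj₁ (λ q → p≢m (sym q))) (spot m occ m)) ⟩
      sumFrom 1 p (λ a → if a ≡ᵇ p then countOn m occ p o i anyOutcome r (spot m occ p) else 0) + 0
        ≡⟨ trans (+-identityʳ _) (sumFrom-≡ᵇ-last p _ hp1) ⟩
      countOn m occ p o i anyOutcome r (spot m occ p)
        ≡⟨ atJ (isOcc p occ) (isOcc (p ∸ 1) occ) refl refl ⟩
      countSmallSquare occ i r ∎
    where
    zero-a : ∀ a → (a ≢ p ⊎ ⊥) → ∀ x → countOn m occ a o i anyOutcome r x ≡ 0
    zero-a a h nothing = countOn-nothing m occ a o i anyOutcome r
    zero-a a (inj₁ ne) (just s) = trans (countOn-just m occ a o i anyOutcome r s) (cong (λ z → if z then countBig (occ ++ [ s ]) o (suc i) r else 0) (ofalse a s (inj₁ ne)))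
    pick : ∀ a → countOn m occ a o i anyOutcome r (spot m occ a) ≡ (if a ≡ᵇ p then countOn m occ p o i anyOutcome r (spot m occ p) else 0)
    pick a with a ≟ p
    ... | yes refl = sym (cong (λ z → if z then countOn m occ a o i anyOutcome r (spot m occ a) else 0) (≡ᵇ-refl a))
    ... | no ne = trans (zero-a a (inj₁ ne) (spot m occ a)) (sym (cong (λ z → if z then countOn m occ p o i anyOutcome r (spot m occ p) else 0) (≢⇒≡ᵇ≡false a p ne)))
    zs : ∀ s → s ≢ m → countOn m occ p o i anyOutcome r (just s) ≡ 0
    zs s ne = trans (countOn-just m occ p o i anyOutcome r s) (cong (λ z → if z then countBig (occ ++ [ s ]) o (suc i) r else 0) (ofalse p s (inj₂ ne)))
    2≤ᵇp : (2 ≤ᵇ p) ≡ true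
    2≤ᵇp = <⇒<ᵇ≡true 1 p hp
    p<ᵇm : (p <ᵇ m) ≡ true
    p<ᵇm = <⇒<ᵇ≡true p m ≤-refl
    noC : ∀ occ' → isOcc p occ' ≡ true → countSmall occ' o (suc i) r + (if isOcc p occ' then 0 else countSmallFilled occ' o (suc i) r) ≡ countSmall occ' o (suc i) r
    noC occ' e = trans (cong (λ z → countSmall occ' o (suc i) r + (if z then 0 else countSmallFilled occ' o (suc i) r)) e) (+-identityʳ _)
    atJ : ∀ b1 b2 → b1 ≡ isOcc p occ → b2 ≡ isOcc (p ∸ 1) occ → countOn m occ p o i anyOutcome r (spot m occ p) ≡ countSmallSquare occ i r
    atJ false b2 e1 e2 = trans (cong (countOn m occ p o i anyOutcome r) (cong (λ z → spotOf z ((2 ≤ᵇ p) ∧ not (isOcc (p ∸ 1) occ)) ((p <ᵇ m) ∧ not (isOcc m occ)) p) (sym e1)))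
      (trans (zs p p≢m) (sym ((sumPrefs-cong p r _ _ (λ w _ _ → cong 𝟙 (trans (run-cong-final p occ w skipSquareCar i lastTwoFilled (λ x → isOcc (p ∸ 1) x ∧ isOcc p x) (λ x → ∧-comm (isOcc p x) _))
          (run-never-occupies p occ w skipSquareCar i (isOcc (p ∸ 1)) p nv (sym e1))))) ⟨ trans ⟩ sumPrefs-0 p r)))
      where
      nv : ∀ j a s → i ≤ j → skipSquareCar j a s ≡ true → s ≢ p
      nv j a s i≤j h refl = contradiction (trans (sym h) (trans (cong (λ z → if z then o j a s else (o (suc j) a s ∧ not (s ≡ᵇ p) ∧ not (s ≡ᵇ p ∸ 1))) (≥⇒<ᵇ≡false j i i≤j))
          (trans (cong (λ z → o (suc j) a s ∧ not z ∧ not (s ≡ᵇ p ∸ 1)) (≡ᵇ-refl s)) (∧-zeroʳ (o (suc j) a s))))) (λ ())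
    atJ true false e1 e2 = trans (cong (countOn m occ p o i anyOutcome r) (cong₂ (λ u v → spotOf u ((2 ≤ᵇ p) ∧ not v) ((p <ᵇ m) ∧ not (isOcc m occ)) p) (sym e1) (sym e2)))
      (trans (cong (λ z → countOn m occ p o i anyOutcome r (if not true then just p else (if z ∧ true then just (p ∸ 1) else (if (p <ᵇ m) ∧ not (isOcc m occ) then just m else nothing)))) 2≤ᵇp)
        (trans (zs (p ∸ 1) (λ q → <-irrefl q (≤-<-trans (m∸n≤m p 1) ≤-refl)))
          (sym (trans (sumPrefs-cong p r _ _ (λ w _ _ → cong 𝟙 (run-never-occupies p occ w skipSquareCar i (isOcc p) (p ∸ 1) nv (sym e2)))) (sumPrefs-0 p r)))))
      where
      nv : ∀ j a s → i ≤ j → skipSquareCar j a s ≡ true → s ≢ p ∸ 1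
      nv j a s i≤j h refl = contradiction (trans (sym h) (trans (cong (λ z → if z then o j a s else (o (suc j) a s ∧ not (s ≡ᵇ p) ∧ not (s ≡ᵇ p ∸ 1))) (≥⇒<ᵇ≡false j i i≤j))
          (trans (cong (λ z → o (suc j) a s ∧ not (s ≡ᵇ p) ∧ not z) (≡ᵇ-refl s)) (trans (sym (∧-assoc (o (suc j) a s) _ _)) (∧-zeroʳ _))))) (λ ())
    atJ true true e1 e2 = begin
        countOn m occ p o i anyOutcome r (spot m occ p)
          ≡⟨ cong (countOn m occ p o i anyOutcome r) (trans (cong₃ (λ u v z → spotOf u ((2 ≤ᵇ p) ∧ not v) (z ∧ not (isOcc m occ)) p) (sym e1) (sym e2) p<ᵇm) (cong (λ z → if not true then just p else (if (2 ≤ᵇ p) ∧ false then just (p ∸ 1) else (if true ∧ not z then just m else nothing))) em)) ⟩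
        countOn m occ p o i anyOutcome r (if (2 ≤ᵇ p) ∧ false then just (p ∸ 1) else just m)
          ≡⟨ cong (λ z → countOn m occ p o i anyOutcome r (if z then just (p ∸ 1) else just m)) (∧-zeroʳ (2 ≤ᵇ p)) ⟩
        countOn m occ p o i anyOutcome r (just m)
          ≡⟨ trans (countOn-just m occ p o i anyOutcome r m) (cong (λ z → if z then countBig (occ ++ [ m ]) o (suc i) r else 0) hJm) ⟩
        countBig (occ ++ [ m ]) o (suc i) r
          ≡⟨ countBig-last-occupied r (occ ++ [ m ]) occ o (suc i) (AgreeExcept-last occ) (isOcc-new occ m) ⟩
        countSmall occ o (suc i) r + (if isOcc p (occ ++ [ m ]) then 0 else countSmallFilled occ o (suc i) r)
          ≡⟨ cong (λ z → countSmall occ o (suc i) r + (if z then 0 else countSmallFilled occ o (suc i) r)) (isOcc-other p occ m p≢m) ⟩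
        countSmall occ o (suc i) r + (if isOcc p occ then 0 else countSmallFilled occ o (suc i) r)
          ≡⟨ noC occ (sym e1) ⟩
        countSmall occ o (suc i) r
          ≡⟨ sumPrefs-cong p r _ _ (λ w _ _ → cong 𝟙 (pwJ w)) ⟩
        countSmallSquare occ i r ∎
      where
      pwJ : ∀ w → run p occ w o (suc i) anyOutcome ≡ run p occ w skipSquareCar i lastTwoFilled
      pwJ w = trans (run-shift p occ w o i anyOutcome) (trans
        (run-cong-free p occ w (λ k → o (suc k)) skipSquareCar i anyOutcome (λ j a s i≤j fr → sym (trans (cong (λ z → if z then o j a s else (o (suc j) a s ∧ not (s ≡ᵇ p) ∧ not (s ≡ᵇ p ∸ 1))) (≥⇒<ᵇ≡false j i i≤j))
           (trans (cong₂ (λ u v → o (suc j) a s ∧ not u ∧ not v) (≢⇒≡ᵇ≡false s p (λ q → contradiction (trans (sym fr) (subst (λ z → isOcc z occ ≡ true) (sym q) (sym e1))) (λ ()))) (≢⇒≡ᵇ≡false s (p ∸ 1) (λ q → contradiction (trans (sym fr) (subst (λ z → isOcc z occ ≡ true) (sym q) (sym e2))) (λ ()))))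
             (∧-identityʳ _)))))
        (sym (trans (run-final-occupied p occ w skipSquareCar i (isOcc p) (p ∸ 1) (sym e2)) (run-final-occupied p occ w skipSquareCar i anyOutcome p (sym e1)))))

  countBig-removeSquare : ∀ r occ i → isOcc m occ ≡ false → i ≤ J → J ≤ i + r → countBig occ o i (suc r) ≡ countSmallSquare occ i r
  countBig-removeSquare r occ i em i≤J J≤ with i ≟ J
  ... | yes i≡J = countBig-removeSquare-first r occ i em i≡J
  countBig-removeSquare zero occ i em i≤J J≤ | no ne = ⊥-elim (ne (≤-antisym i≤J (subst (J ≤_) (+-identityʳ i) J≤)))
  countBig-removeSquare (suc r) occ i em i≤J J≤ | no ne = begin
      countBig occ o i (suc (suc r))
        ≡⟨ sumPrefs-suc m (suc r) _ ⟩
      sumFrom 1 m (λ a → countOn m occ a o i anyOutcome (suc r) (spot m occ a))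
        ≡⟨ sumFrom-suc 1 p _ ⟩
      sumFrom 1 p (λ a → countOn m occ a o i anyOutcome (suc r) (spot m occ a)) + countOn m occ m o i anyOutcome (suc r) (spot m occ m)
        ≡⟨ cong₂ _+_ (sumFrom-cong 1 p _ _ (λ a h1 h2 → pwX a h1 (≤-pred h2))) (trans (cong (countOn m occ m o i anyOutcome (suc r)) (spot-last-free p occ em)) (deadA m)) ⟩
      sumFrom 1 p (λ a → countOn p occ a skipSquareCar i lastTwoFilled r (spot p occ a)) + 0
        ≡⟨ +-identityʳ _ ⟩
      sumFrom 1 p (λ a → countOn p occ a skipSquareCar i lastTwoFilled r (spot p occ a))
        ≡⟨ sym (sumPrefs-suc p r _) ⟩
      countSmallSquare occ i (suc r) ∎
    where
    i<J = ≤∧≢⇒< i≤J ne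
    J≤' : J ≤ suc i + r
    J≤' = subst (J ≤_) (+-suc i r) J≤
    deadA : ∀ a → countOn m occ a o i anyOutcome (suc r) (just m) ≡ 0
    deadA a = trans (countOn-just m occ a o i anyOutcome (suc r) m) (ifz (o i a m))
      where
      ifz : ∀ b → (if b then countBig (occ ++ [ m ]) o (suc i) (suc r) else 0) ≡ 0
      ifz false = refl
      ifz true = countBig-blocked J o (λ a s h → proj₂ (hJ a s h)) (occ ++ [ m ]) (suc i) (suc r) (isOcc-new occ m) i<J (subst (J <_) (sym (+-suc (suc i) r)) (s≤s J≤'))
    odi : ∀ a s → skipSquareCar i a s ≡ o i a s
    odi a s = cong (λ z → if z then o i a s else (o (suc i) a s ∧ not (s ≡ᵇ p) ∧ not (s ≡ᵇ p ∸ 1))) (<⇒<ᵇ≡true i J i<J)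
    pwX : ∀ a → 1 ≤ a → a ≤ p → countOn m occ a o i anyOutcome (suc r) (spot m occ a) ≡ countOn p occ a skipSquareCar i lastTwoFilled r (spot p occ a)
    pwX a h1 h2 with spot-drop-last-free p occ a h1 h2 em
    ... | inj₂ (sm , sp) = trans (cong (countOn m occ a o i anyOutcome (suc r)) sm) (trans (deadA a) (sym (trans (cong (countOn p occ a skipSquareCar i lastTwoFilled r) sp) (countOn-nothing p occ a skipSquareCar i lastTwoFilled r))))
    ... | inj₁ eqs = trans (cong (countOn m occ a o i anyOutcome (suc r)) eqs) (go (spot p occ a) refl)
      where
      go : ∀ x → spot p occ a ≡ x → countOn m occ a o i anyOutcome (suc r) x ≡ countOn p occ a skipSquareCar i lastTwoFilled r x
      go nothing _ = trans (countOn-nothing m occ a o i anyOutcome (suc r)) (sym (countOn-nothing p occ a skipSquareCar i lastTwoFilled r))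
      go (just s) sx = trans (countOn-just m occ a o i anyOutcome (suc r) s) (trans
          (if-then-0-cong (o i a s) (countBig-removeSquare r (occ ++ [ s ]) (suc i) (trans (isOcc-other m occ s (λ q → <-irrefl (sym q) (s≤s s≤p))) em) i<J J≤'))
          (sym (trans (countOn-just p occ a skipSquareCar i lastTwoFilled r s) (cong (λ z → if z then countSmallSquare (occ ++ [ s ]) (suc i) r else 0) (odi a s)))))
        where
        s≤p = proj₂ (proj₁ (spot-range p occ a s sx h1 h2))

-- Recurrences

module CarPrefersLastSpot (p : ℕ) (hp : 1 ≤ p) (J : ℕ) (h1 : 1 ≤ J) (h2 : J ≤ suc p) where
  open DropLastSpot p hp
  direct : Constraint
  direct = carPrefersParksIn J m
  direct-at : direct J m m ≡ true
  direct-at = trans (constrainAt-same J (prefersParksIn m) unconstrained m m) (cong₂ _∧_ (≡ᵇ-refl m) (≡ᵇ-refl m))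
  direct-only : ∀ a s → direct J a s ≡ true → (a ≡ m) × (s ≡ m)
  direct-only a s e = let e' = trans (sym (constrainAt-same J (prefersParksIn m) unconstrained a s)) e in ≡ᵇ≡true⇒≡ a m (∧≡true⇒ˡ (a ≡ᵇ m) _ e') , ≡ᵇ≡true⇒≡ s m (∧≡true⇒ʳ (a ≡ᵇ m) _ e')
  open RemoveLastSpotCar p hp J direct direct-at direct-only using (countBig-remove)
  removed-rest : countSmall [] (skipCar J direct) 1 p ≡ vpf p
  removed-rest = trans (sumPrefs-cong p p _ _ (λ w _ _ → cong 𝟙 (run-cong-from p [] w (skipCar J direct) unconstrained 1 anyOutcome (λ j a s _ → pw j a s)))) (sym (vpf≡sumPrefs-run p))
    where
    pw : ∀ j a s → skipCar J direct j a s ≡ true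
    pw j a s with <ᵇ-cases j J
    ... | inj₁ (e , j<J) = trans (cong (λ z → if z then direct j a s else direct (suc j) a s) e) (constrainAt-other J (prefersParksIn m) unconstrained j a s (λ q → <-irrefl q j<J))
    ... | inj₂ (e , J≤j) = trans (cong (λ z → if z then direct j a s else direct (suc j) a s) e) (constrainAt-other J (prefersParksIn m) unconstrained (suc j) a s (λ q → <-irrefl (sym q) (s≤s J≤j)))
  skipCarFilled-elsewhere : ∀ j a s → s ≢ p → skipCarFilled J direct j a s ≡ true
  skipCarFilled-elsewhere j a s ne with <ᵇ-cases j J
  ... | inj₁ (e , j<J) = trans (cong (λ z → if z then direct j a s ∧ not (s ≡ᵇ p) else viaLast direct (suc j) a s) e)
         (cong₂ (λ u v → u ∧ not v) (constrainAt-other J (prefersParksIn m) unconstrained j a s (λ q → <-irrefl q j<J)) (≢⇒≡ᵇ≡false s p ne))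
  ... | inj₂ (e , J≤j) = trans (cong (λ z → if z then direct j a s ∧ not (s ≡ᵇ p) else viaLast direct (suc j) a s) e)
         (trans (cong (λ z → if z then (a ≡ᵇ p) ∧ direct (suc j) m p else direct (suc j) a s) (≢⇒≡ᵇ≡false s p ne)) (constrainAt-other J (prefersParksIn m) unconstrained (suc j) a s (λ q → <-irrefl (sym q) (s≤s J≤j))))
  removed-viaLast : countSmallSkip J direct [] 1 p ≡ sumFrom J (suc p ∸ J) (λ k → vpfR p k)
  removed-viaLast = begin
    countSmallSkip J direct [] 1 p
      ≡⟨ sumPrefs-final-by-car-at p p (skipCarFilled J direct) ⟩
    sumFrom 1 p F
      ≡⟨ sumFrom-split-at p J F h1 h2 ⟩
    sumFrom 1 (J ∸ 1) F + sumFrom J (suc p ∸ J) F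
      ≡⟨ cong₂ _+_ (trans (sumFrom-cong 1 (J ∸ 1) F (λ _ → 0) (λ k k1 k2 → lowk k k1 (subst (k <_) (m+[n∸m]≡n h1) k2))) (sumFrom-0 1 (J ∸ 1)))
                   (sumFrom-cong J (suc p ∸ J) F _ (λ k k1 k2 → highk k k1 (≤-pred (subst (k <_) (m+[n∸m]≡n h2) k2)))) ⟩
    0 + sumFrom J (suc p ∸ J) (λ k → vpfR p k) ∎
    where
    F : ℕ → ℕ
    F = λ k → sumPrefs p p (λ w → 𝟙 (run p [] w (constrainAt k (parksIn p) (skipCarFilled J direct)) 1 anyOutcome))
    lowk : ∀ k → 1 ≤ k → k < J → F k ≡ 0
    lowk k k1 k<J = sumPrefs-impossible p k (constrainAt k (parksIn p) (skipCarFilled J direct)) anyOutcome k1 (≤-pred (≤-trans k<J h2)) (λ a s → trans (constrainAt-same k (parksIn p) (skipCarFilled J direct) a s)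
        (trans (cong (λ z → (if z then direct k a s ∧ not (s ≡ᵇ p) else viaLast direct (suc k) a s) ∧ (s ≡ᵇ p)) (<⇒<ᵇ≡true k J k<J)) (x∧¬b∧b≡false (direct k a s) (s ≡ᵇ p))))
    highk : ∀ k → J ≤ k → k ≤ p → F k ≡ vpfR p k
    highk k J≤k k≤p = trans (sumPrefs-cong-unique p (constrainAt k (parksIn p) (skipCarFilled J direct)) (carPrefersParksIn k p) anyOutcome k p (≤-trans h1 J≤k) k≤p atk htk oth) (sym (vpfR≡sumPrefs-run p k (≤-trans h1 J≤k) k≤p))
      where
      okJ : ∀ a s → direct (suc k) a s ≡ true
      okJ a s = constrainAt-other J (prefersParksIn m) unconstrained (suc k) a s (λ q → <-irrefl (sym q) (s≤s J≤k))
      atk : ∀ a s → constrainAt k (parksIn p) (skipCarFilled J direct) k a s ≡ carPrefersParksIn k p k a s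
      atk a s = trans (constrainAt-same k (parksIn p) (skipCarFilled J direct) a s) (trans (cong (λ z → (if z then direct k a s ∧ not (s ≡ᵇ p) else viaLast direct (suc k) a s) ∧ (s ≡ᵇ p)) (≥⇒<ᵇ≡false k J J≤k))
         (trans (sc (s ≡ᵇ p) refl) (sym (constrainAt-same k (prefersParksIn p) unconstrained a s))))
        where
        sc : ∀ b → b ≡ (s ≡ᵇ p) → viaLast direct (suc k) a s ∧ b ≡ true ∧ ((a ≡ᵇ p) ∧ b)
        sc true e = trans (cong (λ z → (if z then (a ≡ᵇ p) ∧ direct (suc k) m p else direct (suc k) a s) ∧ true) (sym e)) (trans (∧-identityʳ _) (trans (cong ((a ≡ᵇ p) ∧_) (okJ m p)) refl))
        sc false e = trans (∧-zeroʳ _) (sym (∧-zeroʳ (a ≡ᵇ p)))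
      htk : ∀ a s → constrainAt k (parksIn p) (skipCarFilled J direct) k a s ≡ true → s ≡ p
      htk a s e = ≡ᵇ≡true⇒≡ s p (∧≡true⇒ʳ _ _ (trans (sym (constrainAt-same k (parksIn p) (skipCarFilled J direct) a s)) e))
      oth : ∀ j a s → s ≢ p → constrainAt k (parksIn p) (skipCarFilled J direct) j a s ≡ carPrefersParksIn k p j a s
      oth j a s ne = cong (_∧ (if j ≡ᵇ k then (s ≡ᵇ p) else true)) (skipCarFilled-elsewhere j a s ne) ⟨ trans ⟩
                     cong (λ z → true ∧ (if j ≡ᵇ k then z else true)) (≢⇒≡ᵇ≡false s p ne) ⟨ trans ⟩
                     sym (cong (λ z → true ∧ (if j ≡ᵇ k then (a ≡ᵇ p) ∧ z else true)) (≢⇒≡ᵇ≡false s p ne) ⟨ trans ⟩ cong (λ z → true ∧ (if j ≡ᵇ k then z else true)) (∧-zeroʳ (a ≡ᵇ p)))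

vpfR-suc : ∀ p → 1 ≤ p → ∀ J → 1 ≤ J → J ≤ suc p → vpfR (suc p) J ≡ vpf p + sumFrom J (suc p ∸ J) (λ k → vpfR p k)
vpfR-suc p hp J h1 h2 = begin
  vpfR m J
    ≡⟨ vpfR≡sumPrefs-run m J h1 h2 ⟩
  countBig [] direct 1 m
    ≡⟨ countBig-remove p [] 1 refl h1 h2 ⟩
  countSmall [] (skipCar J direct) 1 p + countSmallSkip J direct [] 1 p
    ≡⟨ cong₂ _+_ removed-rest removed-viaLast ⟩
  vpf p + sumFrom J (suc p ∸ J) (λ k → vpfR p k) ∎
  where
  open DropLastSpot p hp
  open CarPrefersLastSpot p hp J h1 h2
  open RemoveLastSpotCar p hp J direct direct-at direct-only using (countBig-remove)

avoidsLastTwoFrom : ℕ → ℕ → Constraint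
avoidsLastTwoFrom p i j a s = if j <ᵇ i then true else not (s ≡ᵇ p) ∧ not (s ≡ᵇ p ∸ 1)

lastTakenBefore : ℕ → ℕ → Constraint
lastTakenBefore t c j a s = if s ≡ᵇ t then j <ᵇ c else true

vpfS-suc≡avoidsLastTwo : ∀ p → 2 ≤ p → ∀ i → 1 ≤ i → i ≤ suc p → vpfS (suc p) i ≡ sumPrefs p p (λ w → 𝟙 (run p [] w (avoidsLastTwoFrom p i) 1 anyOutcome))
vpfS-suc≡avoidsLastTwo p hp i h1 h2 = begin
  vpfS (suc p) i ≡⟨ vpfS≡sumPrefs-run (suc p) i h1 h2 ⟩
  sumPrefs (suc p) (suc p) (λ w → 𝟙 (run (suc p) [] w o 1 anyOutcome)) ≡⟨ countBig-removeSquare p [] 1 refl h1 h2 ⟩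
  sumPrefs p p (λ w → 𝟙 (run p [] w skipSquareCar 1 lastTwoFilled)) ≡⟨ sumPrefs-cong p p _ _ (λ w iw lw → cong 𝟙 (pw w iw lw)) ⟩
  sumPrefs p p (λ w → 𝟙 (run p [] w (avoidsLastTwoFrom p i) 1 anyOutcome)) ∎
  where
  o : Constraint
  o = carPrefersLeftParksIn i (suc p)
  hJm : o i p (suc p) ≡ true
  hJm = trans (constrainAt-same i (prefersLeftParksIn (suc p)) unconstrained p (suc p)) (cong₂ _∧_ (≡ᵇ-refl p) (≡ᵇ-refl p))
  hJ : ∀ a s → o i a s ≡ true → (a ≡ p) × (s ≡ suc p)
  hJ a s e = let e' = trans (sym (constrainAt-same i (prefersLeftParksIn (suc p)) unconstrained a s)) e in ≡ᵇ≡true⇒≡ a p (∧≡true⇒ˡ (a ≡ᵇ p) _ e') , ≡ᵇ≡true⇒≡ s (suc p) (∧≡true⇒ʳ (a ≡ᵇ p) _ e')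
  open RemoveSquareCar p hp i o hJm hJ using (countBig-removeSquare; skipSquareCar; lastTwoFilled)
  pw : ∀ w → InRange p w → length w ≡ p → run p [] w skipSquareCar 1 lastTwoFilled ≡ run p [] w (avoidsLastTwoFrom p i) 1 anyOutcome
  pw w iw lw = trans (run-final-filled p [] w skipSquareCar 1 (isOcc p) (p ∸ 1) iw (trans (freeCount-[] p) (sym lw)) (2≤⇒1≤pred hp) (m∸n≤m p 1))
     (trans (run-final-filled p [] w skipSquareCar 1 anyOutcome p iw (trans (freeCount-[] p) (sym lw)) (≤-trans (s≤s z≤n) hp) ≤-refl)
       (run-cong-from p [] w skipSquareCar (avoidsLastTwoFrom p i) 1 anyOutcome (λ j a s _ → oo j a s)))
    where
    oo : ∀ j a s → skipSquareCar j a s ≡ avoidsLastTwoFrom p i j a s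
    oo j a s with <ᵇ-cases j i
    ... | inj₁ (e , j<i) = trans (cong (λ z → if z then o j a s else (o (suc j) a s ∧ not (s ≡ᵇ p) ∧ not (s ≡ᵇ p ∸ 1))) e)
           (trans (constrainAt-other i (prefersLeftParksIn (suc p)) unconstrained j a s (λ q → <-irrefl q j<i)) (sym (cong (λ z → if z then true else not (s ≡ᵇ p) ∧ not (s ≡ᵇ p ∸ 1)) e)))
    ... | inj₂ (e , i≤j) = trans (cong (λ z → if z then o j a s else (o (suc j) a s ∧ not (s ≡ᵇ p) ∧ not (s ≡ᵇ p ∸ 1))) e)
           (trans (cong (λ z → z ∧ not (s ≡ᵇ p) ∧ not (s ≡ᵇ p ∸ 1)) (constrainAt-other i (prefersLeftParksIn (suc p)) unconstrained (suc j) a s (λ q → <-irrefl (sym q) (s≤s i≤j))))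
             (sym (cong (λ z → if z then true else not (s ≡ᵇ p) ∧ not (s ≡ᵇ p ∸ 1)) e)))

sumPrefs-lastTakenBefore : ∀ t → 1 ≤ t → ∀ c → c ≤ suc t → sumPrefs t t (λ w → 𝟙 (run t [] w (lastTakenBefore t c) 1 anyOutcome)) ≡ sumFrom 1 (c ∸ 1) (λ ℓ → vpfI t ℓ)
sumPrefs-lastTakenBefore t ht c hc = begin
  sumPrefs t t (λ w → 𝟙 (run t [] w (lastTakenBefore t c) 1 anyOutcome)) ≡⟨ sumPrefs-by-car-at t t (lastTakenBefore t c) ht ≤-refl ⟩
  sumFrom 1 t F ≡⟨ sumFrom-truncate 1 t (c ∸ 1) F (∸-monoˡ-≤ 1 hc) zz ⟩
  sumFrom 1 (c ∸ 1) F ≡⟨ sumFrom-cong 1 (c ∸ 1) F _ (λ ℓ h1 h2 → lowℓ ℓ h1 (<1+pred⇒< ℓ c h1 h2)) ⟩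
  sumFrom 1 (c ∸ 1) (λ ℓ → vpfI t ℓ) ∎
  where
  F = λ ℓ → sumPrefs t t (λ w → 𝟙 (run t [] w (constrainAt ℓ (parksIn t) (lastTakenBefore t c)) 1 anyOutcome))
  zz : ∀ ℓ → 1 + (c ∸ 1) ≤ ℓ → ℓ < 1 + t → F ℓ ≡ 0
  zz ℓ h1 h2 = sumPrefs-impossible t ℓ (constrainAt ℓ (parksIn t) (lastTakenBefore t c)) anyOutcome (≤-trans (s≤s z≤n) h1) (≤-pred h2) (λ a s → trans (constrainAt-same ℓ (parksIn t) (lastTakenBefore t c) a s) (cs (s ≡ᵇ t)))
    where
    c≤ℓ : c ≤ ℓ
    c≤ℓ = ≤-trans (m≤n+m∸n c 1) h1
    cs : ∀ b → (if b then ℓ <ᵇ c else true) ∧ b ≡ false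
    cs true = trans (∧-identityʳ _) (≥⇒<ᵇ≡false ℓ c c≤ℓ)
    cs false = ∧-zeroʳ true
  lowℓ : ∀ ℓ → 1 ≤ ℓ → ℓ < c → F ℓ ≡ vpfI t ℓ
  lowℓ ℓ h1 h2 = trans (sumPrefs-cong-unique t (constrainAt ℓ (parksIn t) (lastTakenBefore t c)) (carParksIn ℓ t) anyOutcome ℓ t h1 (≤-pred (≤-trans h2 hc)) atℓ htℓ oth) (sym (vpfI≡sumPrefs-run t ℓ h1 (≤-pred (≤-trans h2 hc))))
    where
    atℓ : ∀ a s → constrainAt ℓ (parksIn t) (lastTakenBefore t c) ℓ a s ≡ carParksIn ℓ t ℓ a s
    atℓ a s = trans (constrainAt-same ℓ (parksIn t) (lastTakenBefore t c) a s) (trans (cs (s ≡ᵇ t)) (sym (constrainAt-same ℓ (parksIn t) unconstrained a s)))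
      where
      cs : ∀ b → (if b then ℓ <ᵇ c else true) ∧ b ≡ true ∧ b
      cs true = trans (∧-identityʳ _) (<⇒<ᵇ≡true ℓ c h2)
      cs false = refl
    htℓ : ∀ a s → constrainAt ℓ (parksIn t) (lastTakenBefore t c) ℓ a s ≡ true → s ≡ t
    htℓ a s e = ≡ᵇ≡true⇒≡ s t (∧≡true⇒ʳ _ _ (trans (sym (constrainAt-same ℓ (parksIn t) (lastTakenBefore t c) a s)) e))
    oth : ∀ j a s → s ≢ t → constrainAt ℓ (parksIn t) (lastTakenBefore t c) j a s ≡ carParksIn ℓ t j a s
    oth j a s ne = trans (cong (λ z → (if z then j <ᵇ c else true) ∧ (if j ≡ᵇ ℓ then z else true)) (≢⇒≡ᵇ≡false s t ne)) (sym (cong (λ z → true ∧ (if j ≡ᵇ ℓ then z else true)) (≢⇒≡ᵇ≡false s t ne)))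

module CarTakingLastSpot (p' : ℕ) (hp' : 2 ≤ p') (i' : ℕ) (hi : i' ≤ suc p') where
  p i : ℕ
  p = suc p'
  i = suc i'
  hp1 : 1 ≤ p'
  hp1 = ≤-trans (s≤s z≤n) hp'
  byLastCar : ℕ → ℕ
  byLastCar k = sumPrefs p p (λ w → 𝟙 (run p [] w (constrainAt k (parksIn p) (avoidsLastTwoFrom p i)) 1 anyOutcome))
  byLastCar-late : ∀ k → 1 + i' ≤ k → k < 1 + p → byLastCar k ≡ 0
  byLastCar-late k h1 h2 = sumPrefs-impossible p k (constrainAt k (parksIn p) (avoidsLastTwoFrom p i)) anyOutcome (≤-trans (s≤s z≤n) h1) (≤-pred h2)
    (λ a s → trans (constrainAt-same k (parksIn p) (avoidsLastTwoFrom p i) a s) (trans (cong (λ z → (if z then true else not (s ≡ᵇ p) ∧ not (s ≡ᵇ p')) ∧ (s ≡ᵇ p)) (≥⇒<ᵇ≡false k i h1)) (cs (s ≡ᵇ p) (s ≡ᵇ p'))))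
    where
    cs : ∀ b c → (not b ∧ not c) ∧ b ≡ false
    cs true c = refl
    cs false c = ∧-zeroʳ _
  lastTakenBefore-early : ∀ j a s → j < i → lastTakenBefore p' i j a s ≡ true
  lastTakenBefore-early j a s j<i with s ≡ᵇ p'
  ... | true = <⇒<ᵇ≡true j i j<i
  ... | false = refl
  lastTakenBefore-elsewhere : ∀ j a s → s ≢ p' → lastTakenBefore p' i j a s ≡ true
  lastTakenBefore-elsewhere j a s ne = cong (λ z → if z then j <ᵇ i else true) (≢⇒≡ᵇ≡false s p' ne)

  module _ (k : ℕ) (1≤k : 1 ≤ k) (k≤i' : k ≤ i') where
    k≤p : k ≤ p
    k≤p = ≤-trans k≤i' (≤-trans hi ≤-refl)
    k<i : k < i
    k<i = s≤s k≤i'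
    direct : Constraint
    direct = constrainAt k (prefersParksIn p) (lastTakenBefore p' i)
    avoids≡lastTakenBefore-at : ∀ a s → constrainAt k (parksIn p) (avoidsLastTwoFrom p i) k a s ≡ constrainAt k (parksIn p) (lastTakenBefore p' i) k a s
    avoids≡lastTakenBefore-at a s = trans (constrainAt-same k (parksIn p) (avoidsLastTwoFrom p i) a s) (trans (cong₂ _∧_ (trans (cong (λ z → if z then true else not (s ≡ᵇ p) ∧ not (s ≡ᵇ p')) (<⇒<ᵇ≡true k i k<i)) (sym (lastTakenBefore-early k a s k<i))) refl) (sym (constrainAt-same k (parksIn p) (lastTakenBefore p' i) a s)))
    avoids≡lastTakenBefore-elsewhere : ∀ j a s → s ≢ p → constrainAt k (parksIn p) (avoidsLastTwoFrom p i) j a s ≡ constrainAt k (parksIn p) (lastTakenBefore p' i) j a s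
    avoids≡lastTakenBefore-elsewhere j a s ne = cong (_∧ (if j ≡ᵇ k then s ≡ᵇ p else true)) (qq (j <ᵇ i) (s ≡ᵇ p'))
      where
      qq : ∀ b c → (if b then true else not (s ≡ᵇ p) ∧ not c) ≡ (if c then b else true)
      qq true true = refl
      qq true false = refl
      qq false true = ∧-zeroʳ _
      qq false false = trans (∧-identityʳ _) (cong not (≢⇒≡ᵇ≡false s p ne))
    byLastCar-fromLeft : sumPrefs p p (λ w → 𝟙 (run p [] w (constrainAt k (prefersLeftParksIn p) (lastTakenBefore p' i)) 1 anyOutcome)) ≡ vpfS p k
    byLastCar-fromLeft = trans (sumPrefs-cong p p _ _ (λ w _ _ → cong 𝟙 (run-cong-left-filled p [] w (constrainAt k (prefersLeftParksIn p) (lastTakenBefore p' i)) (carPrefersLeftParksIn k p) 1 anyOutcome k p' 1≤k hle hI ho))) (sym (vpfS≡sumPrefs-run p k 1≤k k≤p))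
      where
      hle : ∀ j a s → j ≤ k → constrainAt k (prefersLeftParksIn p) (lastTakenBefore p' i) j a s ≡ carPrefersLeftParksIn k p j a s
      hle j a s j≤k = cong (_∧ (if j ≡ᵇ k then prefersLeftParksIn p a s else true)) (lastTakenBefore-early j a s (≤-<-trans j≤k k<i))
      hI : ∀ a s → constrainAt k (prefersLeftParksIn p) (lastTakenBefore p' i) k a s ≡ true → (a ≡ p') × (s ≡ suc p')
      hI a s e = let e' = ∧≡true⇒ʳ (lastTakenBefore p' i k a s) (prefersLeftParksIn p a s) (trans (sym (constrainAt-same k (prefersLeftParksIn p) (lastTakenBefore p' i) a s)) e) in ≡ᵇ≡true⇒≡ a p' (∧≡true⇒ˡ _ _ e') , ≡ᵇ≡true⇒≡ s p (∧≡true⇒ʳ (a ≡ᵇ p') _ e')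
      ho : ∀ j a s → s ≢ p' → constrainAt k (prefersLeftParksIn p) (lastTakenBefore p' i) j a s ≡ carPrefersLeftParksIn k p j a s
      ho j a s ne = cong (_∧ (if j ≡ᵇ k then prefersLeftParksIn p a s else true)) (lastTakenBefore-elsewhere j a s ne)
    direct-at : direct k p p ≡ true
    direct-at = trans (constrainAt-same k (prefersParksIn p) (lastTakenBefore p' i) p p) (cong₂ _∧_ (lastTakenBefore-elsewhere k p p (λ q → <-irrefl (sym q) ≤-refl)) (cong₂ _∧_ (≡ᵇ-refl p) (≡ᵇ-refl p)))
    direct-only : ∀ a s → direct k a s ≡ true → (a ≡ p) × (s ≡ p)
    direct-only a s e = let e' = ∧≡true⇒ʳ (lastTakenBefore p' i k a s) (prefersParksIn p a s) (trans (sym (constrainAt-same k (prefersParksIn p) (lastTakenBefore p' i) a s)) e) in ≡ᵇ≡true⇒≡ a p (∧≡true⇒ˡ _ _ e') , ≡ᵇ≡true⇒≡ s p (∧≡true⇒ʳ (a ≡ᵇ p) _ e')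
    open DropLastSpot p' hp1
    open RemoveLastSpotCar p' hp1 k direct direct-at direct-only using (countBig-remove)
    direct-other : ∀ j a s → j ≢ k → direct j a s ≡ lastTakenBefore p' i j a s
    direct-other j a s ne = constrainAt-other k (prefersParksIn p) (lastTakenBefore p' i) j a s ne
    removed-rest : countSmall [] (skipCar k direct) 1 p' ≡ sumFrom 1 (i' ∸ 1) (λ ℓ → vpfI p' ℓ)
    removed-rest = trans (sumPrefs-cong p' p' _ _ (λ w _ _ → cong 𝟙 (run-cong-from p' [] w (skipCar k direct) (lastTakenBefore p' i') 1 anyOutcome (λ j a s _ → pw j a s)))) (sumPrefs-lastTakenBefore p' hp1 i' (≤-trans hi ≤-refl))
      where
      pw : ∀ j a s → skipCar k direct j a s ≡ lastTakenBefore p' i' j a s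
      pw j a s with <ᵇ-cases j k
      ... | inj₁ (e , j<k) = trans (cong (λ z → if z then direct j a s else direct (suc j) a s) e) (trans (direct-other j a s (λ q → <-irrefl q j<k)) (cc (s ≡ᵇ p')))
        where
        cc : ∀ b → (if b then j <ᵇ i else true) ≡ (if b then j <ᵇ i' else true)
        cc true = trans (<⇒<ᵇ≡true j i (≤-trans (s≤s (<⇒≤ j<k)) k<i)) (sym (<⇒<ᵇ≡true j i' (≤-trans j<k k≤i')))
        cc false = refl
      ... | inj₂ (e , k≤j) = trans (cong (λ z → if z then direct j a s else direct (suc j) a s) e) (direct-other (suc j) a s (λ q → <-irrefl (sym q) (s≤s k≤j)))
    removed-viaLast : countSmallSkip k direct [] 1 p' ≡ sumFrom k (i' ∸ k) (λ ℓ → vpfR p' ℓ)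
    removed-viaLast = begin
      countSmallSkip k direct [] 1 p'
        ≡⟨ sumPrefs-final-by-car-at p' p' (skipCarFilled k direct) ⟩
      sumFrom 1 p' H
        ≡⟨ sumFrom-split-at p' k H 1≤k (≤-trans k≤i' hi) ⟩
      sumFrom 1 (k ∸ 1) H + sumFrom k (suc p' ∸ k) H
        ≡⟨ cong₂ _+_ (trans (sumFrom-cong 1 (k ∸ 1) H (λ _ → 0) (λ ℓ l1 l2 → lowℓ ℓ l1 (subst (ℓ <_) (m+[n∸m]≡n 1≤k) l2))) (sumFrom-0 1 (k ∸ 1)))
              (sumFrom-truncate k (suc p' ∸ k) (i' ∸ k) H (∸-monoˡ-≤ k hi) (λ ℓ l1 l2 → highℓ ℓ (subst (_≤ ℓ) (m+[n∸m]≡n k≤i') l1) (≤-pred (subst (ℓ <_) (m+[n∸m]≡n (≤-trans k≤i' hi)) l2)))) ⟩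
      0 + sumFrom k (i' ∸ k) H
        ≡⟨ sumFrom-cong k (i' ∸ k) H _ (λ ℓ l1 l2 → midℓ ℓ l1 (subst (ℓ <_) (m+[n∸m]≡n k≤i') l2)) ⟩
      sumFrom k (i' ∸ k) (λ ℓ → vpfR p' ℓ) ∎
      where
      H : ℕ → ℕ
      H = λ ℓ → sumPrefs p' p' (λ w → 𝟙 (run p' [] w (constrainAt ℓ (parksIn p') (skipCarFilled k direct)) 1 anyOutcome))
      direct-later : ∀ j → k ≤ j → direct (suc j) p p' ≡ (j <ᵇ i')
      direct-later j k≤j = trans (direct-other (suc j) p p' (λ q → <-irrefl (sym q) (s≤s k≤j))) (cong (λ z → if z then suc j <ᵇ i else true) (≡ᵇ-refl p'))
      skipCarFilled-elsewhere : ∀ j a s → s ≢ p' → skipCarFilled k direct j a s ≡ true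
      skipCarFilled-elsewhere j a s ne with <ᵇ-cases j k
      ... | inj₁ (e , j<k) = trans (cong (λ z → if z then direct j a s ∧ not (s ≡ᵇ p') else viaLast direct (suc j) a s) e)
            (cong₂ (λ u v → u ∧ not v) (trans (direct-other j a s (λ q → <-irrefl q j<k)) (lastTakenBefore-elsewhere j a s ne)) (≢⇒≡ᵇ≡false s p' ne))
      ... | inj₂ (e , k≤j) = trans (cong (λ z → if z then direct j a s ∧ not (s ≡ᵇ p') else viaLast direct (suc j) a s) e)
            (trans (cong (λ z → if z then (a ≡ᵇ p') ∧ direct (suc j) p p' else direct (suc j) a s) (≢⇒≡ᵇ≡false s p' ne))
              (trans (direct-other (suc j) a s (λ q → <-irrefl (sym q) (s≤s k≤j))) (lastTakenBefore-elsewhere (suc j) a s ne)))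
      atℓ : ∀ ℓ a s → k ≤ ℓ → constrainAt ℓ (parksIn p') (skipCarFilled k direct) ℓ a s ≡ ((a ≡ᵇ p') ∧ (ℓ <ᵇ i')) ∧ (s ≡ᵇ p')
      atℓ ℓ a s k≤ℓ = trans (constrainAt-same ℓ (parksIn p') (skipCarFilled k direct) a s) (trans (cong (λ z → (if z then direct ℓ a s ∧ not (s ≡ᵇ p') else viaLast direct (suc ℓ) a s) ∧ (s ≡ᵇ p')) (≥⇒<ᵇ≡false ℓ k k≤ℓ))
          (cs (s ≡ᵇ p') refl))
        where
        cs : ∀ b → b ≡ (s ≡ᵇ p') → viaLast direct (suc ℓ) a s ∧ b ≡ ((a ≡ᵇ p') ∧ (ℓ <ᵇ i')) ∧ b
        cs true e = cong (_∧ true) (trans (cong (λ z → if z then (a ≡ᵇ p') ∧ direct (suc ℓ) p p' else direct (suc ℓ) a s) (sym e)) (cong ((a ≡ᵇ p') ∧_) (direct-later ℓ k≤ℓ)))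
        cs false e = trans (∧-zeroʳ _) (sym (∧-zeroʳ _))
      lowℓ : ∀ ℓ → 1 ≤ ℓ → ℓ < k → H ℓ ≡ 0
      lowℓ ℓ l1 ℓ<k = sumPrefs-impossible p' ℓ (constrainAt ℓ (parksIn p') (skipCarFilled k direct)) anyOutcome l1 (≤-pred (≤-trans ℓ<k (≤-trans k≤i' hi)))
        (λ a s → trans (constrainAt-same ℓ (parksIn p') (skipCarFilled k direct) a s) (trans (cong (λ z → (if z then direct ℓ a s ∧ not (s ≡ᵇ p') else viaLast direct (suc ℓ) a s) ∧ (s ≡ᵇ p')) (<⇒<ᵇ≡true ℓ k ℓ<k)) (x∧¬b∧b≡false (direct ℓ a s) (s ≡ᵇ p'))))
      highℓ : ∀ ℓ → i' ≤ ℓ → ℓ ≤ p' → H ℓ ≡ 0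
      highℓ ℓ i'≤ℓ ℓ≤ = sumPrefs-impossible p' ℓ (constrainAt ℓ (parksIn p') (skipCarFilled k direct)) anyOutcome (≤-trans 1≤k (≤-trans k≤i' i'≤ℓ)) ℓ≤
        (λ a s → trans (atℓ ℓ a s (≤-trans k≤i' i'≤ℓ)) (trans (cong (λ z → ((a ≡ᵇ p') ∧ z) ∧ (s ≡ᵇ p')) (≥⇒<ᵇ≡false ℓ i' i'≤ℓ)) (cong (_∧ (s ≡ᵇ p')) (∧-zeroʳ (a ≡ᵇ p')))))
      midℓ : ∀ ℓ → k ≤ ℓ → ℓ < i' → H ℓ ≡ vpfR p' ℓ
      midℓ ℓ k≤ℓ ℓ<i' = trans (sumPrefs-cong-unique p' (constrainAt ℓ (parksIn p') (skipCarFilled k direct)) (carPrefersParksIn ℓ p') anyOutcome ℓ p' (≤-trans 1≤k k≤ℓ) ℓ≤p' atq ht oth) (sym (vpfR≡sumPrefs-run p' ℓ (≤-trans 1≤k k≤ℓ) ℓ≤p'))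
        where
        ℓ≤p' : ℓ ≤ p'
        ℓ≤p' = ≤-pred (≤-trans ℓ<i' hi)
        atq : ∀ a s → constrainAt ℓ (parksIn p') (skipCarFilled k direct) ℓ a s ≡ carPrefersParksIn ℓ p' ℓ a s
        atq a s = trans (atℓ ℓ a s k≤ℓ) (trans (cong (λ z → ((a ≡ᵇ p') ∧ z) ∧ (s ≡ᵇ p')) (<⇒<ᵇ≡true ℓ i' ℓ<i')) (trans (cong (_∧ (s ≡ᵇ p')) (∧-identityʳ (a ≡ᵇ p'))) (sym (constrainAt-same ℓ (prefersParksIn p') unconstrained a s))))
        ht : ∀ a s → constrainAt ℓ (parksIn p') (skipCarFilled k direct) ℓ a s ≡ true → s ≡ p'
        ht a s e = ≡ᵇ≡true⇒≡ s p' (∧≡true⇒ʳ _ _ (trans (sym (constrainAt-same ℓ (parksIn p') (skipCarFilled k direct) a s)) e))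
        oth : ∀ j a s → s ≢ p' → constrainAt ℓ (parksIn p') (skipCarFilled k direct) j a s ≡ carPrefersParksIn ℓ p' j a s
        oth j a s ne = trans (cong (_∧ (if j ≡ᵇ ℓ then s ≡ᵇ p' else true)) (skipCarFilled-elsewhere j a s ne))
          (trans (cong (λ z → true ∧ (if j ≡ᵇ ℓ then z else true)) (≢⇒≡ᵇ≡false s p' ne))
            (sym (trans (cong (λ z → true ∧ (if j ≡ᵇ ℓ then (a ≡ᵇ p') ∧ z else true)) (≢⇒≡ᵇ≡false s p' ne)) (cong (λ z → true ∧ (if j ≡ᵇ ℓ then z else true)) (∧-zeroʳ (a ≡ᵇ p'))))))
    byLastCar-direct : sumPrefs p p (λ w → 𝟙 (run p [] w direct 1 anyOutcome)) ≡ sumFrom 1 (i' ∸ 1) (λ ℓ → vpfI p' ℓ) + sumFrom k (i' ∸ k) (λ ℓ → vpfR p' ℓ)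
    byLastCar-direct = trans (countBig-remove p' [] 1 refl 1≤k k≤p) (cong₂ _+_ removed-rest removed-viaLast)
    byLastCar-early : byLastCar k ≡ vpfS p k + sumFrom 1 (i' ∸ 1) (λ ℓ → vpfI p' ℓ) + sumFrom k (i' ∸ k) (λ ℓ → vpfR p' ℓ)
    byLastCar-early = begin
        byLastCar k
          ≡⟨ sumPrefs-cong-unique p (constrainAt k (parksIn p) (avoidsLastTwoFrom p i)) (constrainAt k (parksIn p) (lastTakenBefore p' i)) anyOutcome k p 1≤k k≤p avoids≡lastTakenBefore-at (λ a s e → ≡ᵇ≡true⇒≡ s p (∧≡true⇒ʳ _ _ (trans (sym (constrainAt-same k (parksIn p) (avoidsLastTwoFrom p i) a s)) e))) avoids≡lastTakenBefore-elsewhere ⟩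
        sumPrefs p p (λ w → 𝟙 (run p [] w (constrainAt k (parksIn p) (lastTakenBefore p' i)) 1 anyOutcome))
          ≡⟨ sumPrefs-cong p p _ _ (λ w iw lw → run-split-constraint p [] w (lastTakenBefore p' i) 1 anyOutcome k (parksIn p) (prefersParksIn p) (prefersLeftParksIn p) iw 1≤k (s≤s (subst (k ≤_) (sym lw) k≤p)) (λ a s _ a≤ _ _ adj → parksIn-last-split p a s (s≤s z≤n) a≤ adj)) ⟩
        sumPrefs p p (λ w → 𝟙 (run p [] w (constrainAt k (prefersParksIn p) (lastTakenBefore p' i)) 1 anyOutcome) + 𝟙 (run p [] w (constrainAt k (prefersLeftParksIn p) (lastTakenBefore p' i)) 1 anyOutcome))
          ≡⟨ sumPrefs-+ p p _ _ ⟩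
        sumPrefs p p (λ w → 𝟙 (run p [] w direct 1 anyOutcome)) + sumPrefs p p (λ w → 𝟙 (run p [] w (constrainAt k (prefersLeftParksIn p) (lastTakenBefore p' i)) 1 anyOutcome))
          ≡⟨ cong₂ _+_ byLastCar-direct byLastCar-fromLeft ⟩
        (sumFrom 1 (i' ∸ 1) (λ ℓ → vpfI p' ℓ) + sumFrom k (i' ∸ k) (λ ℓ → vpfR p' ℓ)) + vpfS p k
          ≡⟨ +-comm _ (vpfS p k) ⟩
        vpfS p k + (sumFrom 1 (i' ∸ 1) (λ ℓ → vpfI p' ℓ) + sumFrom k (i' ∸ k) (λ ℓ → vpfR p' ℓ))
          ≡⟨ sym (+-assoc (vpfS p k) _ _) ⟩
        vpfS p k + sumFrom 1 (i' ∸ 1) (λ ℓ → vpfI p' ℓ) + sumFrom k (i' ∸ k) (λ ℓ → vpfR p' ℓ) ∎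

sumPrefs-avoidsLastTwo : ∀ p' → 2 ≤ p' → ∀ i' → i' ≤ suc p' →
  sumPrefs (suc p') (suc p') (λ w → 𝟙 (run (suc p') [] w (avoidsLastTwoFrom (suc p') (suc i')) 1 anyOutcome))
  ≡ sumFrom 1 i' (λ k → vpfS (suc p') k + sumFrom 1 (i' ∸ 1) (λ ℓ → vpfI p' ℓ) + sumFrom k (i' ∸ k) (λ ℓ → vpfR p' ℓ))
sumPrefs-avoidsLastTwo p' hp' i' hi = begin
  sumPrefs p p (λ w → 𝟙 (run p [] w (avoidsLastTwoFrom p i) 1 anyOutcome))
    ≡⟨ sumPrefs-by-car-at p p (avoidsLastTwoFrom p i) (s≤s z≤n) ≤-refl ⟩
  sumFrom 1 p byLastCar
    ≡⟨ sumFrom-truncate 1 p i' byLastCar hi byLastCar-late ⟩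
  sumFrom 1 i' byLastCar
    ≡⟨ sumFrom-cong 1 i' byLastCar _ (λ k h1 h2 → byLastCar-early k h1 (≤-pred h2)) ⟩
  sumFrom 1 i' (λ k → vpfS p k + sumFrom 1 (i' ∸ 1) (λ ℓ → vpfI p' ℓ) + sumFrom k (i' ∸ k) (λ ℓ → vpfR p' ℓ)) ∎
  where open CarTakingLastSpot p' hp' i' hi

vpfS-suc : ∀ p → 3 ≤ p → ∀ i → 1 ≤ i → i ≤ suc p →
  vpfS (suc p) i ≡ sumFrom 1 (i ∸ 1) (λ k → vpfS p k + sumFrom 1 (i ∸ 2) (vpfI (p ∸ 1)) + sumFrom k (i ∸ 1 ∸ k) (vpfR (p ∸ 1)))
vpfS-suc p@(suc p') (s≤s 2≤p') i@(suc i') 1≤i i≤p+1 = begin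
  vpfS (suc p) i
    ≡⟨ vpfS-suc≡avoidsLastTwo p (≤-trans (n≤1+n 2) (s≤s 2≤p')) i 1≤i i≤p+1 ⟩
  sumPrefs p p (λ w → 𝟙 (run p [] w (avoidsLastTwoFrom p i) 1 anyOutcome))
    ≡⟨ sumPrefs-avoidsLastTwo p' 2≤p' i' (≤-pred i≤p+1) ⟩
  sumFrom 1 i' (λ k → vpfS p k + sumFrom 1 (i' ∸ 1) (vpfI p') + sumFrom k (i' ∸ k) (vpfR p')) ∎

vpfR-recurrence : ∀ n i → 3 ≤ n → 1 ≤ i → i ≤ n →
  vpfR n i ≡ vpf (n ∸ 1) + (n ∸ i) * vpf (n ∸ 2) + sumRange i (n ∸ 2) (λ ℓ → (ℓ + 1 ∸ i) * vpfR (n ∸ 2) ℓ)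
vpfR-recurrence n@(suc p@(suc p₁)) i (s≤s (s≤s (s≤s _))) 1≤i i≤n = begin
  vpfR n i
    ≡⟨ vpfR-suc p (s≤s z≤n) i 1≤i i≤n ⟩
  vpf p + sumFrom i (n ∸ i) (vpfR p)
    ≡⟨ cong (vpf p +_) (sumFrom-cong i (n ∸ i) _ _ (λ j i≤j j< → vpfR-suc p₁ (s≤s z≤n) j (≤-trans 1≤i i≤j) (≤-pred (subst (j <_) (m+[n∸m]≡n i≤n) j<)))) ⟩
  vpf p + sumFrom i (n ∸ i) (λ j → vpf p₁ + sumFrom j (p ∸ j) (vpfR p₁))
    ≡⟨ cong (vpf p +_) (trans (sumFrom-+ i (n ∸ i) _ _) (cong (_+ sumFrom i (n ∸ i) (λ j → sumFrom j (p ∸ j) (vpfR p₁))) (sumFrom-const i (n ∸ i) (vpf p₁)))) ⟩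
  vpf p + ((n ∸ i) * vpf p₁ + sumFrom i (n ∸ i) (λ j → sumFrom j (p ∸ j) (vpfR p₁)))
    ≡⟨ sym (+-assoc (vpf p) _ _) ⟩
  vpf p + (n ∸ i) * vpf p₁ + sumFrom i (n ∸ i) (λ j → sumFrom j (p ∸ j) (vpfR p₁))
    ≡⟨ cong (vpf p + (n ∸ i) * vpf p₁ +_) (sumFrom-pyramid i p (vpfR p₁) i≤n) ⟩
  vpf p + (n ∸ i) * vpf p₁ + sumFrom i (p ∸ i) (λ ℓ → (suc ℓ ∸ i) * vpfR p₁ ℓ)
    ≡⟨ cong (vpf p + (n ∸ i) * vpf p₁ +_) (sym (trans (sumRange≡sumFrom i p₁ _) (sumFrom-cong i (p ∸ i) _ _ (λ ℓ _ _ → cong (λ x → (x ∸ i) * vpfR p₁ ℓ) (+-comm ℓ 1))))) ⟩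
  vpf p + (n ∸ i) * vpf p₁ + sumRange i p₁ (λ ℓ → (ℓ + 1 ∸ i) * vpfR p₁ ℓ) ∎

vpfS-recurrence : ∀ n i → 4 ≤ n → 1 ≤ i → i ≤ n →
  vpfS n i ≡ ((i ∸ 1) * (i ∸ 2)) / 2 * vpf (n ∸ 3)
             + sumRange 1 (i ∸ 1) (λ ℓ → vpfS (n ∸ 1) ℓ)
             + (i ∸ 1) * sumRange 1 (i ∸ 2) (λ ℓ → vpfI (n ∸ 2) ℓ)
             + sumRange 1 (i ∸ 3) (λ ℓ → ((ℓ * (ℓ + 1)) / 2) * vpfR (n ∸ 3) ℓ)
             + ((i ∸ 2) * (i ∸ 1)) / 2 * sumRange (i ∸ 2) (n ∸ 3) (λ ℓ → vpfR (n ∸ 3) ℓ)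
vpfS-recurrence n@(suc p@(suc p'@(suc p''))) i@(suc i') 4≤n@(s≤s (s≤s (s≤s (s≤s _)))) 1≤i i≤n = begin
  vpfS n i
    ≡⟨ vpfS-suc p (≤-pred 4≤n) i 1≤i i≤n ⟩
  sumFrom 1 i' (λ k → vpfS p k + SI + sumFrom k (i' ∸ k) (vpfR p'))
    ≡⟨ trans (sumFrom-+ 1 i' _ _) (cong (_+ sumFrom 1 i' (λ k → sumFrom k (i' ∸ k) (vpfR p'))) (trans (sumFrom-+ 1 i' _ _) (cong (SS +_) (sumFrom-const 1 i' SI)))) ⟩
  SS + i' * SI + sumFrom 1 i' (λ k → sumFrom k (i' ∸ k) (vpfR p'))
    ≡⟨ cong (SS + i' * SI +_) (trans (sumFrom-pyramid 1 i' (vpfR p') (s≤s z≤n)) weighted-vpfR) ⟩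
  SS + i' * SI + (triangular c * V + sumFrom 1 c (λ ℓ → ℓ * sumFrom ℓ (p' ∸ ℓ) g))
    ≡⟨ cong (λ x → SS + i' * SI + (triangular c * V + x)) (sumFrom-weighted-tails p' c g c≤p') ⟩
  SS + i' * SI + (triangular c * V + (A + B))
    ≡⟨ solve 5 (λ a b x y z → a :+ b :+ (x :+ (y :+ z)) := x :+ a :+ b :+ y :+ z) refl SS (i' * SI) (triangular c * V) A B ⟩
  triangular c * V + SS + i' * SI + A + B
    ≡⟨ cong₂ (λ x y → x * V + y + i' * SI + A + B) (sym (triangular≡/2 c (i' * c) (*-pred-comm i'))) (sym (sumRange≡sumFrom 1 i' _)) ⟩
  (i' * c) / 2 * V + sumRange 1 i' (vpfS p) + i' * SI + A + B
    ≡⟨ cong₂ (λ x y → (i' * c) / 2 * V + sumRange 1 i' (vpfS p) + i' * x + y + B) (sym (sumRange≡sumFrom 1 c _)) A≡ ⟩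
  (i' * c) / 2 * V + sumRange 1 i' (vpfS p) + i' * sumRange 1 c (vpfI p') + sumRange 1 (i' ∸ 2) (λ ℓ → ((ℓ * (ℓ + 1)) / 2) * g ℓ) + B
    ≡⟨ cong ((i' * c) / 2 * V + sumRange 1 i' (vpfS p) + i' * sumRange 1 c (vpfI p') + sumRange 1 (i' ∸ 2) (λ ℓ → ((ℓ * (ℓ + 1)) / 2) * g ℓ) +_) B≡ ⟩
  (i' * c) / 2 * V + sumRange 1 i' (vpfS p) + i' * sumRange 1 c (vpfI p') + sumRange 1 (i' ∸ 2) (λ ℓ → ((ℓ * (ℓ + 1)) / 2) * g ℓ)
    + (c * i') / 2 * sumRange c p'' g ∎
  where
  open +-*-Solver
  c V : ℕ
  c = i' ∸ 1
  V = vpf p''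
  g : ℕ → ℕ
  g = vpfR p''
  SS SI A B : ℕ
  SS = sumFrom 1 i' (vpfS p)
  SI = sumFrom 1 c (vpfI p')
  A = sumFrom 1 (c ∸ 1) (λ ℓ → triangular ℓ * g ℓ)
  B = triangular c * sumFrom c (p' ∸ c) g
  c≤p' : c ≤ p'
  c≤p' = ∸-monoˡ-≤ 1 (≤-pred i≤n)
  weighted-vpfR : sumFrom 1 c (λ ℓ → ℓ * vpfR p' ℓ) ≡ triangular c * V + sumFrom 1 c (λ ℓ → ℓ * sumFrom ℓ (p' ∸ ℓ) g)
  weighted-vpfR = begin
    sumFrom 1 c (λ ℓ → ℓ * vpfR p' ℓ)
      ≡⟨ sumFrom-cong 1 c _ _ (λ ℓ 1≤ℓ ℓ< → cong (ℓ *_) (vpfR-suc p'' (s≤s z≤n) ℓ 1≤ℓ (≤-trans (≤-pred ℓ<) c≤p'))) ⟩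
    sumFrom 1 c (λ ℓ → ℓ * (V + sumFrom ℓ (p' ∸ ℓ) g))
      ≡⟨ trans (sumFrom-cong 1 c _ _ (λ ℓ _ _ → *-distribˡ-+ ℓ V _)) (sumFrom-+ 1 c _ _) ⟩
    sumFrom 1 c (λ ℓ → ℓ * V) + sumFrom 1 c (λ ℓ → ℓ * sumFrom ℓ (p' ∸ ℓ) g)
      ≡⟨ cong (_+ sumFrom 1 c (λ ℓ → ℓ * sumFrom ℓ (p' ∸ ℓ) g)) (sumFrom-*ʳ 1 c (λ ℓ → ℓ) V) ⟩
    triangular c * V + sumFrom 1 c (λ ℓ → ℓ * sumFrom ℓ (p' ∸ ℓ) g) ∎
  A≡ : A ≡ sumRange 1 (i' ∸ 2) (λ ℓ → ((ℓ * (ℓ + 1)) / 2) * g ℓ)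
  A≡ = trans (cong (λ k → sumFrom 1 k (λ ℓ → triangular ℓ * g ℓ)) (∸-+-assoc i' 1 1))
    (trans (sumFrom-cong 1 (i' ∸ 2) _ _ (λ ℓ _ _ → cong (_* g ℓ) (sym (triangular≡/2 ℓ (ℓ * (ℓ + 1)) (cong (ℓ *_) (+-comm ℓ 1))))))
           (sym (sumRange≡sumFrom 1 (i' ∸ 2) (λ ℓ → ((ℓ * (ℓ + 1)) / 2) * g ℓ))))
  B≡ : B ≡ (c * i') / 2 * sumRange c p'' g
  B≡ = cong₂ _*_ (sym (triangular≡/2 c (c * i') (trans (*-comm c i') (*-pred-comm i')))) (sym (sumRange≡sumFrom c p'' g))

theorem2p1 : ((n i : ℕ) → 4 ≤ n → 1 ≤ i → i ≤ n →
    (vpf n ≡ sumRange 1 n (λ j → vpfI n j))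
    × (vpfI n i ≡ vpfR n i + vpfS n i)
    × (vpfR n i ≡ vpf (n ∸ 1) + (n ∸ i) * vpf (n ∸ 2)
    + sumRange i (n ∸ 2) (λ ℓ → (ℓ + 1 ∸ i) * vpfR (n ∸ 2) ℓ))
    × (vpfS n i ≡ ((i ∸ 1) * (i ∸ 2)) / 2 * vpf (n ∸ 3)
    + sumRange 1 (i ∸ 1) (λ ℓ → vpfS (n ∸ 1) ℓ)
    + (i ∸ 1) * sumRange 1 (i ∸ 2) (λ ℓ → vpfI (n ∸ 2) ℓ)
    + sumRange 1 (i ∸ 3) (λ ℓ → ((ℓ * (ℓ + 1)) / 2) * vpfR (n ∸ 3) ℓ)
    + ((i ∸ 2) * (i ∸ 1)) / 2 * sumRange (i ∸ 2) (n ∸ 3) (λ ℓ → vpfR (n ∸ 3) ℓ)))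
    × (vpfR 1 1 ≡ 1) × (vpfR 2 2 ≡ 1) × (vpfR 2 1 ≡ 2)
    × (vpfR 3 1 ≡ 7) × (vpfR 3 2 ≡ 5) × (vpfR 3 3 ≡ 4)
    × (vpfS 1 1 ≡ 0) × (vpfS 2 1 ≡ 0) × (vpfS 3 1 ≡ 0) × (vpfS 3 2 ≡ 0)
    × (vpfS 2 2 ≡ 1) × (vpfS 3 3 ≡ 4)
theorem2p1 =
  (λ n i 4≤n 1≤i i≤n →
    vpf≡sum-vpfI n (≤-trans 1≤i i≤n) ,
    vpfI≡vpfR+vpfS n i 1≤i i≤n ,
    vpfR-recurrence n i (≤-trans (n≤1+n 3) 4≤n) 1≤i i≤n ,
    vpfS-recurrence n i 4≤n 1≤i i≤n) ,
  refl , refl , refl , refl , refl , refl , refl , refl , refl , refl , refl , refl
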